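{- Let $\mathbb{K}$ be a field of characteristic $0$ and $\mathcal{H}$ the $\mathbb{K}$-vector space freely spanned by totally assigned graphs (TAGs), with product $m\big((\Gamma_1,\mu_1),(\Gamma_2,\mu_2)\big)=(\Gamma_1\sqcup\Gamma_2,\mu_1\sqcup\mu_2)$, unit $1_{\mathcal{H}}$ the empty graph, coproduct $\Delta\big((\Gamma,\mu)\big)=\sum_{\emptyset\subseteq(\gamma,\nu)\subseteq(\Gamma,\mu)}(\gamma,\nu)\otimes(\Gamma/\gamma,\mu/\nu)$ and counit $\epsilon$ with $\epsilon(1_{\mathcal{H}})=1$ and $\epsilon=0$ on all other TAGs. Then the bialgebra $(\mathcal{H},m,1_{\mathcal{H}},\Delta,\epsilon)$ is a Hopf algebra. Its antipode $S$ satisfies $S(1_{\mathcal{H}})=1_{\mathcal{H}}$ and, for any non-empty TAG $(\Gamma,\mu)$, $$S(\Gamma,\mu)=-(\Gamma,\mu)-\sum_{\emptyset\subsetneq(\gamma,\nu)\subsetneq(\Gamma,\mu)}S(\gamma,\nu)\cdot(\Gamma/\gamma,\mu/\nu)=-(\Gamma,\mu)-\sum_{\emptyset\subsetneq(\gamma,\nu)\subsetneq(\Gamma,\mu)}(\gamma,\nu)\cdot S(\Gamma/\gamma,\mu/\nu).$$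
   Context: Graphs are finite, possibly disconnected, with loops and multiple edges allowed; $E(\Gamma)$ is the edge set. A TAG is a pair $(\Gamma,\mu)$ where $\mu$ is a total order on $E(\Gamma)$. $\mu_1\sqcup\mu_2$ is the ordinal sum order: it restricts to $\mu_i$ on $E(\Gamma_i)$ and every edge of $\Gamma_1$ precedes every edge of $\Gamma_2$. A subgraph $\gamma$ of $\Gamma$ is formed by a subset of $E(\Gamma)$ together with the vertices incident to these edges; a totally assigned subgraph $(\gamma,\nu)$ carries $\nu=\mu|_{E(\gamma)}$. The shrinking $(\Gamma/\gamma,\mu/\nu)$: contract each connected component of $\gamma$ to a point, and restrict $\mu$ to the edges of $\Gamma$ not in $\gamma$. The product $\cdot$ is $m$. -}

module Defs where

open import Level using (Level)
open import Data.Nat as N using (ℕ; zero; suc; _≡ᵇ_; _<ᵇ_)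
open import Data.Bool using (Bool; true; false; if_then_else_; _∧_; _∨_; not)
open import Data.Product using (_×_; _,_; proj₁; proj₂; Σ)
open import Data.List using (List; []; _∷_; _++_; map; concatMap; foldr; length)
open import Data.Maybe using (Maybe; just; nothing)
open import Relation.Nullary using (¬_)
open import Relation.Binary.PropositionalEquality using (_≡_)
open import Algebra.Bundles using (CommutativeRing)

module _ {c ℓ : Level} (K : CommutativeRing c ℓ) where
  open CommutativeRing K

  natK : ℕ → Carrier
  natK zero    = 0#
  natK (suc n) = 1# + natK n

  IsField : Set (c Level.⊔ ℓ)
  IsField = (¬ (1# ≈ 0#)) × ((x : Carrier) → ¬ (x ≈ 0#) → Σ Carrier (λ y → (x * y) ≈ 1#))

  CharZero : Set ℓ
  CharZero = (n : ℕ) → ¬ (natK (suc n) ≈ 0#)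

-- A raw TAG is the list of its edges in the order μ (first = smallest);
-- an edge is a pair of vertex labels (an unordered pair; loops a = a allowed,
-- multiple edges allowed).  Vertices are exactly those incident to edges
-- (graphs are considered without isolated vertices).
-- The empty list is the empty graph 1_H.

Edge : Set
Edge = ℕ × ℕ

RawTAG : Set
RawTAG = List Edge

eqEdge : Edge → Edge → Bool
eqEdge (a , b) (c , d) = (a ≡ᵇ c) ∧ (b ≡ᵇ d)

eqRaw : RawTAG → RawTAG → Bool
eqRaw [] [] = true
eqRaw (e ∷ es) (f ∷ fs) = eqEdge e f ∧ eqRaw es fs
eqRaw _ _ = false

ltEdge : Edge → Edge → Bool
ltEdge (a , b) (c , d) = (a <ᵇ c) ∨ ((a ≡ᵇ c) ∧ (b <ᵇ d))

leqRaw : RawTAG → RawTAG → Bool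
leqRaw [] _ = true
leqRaw (_ ∷ _) [] = false
leqRaw (e ∷ es) (f ∷ fs) = ltEdge e f ∨ (eqEdge e f ∧ leqRaw es fs)

minRaw : RawTAG → List RawTAG → RawTAG
minRaw m [] = m
minRaw m (g ∷ gs) = minRaw (if leqRaw g m then g else m) gs

lookupL : List (ℕ × ℕ) → ℕ → Maybe ℕ
lookupL [] _ = nothing
lookupL ((x , y) ∷ r) v = if x ≡ᵇ v then just y else lookupL r v

-- unordered pair normalised as (min , max)
mkEdge : ℕ → ℕ → Edge
mkEdge a b = if b <ᵇ a then (b , a) else (a , b)

-- all relabellings of the vertices by order of first appearance
-- (scanning edges in the order μ); when an edge has two distinct new
-- endpoints both choices are produced.
relabels : List (ℕ × ℕ) → ℕ → RawTAG → List RawTAG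
relabels ρ n [] = [] ∷ []
relabels ρ n ((a , b) ∷ es) with lookupL ρ a | lookupL ρ b
... | just x | just y = map (mkEdge x y ∷_) (relabels ρ n es)
... | just x | nothing = map (mkEdge x n ∷_) (relabels ((b , n) ∷ ρ) (suc n) es)
... | nothing | just y = map (mkEdge n y ∷_) (relabels ((a , n) ∷ ρ) (suc n) es)
... | nothing | nothing =
  if a ≡ᵇ b
  then map ((n , n) ∷_) (relabels ((a , n) ∷ ρ) (suc n) es)
  else (map ((n , suc n) ∷_) (relabels ((b , suc n) ∷ (a , n) ∷ ρ) (suc (suc n)) es)
        ++ map ((n , suc n) ∷_) (relabels ((a , suc n) ∷ (b , n) ∷ ρ) (suc (suc n)) es))

-- canonical representative of the isomorphism class of a TAG
-- (isomorphism = vertex bijection sending the i-th edge to the i-th edge):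
-- lexicographically least first-appearance relabelling.
canon : RawTAG → RawTAG
canon g = minRaw (mkEdgeList g) (relabels [] 0 g)
  where
  mkEdgeList : RawTAG → RawTAG
  mkEdgeList [] = []
  mkEdgeList ((a , b) ∷ es) = mkEdge a b ∷ mkEdgeList es

isoᵇ : RawTAG → RawTAG → Bool
isoᵇ g h = eqRaw (canon g) (canon h)

-- Product: disjoint union with the ordinal-sum order

maxV : RawTAG → ℕ
maxV [] = 0
maxV ((a , b) ∷ es) = a N.⊔ b N.⊔ maxV es

shiftV : ℕ → RawTAG → RawTAG
shiftV k = map (λ { (a , b) → (k N.+ a , k N.+ b) })

_⊔ᵍ_ : RawTAG → RawTAG → RawTAG
g ⊔ᵍ h = g ++ shiftV (suc (maxV g)) h

masks : ℕ → List (List Bool)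
masks zero = [] ∷ []
masks (suc n) = map (true ∷_) (masks n) ++ map (false ∷_) (masks n)

select : Bool → List Bool → RawTAG → RawTAG
select v [] _ = []
select v (_ ∷ _) [] = []
select v (m ∷ ms) (e ∷ es) = if eqB m v then e ∷ select v ms es else select v ms es
  where
  eqB : Bool → Bool → Bool
  eqB true true = true
  eqB false false = true
  eqB _ _ = false

subG : List Bool → RawTAG → RawTAG
subG = select true

-- vertex map contracting each connected component of γ to a point
contractMap : RawTAG → ℕ → ℕ
contractMap [] v = v
contractMap ((a , b) ∷ es) = merge (contractMap es)
  where
  merge : (ℕ → ℕ) → ℕ → ℕ
  merge ρ v = if ρ v ≡ᵇ ρ b then ρ a else ρ v

quotG : List Bool → RawTAG → RawTAG
quotG m g = map (λ { (a , b) → (ρ a , ρ b) }) (select false m g)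
  where
  ρ : ℕ → ℕ
  ρ = contractMap (subG m g)

allMasks : RawTAG → List (List Bool)
allMasks g = masks (length g)

subPairs : RawTAG → List (RawTAG × RawTAG)
subPairs g = map (λ m → (subG m g , quotG m g)) (allMasks g)

orB : List Bool → Bool
orB [] = false
orB (b ∷ bs) = b ∨ orB bs

filterB : {A : Set} → (A → Bool) → List A → List A
filterB p [] = []
filterB p (x ∷ xs) = if p x then x ∷ filterB p xs else filterB p xs

strictSubPairs : RawTAG → List (RawTAG × RawTAG)
strictSubPairs g =
  map (λ m → (subG m g , quotG m g))
      (filterB (λ m → orB m ∧ orB (map not m)) (allMasks g))

module Hopf {c ℓ : Level} (K : CommutativeRing c ℓ) where
  open CommutativeRing K

  FV : Set → Set c
  FV B = List (Carrier × B)

  coeff : {B : Set} → (B → B → Bool) → B → FV B → Carrier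
  coeff eq t [] = 0#
  coeff eq t ((x , b) ∷ r) = (if eq b t then x else 0#) + coeff eq t r

  EqV : {B : Set} → (B → B → Bool) → FV B → FV B → Set ℓ
  EqV eq u v = ∀ t → coeff eq t u ≈ coeff eq t v

  eq1 : RawTAG → RawTAG → Bool
  eq1 = isoᵇ

  eq2 : RawTAG × RawTAG → RawTAG × RawTAG → Bool
  eq2 (a , b) (a' , b') = isoᵇ a a' ∧ isoᵇ b b'

  eq3 : RawTAG × RawTAG × RawTAG → RawTAG × RawTAG × RawTAG → Bool
  eq3 (a , b , d) (a' , b' , d') = isoᵇ a a' ∧ isoᵇ b b' ∧ isoᵇ d d'

  H : Set c
  H = FV RawTAG

  _≈H_ : H → H → Set ℓ
  _≈H_ = EqV eq1

  _≈H⊗H_ : FV (RawTAG × RawTAG) → FV (RawTAG × RawTAG) → Set ℓ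
  _≈H⊗H_ = EqV eq2

  _≈H⊗H⊗H_ : FV (RawTAG × RawTAG × RawTAG) → FV (RawTAG × RawTAG × RawTAG) → Set ℓ
  _≈H⊗H⊗H_ = EqV eq3

  vec : {B : Set} → B → FV B
  vec b = (1# , b) ∷ []

  scaleV : {B : Set} → Carrier → FV B → FV B
  scaleV k = map (λ { (x , b) → (k * x , b) })

  _+V_ : {B : Set} → FV B → FV B → FV B
  u +V v = u ++ v

  -V_ : {B : Set} → FV B → FV B
  -V u = map (λ { (x , b) → (- x , b) }) u

  sumV : {B : Set} → List (FV B) → FV B
  sumV = foldr _+V_ []

  extend : {A B : Set} → (A → FV B) → FV A → FV B
  extend f u = concatMap (λ { (x , a) → scaleV x (f a) }) u

  oneH : H
  oneH = vec []

  _·_ : H → H → H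
  u · v = extend (λ g → extend (λ h → vec (g ⊔ᵍ h)) v) u

  _·₂_ : FV (RawTAG × RawTAG) → FV (RawTAG × RawTAG) → FV (RawTAG × RawTAG)
  u ·₂ v = extend (λ { (g , g') → extend (λ { (h , h') → vec (g ⊔ᵍ h , g' ⊔ᵍ h') }) v }) u

  Δ : RawTAG → FV (RawTAG × RawTAG)
  Δ g = map (λ p → (1# , p)) (subPairs g)

  ε : RawTAG → Carrier
  ε [] = 1#
  ε (_ ∷ _) = 0#

  εV : H → Carrier
  εV [] = 0#
  εV ((x , g) ∷ r) = (x * ε g) + εV r

  _⊗map_ : {A B C D : Set} → (A → FV C) → (B → FV D) → FV (A × B) → FV (C × D)
  (f ⊗map g) = extend (λ { (a , b) → extend (λ x → extend (λ y → vec (x , y)) (g b)) (f a) })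

  idB : {B : Set} → B → FV B
  idB = vec

  conv : (RawTAG → H) → (RawTAG → H) → RawTAG → H
  conv f g t = extend (λ { (a , b) → vec (a ⊔ᵍ b) }) ((f ⊗map g) (Δ t))

  -- the bialgebra axioms for (H, m, 1, Δ, ε), checked on basis elements
  -- (all maps being linear extensions), including well-definedness on
  -- isomorphism classes
  record IsBialgebra : Set ℓ where
    field
      m-wd     : ∀ g g' h h' → isoᵇ g g' ≡ true → isoᵇ h h' ≡ true →
                 vec (g ⊔ᵍ h) ≈H vec (g' ⊔ᵍ h')
      m-assoc  : ∀ g h k → vec ((g ⊔ᵍ h) ⊔ᵍ k) ≈H vec (g ⊔ᵍ (h ⊔ᵍ k))
      m-unitˡ  : ∀ g → (oneH · vec g) ≈H vec g
      m-unitʳ  : ∀ g → (vec g · oneH) ≈H vec g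
      Δ-wd     : ∀ g g' → isoᵇ g g' ≡ true → Δ g ≈H⊗H Δ g'
      ε-wd     : ∀ g g' → isoᵇ g g' ≡ true → ε g ≈ ε g'
      coassoc  : ∀ g → extend (λ { ((a , b) , d) → vec (a , b , d) }) ((Δ ⊗map idB) (Δ g))
                       ≈H⊗H⊗H
                       extend (λ { (a , (b , d)) → vec (a , b , d) }) ((idB ⊗map Δ) (Δ g))
      counitˡ  : ∀ g → extend (λ { (a , b) → scaleV (ε a) (vec b) }) (Δ g) ≈H vec g
      counitʳ  : ∀ g → extend (λ { (a , b) → scaleV (ε b) (vec a) }) (Δ g) ≈H vec g
      Δ-mult   : ∀ g h → Δ (g ⊔ᵍ h) ≈H⊗H (Δ g ·₂ Δ h)
      Δ-unit   : Δ [] ≈H⊗H vec ([] , [])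
      ε-mult   : ∀ g h → ε (g ⊔ᵍ h) ≈ (ε g * ε h)
      ε-unit   : ε [] ≈ 1#

  record IsAntipode (S : RawTAG → H) : Set ℓ where
    field
      S-wd : ∀ g g' → isoᵇ g g' ≡ true → S g ≈H S g'
      S-left  : ∀ g → conv S idB g ≈H scaleV (ε g) oneH
      S-right : ∀ g → conv idB S g ≈H scaleV (ε g) oneH

  record AntipodeFormulas (S : RawTAG → H) : Set ℓ where
    field
      S-one : S [] ≈H oneH
      S-rec-left  : ∀ e es → let g = e ∷ es in
        S g ≈H ((-V vec g) +V (-V sumV (map (λ { (γ , q) → S γ · vec q }) (strictSubPairs g))))
      S-rec-right : ∀ e es → let g = e ∷ es in
        S g ≈H ((-V vec g) +V (-V sumV (map (λ { (γ , q) → vec γ · S q }) (strictSubPairs g))))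

{-# OPTIONS --safe #-}
module Submission where

-- A TAG is stored as its edge list in the order μ, and two lists are identified when their
-- canonical forms agree: the lexicographically least first-appearance relabelling, which
-- depends only on which vertices a relabelling identifies and on the orientation of edges.
-- Equality in the vector space spanned by the isomorphism classes is tested by pairing with
-- isomorphism-invariant coefficient functions, which reduces every axiom to statements about
-- edge lists: a product is a shifted concatenation, the vertices identified by a shrinking are
-- the connected components of the contracted edges, nested subgraphs γ' ⊆ γ ⊆ Γ are ternary
-- masks on the edges of Γ (coassociativity), and a mask of Γ₁ ⊔ Γ₂ is a pair of masks
-- (multiplicativity).
--
-- The bialgebra is graded by the number of edges and connected, so the two recursions
-- S Γ = - Γ - Σ S γ · Γ/γ and S' Γ = - Γ - Σ γ · S' (Γ/γ) define a left and a right
-- convolution inverse of the identity; they agree because convolution is associative.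
-- Conversely, for any antipode the identities S ⋆ id = ε 1 = id ⋆ S at a non-empty TAG
-- are the two recursive formulas.

open import Defs
open import Level using (Level)
open import Algebra.Bundles using (CommutativeRing)
open import Data.Product using (_×_; Σ; _,_)

module LexOrder where

  open import Data.Nat using (ℕ; zero; suc; _≡ᵇ_; _<ᵇ_; _<_)
  open import Data.Nat.Properties using (≡ᵇ⇒≡; <ᵇ⇒<; <⇒<ᵇ; <-irrefl; <-asym; <-trans; <-cmp)
  open import Data.Bool using (true; false; _∧_; T)
  open import Data.Product using (_×_; _,_)
  open import Data.Sum using (_⊎_; inj₁; inj₂)
  open import Data.List using ([]; _∷_)
  open import Data.List.Relation.Unary.Any using (here; there)
  open import Data.List.Membership.Propositional using (_∈_)
  open import Data.Empty using (⊥-elim)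
  open import Data.Unit using (tt)
  open import Function.Bundles using (_⇔_; Equivalence)
  open import Relation.Nullary using (¬_)
  open import Relation.Binary.Definitions using (Tri; Trichotomous; tri<; tri≈; tri>)
  open import Relation.Binary.PropositionalEquality

  true≢false : true ≢ false
  true≢false ()

  ∧-true : ∀ {x y} → x ∧ y ≡ true → (x ≡ true) × (y ≡ true)
  ∧-true {true} {true} _ = refl , refl

  ≡ᵇ-refl : ∀ n → (n ≡ᵇ n) ≡ true
  ≡ᵇ-refl zero = refl
  ≡ᵇ-refl (suc n) = ≡ᵇ-refl n

  ≡ᵇ-true⇒≡ : ∀ m n → (m ≡ᵇ n) ≡ true → m ≡ n
  ≡ᵇ-true⇒≡ m n eq = ≡ᵇ⇒≡ m n (subst T (sym eq) tt)

  ≢⇒≡ᵇ-false : ∀ {m n} → m ≢ n → (m ≡ᵇ n) ≡ false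
  ≢⇒≡ᵇ-false {m} {n} m≢n with m ≡ᵇ n in eq
  ... | true = ⊥-elim (m≢n (≡ᵇ-true⇒≡ m n eq))
  ... | false = refl

  ≡ᵇ-sym : ∀ m n → (m ≡ᵇ n) ≡ (n ≡ᵇ m)
  ≡ᵇ-sym zero zero = refl
  ≡ᵇ-sym zero (suc n) = refl
  ≡ᵇ-sym (suc m) zero = refl
  ≡ᵇ-sym (suc m) (suc n) = ≡ᵇ-sym m n

  data ≡ᵇ-View (m n : ℕ) : Set where
    equal    : m ≡ n → (m ≡ᵇ n) ≡ true → ≡ᵇ-View m n
    distinct : m ≢ n → (m ≡ᵇ n) ≡ false → ≡ᵇ-View m n

  ≡ᵇ-view : ∀ m n → ≡ᵇ-View m n
  ≡ᵇ-view m n with m ≡ᵇ n in eq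
  ... | true = equal (≡ᵇ-true⇒≡ m n eq) eq
  ... | false = distinct (λ { refl → true≢false (trans (sym (≡ᵇ-refl m)) eq) }) eq

  ≡ᵇ-resp-⇔ : ∀ {m n m' n'} → (m ≡ n) ⇔ (m' ≡ n') → (m ≡ᵇ n) ≡ (m' ≡ᵇ n')
  ≡ᵇ-resp-⇔ {m} {n} {m'} {n'} m≡n⇔m'≡n' with ≡ᵇ-view m n | ≡ᵇ-view m' n'
  ... | equal _ eq | equal _ eq' = trans eq (sym eq')
  ... | equal p _ | distinct p' _ = ⊥-elim (p' (Equivalence.to m≡n⇔m'≡n' p))
  ... | distinct p _ | equal p' _ = ⊥-elim (p (Equivalence.from m≡n⇔m'≡n' p'))
  ... | distinct _ eq | distinct _ eq' = trans eq (sym eq')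

  <ᵇ-true : ∀ {m n} → m < n → (m <ᵇ n) ≡ true
  <ᵇ-true {m} {n} m<n with m <ᵇ n in eq
  ... | true = refl
  ... | false = ⊥-elim (subst T eq (<⇒<ᵇ m<n))

  <ᵇ-false : ∀ {m n} → ¬ (m < n) → (m <ᵇ n) ≡ false
  <ᵇ-false {m} {n} m≮n with m <ᵇ n in eq
  ... | true = ⊥-elim (m≮n (<ᵇ⇒< m n (subst T (sym eq) tt)))
  ... | false = refl

  infix 4 _<ₑ_

  _<ₑ_ : Edge → Edge → Set
  (a , b) <ₑ (c , d) = a < c ⊎ (a ≡ c × b < d)

  <ₑ-irrefl : ∀ {e} → ¬ e <ₑ e
  <ₑ-irrefl (inj₁ a<a) = <-irrefl refl a<a
  <ₑ-irrefl (inj₂ (_ , b<b)) = <-irrefl refl b<b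

  <ₑ-asym : ∀ {e f} → e <ₑ f → ¬ f <ₑ e
  <ₑ-asym (inj₁ x) (inj₁ y) = <-asym x y
  <ₑ-asym (inj₁ x) (inj₂ (refl , _)) = <-irrefl refl x
  <ₑ-asym (inj₂ (refl , _)) (inj₁ y) = <-irrefl refl y
  <ₑ-asym (inj₂ (refl , x)) (inj₂ (_ , y)) = <-asym x y

  <ₑ-trans : ∀ {e f g} → e <ₑ f → f <ₑ g → e <ₑ g
  <ₑ-trans (inj₁ x) (inj₁ y) = inj₁ (<-trans x y)
  <ₑ-trans (inj₁ x) (inj₂ (refl , _)) = inj₁ x
  <ₑ-trans (inj₂ (refl , _)) (inj₁ y) = inj₁ y
  <ₑ-trans (inj₂ (refl , x)) (inj₂ (refl , y)) = inj₂ (refl , <-trans x y)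

  <ₑ-cmp : Trichotomous _≡_ _<ₑ_
  <ₑ-cmp (a , b) (c , d) with <-cmp a c
  ... | tri< a<c _ _ = less (inj₁ a<c)
    where less : ∀ {e f} → e <ₑ f → Tri (e <ₑ f) (e ≡ f) (f <ₑ e)
          less e<f = tri< e<f (λ { refl → <ₑ-irrefl e<f }) (<ₑ-asym e<f)
  ... | tri> _ _ c<a = tri> (<ₑ-asym (inj₁ c<a)) (λ { refl → <-irrefl refl c<a }) (inj₁ c<a)
  ... | tri≈ _ refl _ with <-cmp b d
  ...   | tri< b<d _ _ = tri< (inj₂ (refl , b<d)) (λ { refl → <-irrefl refl b<d }) (<ₑ-asym (inj₂ (refl , b<d)))
  ...   | tri≈ _ refl _ = tri≈ <ₑ-irrefl refl <ₑ-irrefl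
  ...   | tri> _ _ d<b = tri> (<ₑ-asym (inj₂ (refl , d<b))) (λ { refl → <-irrefl refl d<b }) (inj₂ (refl , d<b))

  ltEdge-true : ∀ {e f} → e <ₑ f → ltEdge e f ≡ true
  ltEdge-true {a , b} {c , d} (inj₁ a<c) rewrite <ᵇ-true a<c = refl
  ltEdge-true {a , b} {c , d} (inj₂ (refl , b<d))
    rewrite <ᵇ-false {a} {a} (<-irrefl refl) | ≡ᵇ-refl a | <ᵇ-true b<d = refl

  ltEdge-false : ∀ {e f} → ¬ e <ₑ f → ltEdge e f ≡ false
  ltEdge-false {a , b} {c , d} e≮f with <-cmp a c
  ... | tri< a<c _ _ = ⊥-elim (e≮f (inj₁ a<c))
  ... | tri> _ a≢c c<a rewrite <ᵇ-false {a} {c} (<-asym c<a) | ≢⇒≡ᵇ-false a≢c = refl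
  ... | tri≈ a≮a refl _ rewrite <ᵇ-false a≮a | ≡ᵇ-refl a | <ᵇ-false {b} {d} (λ b<d → e≮f (inj₂ (refl , b<d))) = refl

  eqEdge-refl : ∀ e → eqEdge e e ≡ true
  eqEdge-refl (a , b) rewrite ≡ᵇ-refl a | ≡ᵇ-refl b = refl

  eqEdge-false : ∀ {e f} → e ≢ f → eqEdge e f ≡ false
  eqEdge-false {a , b} {c , d} e≢f with ≡ᵇ-view a c | ≡ᵇ-view b d
  ... | equal refl _ | equal refl _ = ⊥-elim (e≢f refl)
  ... | equal _ a≡ᵇc | distinct _ b≢ᵇd rewrite a≡ᵇc | b≢ᵇd = refl
  ... | distinct _ a≢ᵇc | _ rewrite a≢ᵇc = refl

  leqRaw-< : ∀ {e f} es fs → e <ₑ f → leqRaw (e ∷ es) (f ∷ fs) ≡ true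
  leqRaw-< es fs e<f rewrite ltEdge-true e<f = refl

  leqRaw-∷ : ∀ e es fs → leqRaw (e ∷ es) (e ∷ fs) ≡ leqRaw es fs
  leqRaw-∷ e es fs rewrite ltEdge-false (<ₑ-irrefl {e}) | eqEdge-refl e = refl

  leqRaw-> : ∀ {e f} es fs → f <ₑ e → leqRaw (e ∷ es) (f ∷ fs) ≡ false
  leqRaw-> {e} {f} es fs f<e
    rewrite ltEdge-false (<ₑ-asym f<e) | eqEdge-false {e} {f} (λ { refl → <ₑ-irrefl f<e }) = refl

  leqRaw-refl : ∀ x → leqRaw x x ≡ true
  leqRaw-refl [] = refl
  leqRaw-refl (e ∷ es) = trans (leqRaw-∷ e es es) (leqRaw-refl es)

  leqRaw-total : ∀ x y → leqRaw y x ≡ false → leqRaw x y ≡ true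
  leqRaw-total [] y _ = refl
  leqRaw-total (e ∷ es) [] ()
  leqRaw-total (e ∷ es) (f ∷ fs) y≰x with <ₑ-cmp e f
  ... | tri< e<f _ _ = leqRaw-< es fs e<f
  ... | tri≈ _ refl _ = trans (leqRaw-∷ e es fs) (leqRaw-total es fs (trans (sym (leqRaw-∷ e fs es)) y≰x))
  ... | tri> _ _ f<e = ⊥-elim (true≢false (trans (sym (leqRaw-< fs es f<e)) y≰x))

  leqRaw-antisym : ∀ x y → leqRaw x y ≡ true → leqRaw y x ≡ true → x ≡ y
  leqRaw-antisym [] [] _ _ = refl
  leqRaw-antisym [] (f ∷ fs) _ ()
  leqRaw-antisym (e ∷ es) [] ()
  leqRaw-antisym (e ∷ es) (f ∷ fs) x≤y y≤x with <ₑ-cmp e f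
  ... | tri< e<f _ _ = ⊥-elim (true≢false (trans (sym y≤x) (leqRaw-> fs es e<f)))
  ... | tri> _ _ f<e = ⊥-elim (true≢false (trans (sym x≤y) (leqRaw-> es fs f<e)))
  ... | tri≈ _ refl _ =
    cong (e ∷_) (leqRaw-antisym es fs (trans (sym (leqRaw-∷ e es fs)) x≤y) (trans (sym (leqRaw-∷ e fs es)) y≤x))

  leqRaw-trans : ∀ x y z → leqRaw x y ≡ true → leqRaw y z ≡ true → leqRaw x z ≡ true
  leqRaw-trans [] y z _ _ = refl
  leqRaw-trans (e ∷ es) [] z ()
  leqRaw-trans (e ∷ es) (f ∷ fs) [] _ ()
  leqRaw-trans (e ∷ es) (f ∷ fs) (g ∷ gs) x≤y y≤z with <ₑ-cmp e f | <ₑ-cmp f g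
  ... | tri> _ _ f<e | _ = ⊥-elim (true≢false (trans (sym x≤y) (leqRaw-> es fs f<e)))
  ... | _ | tri> _ _ g<f = ⊥-elim (true≢false (trans (sym y≤z) (leqRaw-> fs gs g<f)))
  ... | tri< e<f _ _ | tri< f<g _ _ = leqRaw-< es gs (<ₑ-trans e<f f<g)
  ... | tri< e<f _ _ | tri≈ _ refl _ = leqRaw-< es gs e<f
  ... | tri≈ _ refl _ | tri< f<g _ _ = leqRaw-< es gs f<g
  ... | tri≈ _ refl _ | tri≈ _ refl _ =
    trans (leqRaw-∷ e es gs)
          (leqRaw-trans es fs gs (trans (sym (leqRaw-∷ e es fs)) x≤y) (trans (sym (leqRaw-∷ e fs gs)) y≤z))

  minRaw-∈ : ∀ m L → minRaw m L ∈ (m ∷ L)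
  minRaw-∈ m [] = here refl
  minRaw-∈ m (g ∷ gs) with leqRaw g m
  ... | true with minRaw-∈ g gs
  ...   | here p = there (here p)
  ...   | there p = there (there p)
  minRaw-∈ m (g ∷ gs) | false with minRaw-∈ m gs
  ...   | here p = here p
  ...   | there p = there (there p)

  minRaw-least : ∀ m L x → x ∈ (m ∷ L) → leqRaw (minRaw m L) x ≡ true
  minRaw-least m [] x (here refl) = leqRaw-refl m
  minRaw-least m (g ∷ gs) x x∈ with leqRaw g m in g≤m
  minRaw-least m (g ∷ gs) x (here refl) | true =
    leqRaw-trans (minRaw g gs) g m (minRaw-least g gs g (here refl)) g≤m
  minRaw-least m (g ∷ gs) x (there (here refl)) | true = minRaw-least g gs g (here refl)
  minRaw-least m (g ∷ gs) x (there (there p)) | true = minRaw-least g gs x (there p)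
  minRaw-least m (g ∷ gs) x (here refl) | false = minRaw-least m gs m (here refl)
  minRaw-least m (g ∷ gs) x (there (here refl)) | false =
    leqRaw-trans (minRaw m gs) m g (minRaw-least m gs m (here refl)) (leqRaw-total m g g≤m)
  minRaw-least m (g ∷ gs) x (there (there p)) | false = minRaw-least m gs x (there p)

module CanonicalForm where

  open LexOrder
  open import Data.Nat using (ℕ; suc; _≡ᵇ_; _<ᵇ_; _<_; _≤_; z≤n)
  open import Data.Nat.Properties using (<-irrefl; <-asym; <-trans; <-cmp; n<1+n; ≤∧≢⇒<; m≤n⇒m<n∨m≡n)
  open import Data.Bool using (true; false)
  open import Data.Product using (_×_; _,_; proj₁; proj₂; Σ; ∃)
  open import Data.Sum using (_⊎_; inj₁; inj₂)
  open import Data.List using (List; []; _∷_; _++_; map)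
  open import Data.List.Relation.Unary.Any using (Any; here; there)
  open import Data.List.Membership.Propositional using (_∈_)
  open import Data.List.Membership.Propositional.Properties using (∈-map⁺; ∈-map⁻; ∈-++⁺ˡ; ∈-++⁺ʳ; ∈-++⁻)
  open import Data.List.Relation.Binary.Pointwise as Pointwise using (Pointwise; []; _∷_)
  open import Data.List.Relation.Binary.Permutation.Propositional using (_↭_; ↭-sym; ↭-trans; ↭-refl)
  open import Data.List.Relation.Binary.Permutation.Propositional.Properties using (map⁺; ++⁺; ++-comm; ∈-resp-↭)
  open import Data.Maybe using (just; nothing)
  open import Data.Maybe.Properties using (just-injective)
  open import Data.Empty using (⊥-elim)
  open import Data.Unit using (⊤; tt)
  open import Function.Bundles using (_⇔_; mk⇔)
  open import Relation.Nullary using (¬_)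
  open import Relation.Binary.Definitions using (tri<; tri≈; tri>)
  open import Relation.Binary.PropositionalEquality

  Vertex : {A : Set} → A → List (A × A) → Set
  Vertex v es = Any (λ e → v ≡ proj₁ e ⊎ v ≡ proj₂ e) es

  vertexˡ : ∀ {A : Set} {a b : A} {es} → Vertex a ((a , b) ∷ es)
  vertexˡ = here (inj₁ refl)

  vertexʳ : ∀ {A : Set} {a b : A} {es} → Vertex b ((a , b) ∷ es)
  vertexʳ = here (inj₂ refl)

  mapVertices : {A B : Set} → (A → B) → List (A × A) → List (B × B)
  mapVertices t = map (λ e → (t (proj₁ e) , t (proj₂ e)))

  relabel : {A : Set} → (A → ℕ) → List (A × A) → RawTAG
  relabel = mapVertices

  relabel-id : ∀ g → relabel (λ v → v) g ≡ g
  relabel-id [] = refl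
  relabel-id (e ∷ g) = cong (e ∷_) (relabel-id g)

  infix 4 _≈ₑ_ _≈ₑ*_

  data _≈ₑ_ : Edge → Edge → Set where
    same    : ∀ {e} → e ≈ₑ e
    swapped : ∀ {a b} → (a , b) ≈ₑ (b , a)

  _≈ₑ*_ : RawTAG → RawTAG → Set
  _≈ₑ*_ = Pointwise _≈ₑ_

  ≈ₑ*-refl : ∀ {g} → g ≈ₑ* g
  ≈ₑ*-refl = Pointwise.refl same

  SameKernel : {A : Set} → (A → ℕ) → (A → ℕ) → List (A × A) → Set
  SameKernel f f' es = ∀ u v → Vertex u es → Vertex v es → (f u ≡ f v) ⇔ (f' u ≡ f' v)

  mkEdge-comm : ∀ x y → mkEdge x y ≡ mkEdge y x
  mkEdge-comm x y with <-cmp x y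
  ... | tri< x<y _ _ rewrite <ᵇ-false {y} {x} (<-asym x<y) | <ᵇ-true x<y = refl
  ... | tri≈ _ refl _ = refl
  ... | tri> _ _ y<x rewrite <ᵇ-true y<x | <ᵇ-false {x} {y} (<-asym y<x) = refl

  mkEdge-≮ : ∀ {x y} → ¬ (y < x) → mkEdge x y ≡ (x , y)
  mkEdge-≮ y≮x rewrite <ᵇ-false y≮x = refl

  mkEdge-< : ∀ {x y} → x < y → mkEdge x y ≡ (x , y)
  mkEdge-< x<y = mkEdge-≮ (<-asym x<y)

  mkEdge-> : ∀ {x y} → y < x → mkEdge x y ≡ (y , x)
  mkEdge-> y<x rewrite <ᵇ-true y<x = refl

  mkEdge-diag : ∀ x → mkEdge x x ≡ (x , x)
  mkEdge-diag x = mkEdge-≮ (<-irrefl refl)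

  ≈ₑ-mkEdge : ∀ x y → (x , y) ≈ₑ mkEdge x y
  ≈ₑ-mkEdge x y with y <ᵇ x
  ... | true = swapped
  ... | false = same

  lookup-hit : ∀ c k ρ → lookupL ((c , k) ∷ ρ) c ≡ just k
  lookup-hit c k ρ rewrite ≡ᵇ-refl c = refl

  lookup-miss : ∀ {c u} k ρ → c ≢ u → lookupL ((c , k) ∷ ρ) u ≡ lookupL ρ u
  lookup-miss k ρ c≢u rewrite ≢⇒≡ᵇ-false c≢u = refl

  ++-cross : ∀ {X : Set} {A B C D : List X} → A ↭ D → B ↭ C → A ++ B ↭ C ++ D
  ++-cross {C = C} {D = D} p q = ↭-trans (++⁺ p q) (++-comm D C)

  module _ {A : Set} (f f' : A → ℕ) where

    record LookupsAgree (es : List (A × A)) (ρ ρ' : List (ℕ × ℕ)) : Set where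
      constructor agree
      field lookups-agree : ∀ v → Vertex v es → lookupL ρ (f v) ≡ lookupL ρ' (f' v)
    open LookupsAgree

    agree-∷ : ∀ {es ρ ρ'} c d k → SameKernel f f' es → Vertex c es → Vertex d es → f' c ≡ f' d →
              LookupsAgree es ρ ρ' → LookupsAgree es ((f c , k) ∷ ρ) ((f' d , k) ∷ ρ')
    agree-∷ {es} {ρ} {ρ'} c d k ker c∈ d∈ fc≡fd agr = agree λ v v∈ → agrees v v∈
      where
      agrees : ∀ v → Vertex v es → lookupL ((f c , k) ∷ ρ) (f v) ≡ lookupL ((f' d , k) ∷ ρ') (f' v)
      agrees v v∈ rewrite sym fc≡fd | ≡ᵇ-resp-⇔ (ker c v c∈ v∈) | lookups-agree agr v v∈ = refl

    agree-fresh : ∀ {es ρ ρ'} c k → SameKernel f f' es → Vertex c es →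
                  LookupsAgree es ρ ρ' → LookupsAgree es ((f c , k) ∷ ρ) ((f' c , k) ∷ ρ')
    agree-fresh c k ker c∈ = agree-∷ c c k ker c∈ c∈ refl

    agree-tail : ∀ {e es ρ ρ'} → LookupsAgree (e ∷ es) ρ ρ' → LookupsAgree es ρ ρ'
    agree-tail agr = agree λ v v∈ → lookups-agree agr v (there v∈)

    kernel-tail : ∀ {e es} → SameKernel f f' (e ∷ es) → SameKernel f f' es
    kernel-tail ker u v u∈ v∈ = ker u v (there u∈) (there v∈)

    RelabelsAgree : A → A → List (A × A) → RawTAG → Set
    RelabelsAgree a b es h = ∀ {ρ ρ'} n → LookupsAgree ((a , b) ∷ es) ρ ρ' → relabels ρ n (relabel f es) ↭ relabels ρ' n h

    relabels-perm-same : ∀ a b es h ρ ρ' n → SameKernel f f' ((a , b) ∷ es) → LookupsAgree ((a , b) ∷ es) ρ ρ' →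
                         RelabelsAgree a b es h → relabels ρ n (relabel f ((a , b) ∷ es)) ↭ relabels ρ' n ((f' a , f' b) ∷ h)
    relabels-perm-same a b es h ρ ρ' n ker agr rec
      with lookupL ρ (f a) | lookupL ρ' (f' a) | lookups-agree agr a vertexˡ
         | lookupL ρ (f b) | lookupL ρ' (f' b) | lookups-agree agr b vertexʳ
    ... | just x | _ | refl | just y | _ | refl = map⁺ _ (rec n agr)
    ... | just x | _ | refl | nothing | _ | refl = map⁺ _ (rec (suc n) (agree-fresh b n ker vertexʳ agr))
    ... | nothing | _ | refl | just y | _ | refl = map⁺ _ (rec (suc n) (agree-fresh a n ker vertexˡ agr))
    ... | nothing | _ | refl | nothing | _ | refl rewrite ≡ᵇ-resp-⇔ (ker a b vertexˡ vertexʳ) with f' a ≡ᵇ f' b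
    ...   | true = map⁺ _ (rec (suc n) (agree-fresh a n ker vertexˡ agr))
    ...   | false =
      ++⁺ (map⁺ _ (rec (suc (suc n)) (agree-fresh b (suc n) ker vertexʳ (agree-fresh a n ker vertexˡ agr))))
          (map⁺ _ (rec (suc (suc n)) (agree-fresh a (suc n) ker vertexˡ (agree-fresh b n ker vertexʳ agr))))

    relabels-perm-swapped : ∀ a b es h ρ ρ' n → SameKernel f f' ((a , b) ∷ es) → LookupsAgree ((a , b) ∷ es) ρ ρ' →
                            RelabelsAgree a b es h → relabels ρ n (relabel f ((a , b) ∷ es)) ↭ relabels ρ' n ((f' b , f' a) ∷ h)
    relabels-perm-swapped a b es h ρ ρ' n ker agr rec
      with lookupL ρ (f a) | lookupL ρ' (f' a) | lookups-agree agr a vertexˡ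
         | lookupL ρ (f b) | lookupL ρ' (f' b) | lookups-agree agr b vertexʳ
    ... | just x | _ | refl | just y | _ | refl rewrite mkEdge-comm x y = map⁺ _ (rec n agr)
    ... | just x | _ | refl | nothing | _ | refl rewrite mkEdge-comm x n =
      map⁺ _ (rec (suc n) (agree-fresh b n ker vertexʳ agr))
    ... | nothing | _ | refl | just y | _ | refl rewrite mkEdge-comm n y =
      map⁺ _ (rec (suc n) (agree-fresh a n ker vertexˡ agr))
    ... | nothing | _ | refl | nothing | _ | refl
      rewrite ≡ᵇ-resp-⇔ (ker a b vertexˡ vertexʳ) | ≡ᵇ-sym (f' b) (f' a) with f' a ≡ᵇ f' b in fa≡ᵇfb
    ...   | true = map⁺ _ (rec (suc n) (agree-∷ a b n ker vertexˡ vertexʳ (≡ᵇ-true⇒≡ _ _ fa≡ᵇfb) agr))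
    ...   | false =
      ++-cross (map⁺ _ (rec (suc (suc n)) (agree-fresh b (suc n) ker vertexʳ (agree-fresh a n ker vertexˡ agr))))
               (map⁺ _ (rec (suc (suc n)) (agree-fresh a (suc n) ker vertexˡ (agree-fresh b n ker vertexʳ agr))))

    relabels-perm : ∀ (es : List (A × A)) h ρ ρ' n → SameKernel f f' es → LookupsAgree es ρ ρ' → relabel f' es ≈ₑ* h →
                    relabels ρ n (relabel f es) ↭ relabels ρ' n h
    relabels-perm [] [] ρ ρ' n ker agr [] = ↭-refl
    relabels-perm ((a , b) ∷ es) (_ ∷ h) ρ ρ' n ker agr (same ∷ pw) =
      relabels-perm-same a b es h ρ ρ' n ker agr
        (λ n' agr' → relabels-perm es h _ _ n' (kernel-tail ker) (agree-tail agr') pw)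
    relabels-perm ((a , b) ∷ es) (_ ∷ h) ρ ρ' n ker agr (swapped ∷ pw) =
      relabels-perm-swapped a b es h ρ ρ' n ker agr
        (λ n' agr' → relabels-perm es h _ _ n' (kernel-tail ker) (agree-tail agr') pw)

  relabels-nonempty : ∀ ρ n es → ∃ λ r → r ∈ relabels ρ n es
  relabels-nonempty ρ n [] = [] , here refl
  relabels-nonempty ρ n ((a , b) ∷ es) with lookupL ρ a | lookupL ρ b
  ... | just x | just y = let (r , p) = relabels-nonempty ρ n es in _ , ∈-map⁺ _ p
  ... | just x | nothing = let (r , p) = relabels-nonempty ((b , n) ∷ ρ) (suc n) es in _ , ∈-map⁺ _ p
  ... | nothing | just y = let (r , p) = relabels-nonempty ((a , n) ∷ ρ) (suc n) es in _ , ∈-map⁺ _ p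
  ... | nothing | nothing with a ≡ᵇ b
  ...   | true = let (r , p) = relabels-nonempty ((a , n) ∷ ρ) (suc n) es in _ , ∈-map⁺ _ p
  ...   | false = let (r , p) = relabels-nonempty ((b , suc n) ∷ (a , n) ∷ ρ) (suc (suc n)) es in _ , ∈-++⁺ˡ (∈-map⁺ _ p)

  normE : RawTAG → RawTAG
  normE [] = []
  normE ((a , b) ∷ es) = mkEdge a b ∷ normE es

  -- `canon` normalises its argument with a where-bound function that cannot be named.
  -- The meta `canonEdges` is solved to it by unification: the with-abstraction of
  -- `e ∷ es` turns the constraint into a higher-order pattern.
  private
    canon-∷ : ∀ e es → canon (e ∷ es) ≡ minRaw (mkEdge (proj₁ e) (proj₂ e) ∷ _) (relabels [] 0 (e ∷ es))
    canon-∷ e es = refl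

    mutual
      canonEdges : RawTAG → RawTAG → RawTAG
      canonEdges = _

      solve-canonEdges : Edge → RawTAG → ⊤
      solve-canonEdges e es with e ∷ es | canon-∷ e es
      ... | g | eq = tt
        where
        pinned : _ ≡ minRaw (mkEdge (proj₁ e) (proj₂ e) ∷ canonEdges g es) (relabels [] 0 (e ∷ es))
        pinned = eq

    canonEdges-normE : ∀ g es → canonEdges g es ≡ normE es
    canonEdges-normE g [] = refl
    canonEdges-normE g ((a , b) ∷ es) = cong (mkEdge a b ∷_) (canonEdges-normE g es)

  canon-unfold : ∀ g → canon g ≡ minRaw (normE g) (relabels [] 0 g)
  canon-unfold g = cong (λ m → minRaw m (relabels [] 0 g)) (canonEdges-normE g g)

  record FirstAppearance (ρ : List (ℕ × ℕ)) (n : ℕ) (es : RawTAG) : Set where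
    constructor first-appearance
    field labels : ∀ v → Vertex v es → (lookupL ρ v ≡ just v × v < n) ⊎ (lookupL ρ v ≡ nothing × n ≤ v)
  open FirstAppearance

  first-appearance-∷ : ∀ {ρ n es} c → c ≡ n → FirstAppearance ρ n es → FirstAppearance ((c , n) ∷ ρ) (suc n) es
  first-appearance-∷ {ρ} {n} {es} c c≡n fa = first-appearance labels′
    where
    labels′ : ∀ v → Vertex v es →
      (lookupL ((c , n) ∷ ρ) v ≡ just v × v < suc n) ⊎ (lookupL ((c , n) ∷ ρ) v ≡ nothing × suc n ≤ v)
    labels′ v v∈ with ≡ᵇ-view c v
    ... | equal refl c≡ᵇv rewrite c≡ᵇv = inj₁ (cong just (sym c≡n) , subst (_< suc n) (sym c≡n) (n<1+n n))
    ... | distinct c≢v c≢ᵇv rewrite c≢ᵇv with labels fa v v∈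
    ...   | inj₁ (p , v<n) = inj₁ (p , <-trans v<n (n<1+n n))
    ...   | inj₂ (p , n≤v) = inj₂ (p , ≤∧≢⇒< n≤v (λ n≡v → c≢v (trans c≡n n≡v)))

  first-appearance-tail : ∀ {ρ n e es} → FirstAppearance ρ n (e ∷ es) → FirstAppearance ρ n es
  first-appearance-tail fa = first-appearance λ v v∈ → labels fa v (there v∈)

  Below : List RawTAG → RawTAG → Set
  Below X s = ∃ λ r → r ∈ X × leqRaw r s ≡ true

  below-head : ∀ {x y} {X : List RawTAG} → (∃ λ r → r ∈ X) → x <ₑ y → (s : RawTAG) → Below (map (x ∷_) X) (y ∷ s)
  below-head {x} (r , r∈) x<y s = x ∷ r , ∈-map⁺ _ r∈ , leqRaw-< r s x<y

  below-tail : ∀ {x} {X : List RawTAG} {s} → Below X s → Below (map (x ∷_) X) (x ∷ s)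
  below-tail {x} {s = s} (r , r∈ , r≤s) = x ∷ r , ∈-map⁺ _ r∈ , trans (leqRaw-∷ x r s) r≤s

  below-++ˡ : ∀ {X Y s} → Below X s → Below (X ++ Y) s
  below-++ˡ (r , r∈ , r≤s) = r , ∈-++⁺ˡ r∈ , r≤s

  below-++ʳ : ∀ {X Y s} → Below Y s → Below (X ++ Y) s
  below-++ʳ {X} (r , r∈ , r≤s) = r , ∈-++⁺ʳ X r∈ , r≤s

  two-fresh-below : ∀ ρ n a b es → a ≢ b → n ≤ a → n ≤ b → FirstAppearance ρ n es →
    (∀ ρ' n' → FirstAppearance ρ' n' es → Below (relabels ρ' n' es) (normE es)) →
    Below (map ((n , suc n) ∷_) (relabels ((b , suc n) ∷ (a , n) ∷ ρ) (suc (suc n)) es)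
           ++ map ((n , suc n) ∷_) (relabels ((a , suc n) ∷ (b , n) ∷ ρ) (suc (suc n)) es))
          (mkEdge a b ∷ normE es)
  two-fresh-below ρ n a b es a≢b n≤a n≤b fa rec with <-cmp a b
  ... | tri≈ _ a≡b _ = ⊥-elim (a≢b a≡b)
  ... | tri< a<b _ _ rewrite mkEdge-< a<b with m≤n⇒m<n∨m≡n n≤a
  ...   | inj₁ n<a = below-++ˡ (below-head (relabels-nonempty _ _ es) (inj₁ n<a) (normE es))
  ...   | inj₂ refl with m≤n⇒m<n∨m≡n a<b
  ...     | inj₂ refl = below-++ˡ (below-tail (rec _ _ (first-appearance-∷ b refl (first-appearance-∷ a refl fa))))
  ...     | inj₁ 1+a<b = below-++ˡ (below-head (relabels-nonempty _ _ es) (inj₂ (refl , 1+a<b)) (normE es))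
  two-fresh-below ρ n a b es a≢b n≤a n≤b fa rec | tri> _ _ b<a rewrite mkEdge-> b<a with m≤n⇒m<n∨m≡n n≤b
  ...   | inj₁ n<b = below-++ʳ (below-head (relabels-nonempty _ _ es) (inj₁ n<b) (normE es))
  ...   | inj₂ refl with m≤n⇒m<n∨m≡n b<a
  ...     | inj₂ refl = below-++ʳ (below-tail (rec _ _ (first-appearance-∷ a refl (first-appearance-∷ b refl fa))))
  ...     | inj₁ 1+b<a = below-++ʳ (below-head (relabels-nonempty _ _ es) (inj₂ (refl , 1+b<a)) (normE es))

  relabels-below-normE : ∀ ρ n es → FirstAppearance ρ n es → Below (relabels ρ n es) (normE es)
  relabels-below-normE ρ n [] fa = [] , here refl , refl
  relabels-below-normE ρ n ((a , b) ∷ es) fa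
    with lookupL ρ a | lookupL ρ b | labels fa a vertexˡ | labels fa b vertexʳ
  ... | just _ | just _ | inj₁ (refl , _) | inj₁ (refl , _) =
    below-tail (relabels-below-normE ρ n es (first-appearance-tail fa))
  ... | just _ | just _ | inj₂ (() , _) | _
  ... | just _ | just _ | _ | inj₂ (() , _)
  ... | nothing | _ | inj₁ (() , _) | _
  ... | _ | nothing | _ | inj₁ (() , _)
  ... | just _ | nothing | inj₁ (refl , a<n) | inj₂ (refl , n≤b) with m≤n⇒m<n∨m≡n n≤b
  ...   | inj₂ refl rewrite mkEdge-< a<n =
    below-tail (relabels-below-normE _ _ es (first-appearance-∷ b refl (first-appearance-tail fa)))
  ...   | inj₁ n<b rewrite mkEdge-< a<n | mkEdge-< (<-trans a<n n<b) =
    below-head (relabels-nonempty ((b , n) ∷ ρ) (suc n) es) (inj₂ (refl , n<b)) (normE es)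
  relabels-below-normE ρ n ((a , b) ∷ es) fa | nothing | just _ | inj₂ (refl , n≤a) | inj₁ (refl , b<n)
    with m≤n⇒m<n∨m≡n n≤a
  ...   | inj₂ refl rewrite mkEdge-> b<n =
    below-tail (relabels-below-normE _ _ es (first-appearance-∷ a refl (first-appearance-tail fa)))
  ...   | inj₁ n<a rewrite mkEdge-> b<n | mkEdge-> (<-trans b<n n<a) =
    below-head (relabels-nonempty ((a , n) ∷ ρ) (suc n) es) (inj₂ (refl , n<a)) (normE es)
  relabels-below-normE ρ n ((a , b) ∷ es) fa | nothing | nothing | inj₂ (refl , n≤a) | inj₂ (refl , n≤b)
    with ≡ᵇ-view a b
  ... | equal refl a≡ᵇa rewrite a≡ᵇa | mkEdge-diag a with m≤n⇒m<n∨m≡n n≤a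
  ...   | inj₂ refl = below-tail (relabels-below-normE _ _ es (first-appearance-∷ a refl (first-appearance-tail fa)))
  ...   | inj₁ n<a = below-head (relabels-nonempty ((a , n) ∷ ρ) (suc n) es) (inj₁ n<a) (normE es)
  relabels-below-normE ρ n ((a , b) ∷ es) fa | nothing | nothing | inj₂ (refl , n≤a) | inj₂ (refl , n≤b)
    | distinct a≢b a≢ᵇb rewrite a≢ᵇb =
    two-fresh-below ρ n a b es a≢b n≤a n≤b (first-appearance-tail fa) (λ ρ' n' → relabels-below-normE ρ' n' es)

  lookup₀ : List (ℕ × ℕ) → ℕ → ℕ
  lookup₀ ρ v with lookupL ρ v
  ... | just x = x
  ... | nothing = 0

  lookup₀-just : ∀ ρ v {x} → lookupL ρ v ≡ just x → lookup₀ ρ v ≡ x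
  lookup₀-just ρ v eq with lookupL ρ v
  lookup₀-just ρ v refl | just x = refl

  record InjectiveBelow (ρ : List (ℕ × ℕ)) (n : ℕ) : Set where
    constructor injective-below
    field
      injective : ∀ u v x → lookupL ρ u ≡ just x → lookupL ρ v ≡ just x → u ≡ v
      bounded   : ∀ u x → lookupL ρ u ≡ just x → x < n
  open InjectiveBelow

  injectiveBelow-[] : InjectiveBelow [] 0
  injectiveBelow-[] = injective-below (λ _ _ _ ()) (λ _ _ ())

  injectiveBelow-∷ : ∀ {ρ n} c → InjectiveBelow ρ n → lookupL ρ c ≡ nothing → InjectiveBelow ((c , n) ∷ ρ) (suc n)
  injectiveBelow-∷ {ρ} {n} c ib c∉ = injective-below inj bnd
    where
    inj : ∀ u v x → lookupL ((c , n) ∷ ρ) u ≡ just x → lookupL ((c , n) ∷ ρ) v ≡ just x → u ≡ v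
    inj u v x ρu ρv with ≡ᵇ-view c u | ≡ᵇ-view c v
    ... | equal c≡u _ | equal c≡v _ = trans (sym c≡u) c≡v
    ... | equal _ e₁ | distinct _ e₂ rewrite e₁ | e₂ = ⊥-elim (<-irrefl refl (bounded ib v n (trans ρv (sym ρu))))
    ... | distinct _ e₁ | equal _ e₂ rewrite e₁ | e₂ = ⊥-elim (<-irrefl refl (bounded ib u n (trans ρu (sym ρv))))
    ... | distinct _ e₁ | distinct _ e₂ rewrite e₁ | e₂ = injective ib u v x ρu ρv
    bnd : ∀ u x → lookupL ((c , n) ∷ ρ) u ≡ just x → x < suc n
    bnd u x ρu with ≡ᵇ-view c u
    ... | equal _ e rewrite e = subst (_< suc n) (just-injective ρu) (n<1+n n)
    ... | distinct _ e rewrite e = <-trans (bounded ib u x ρu) (n<1+n n)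

  record Extends (ρ ρf : List (ℕ × ℕ)) : Set where
    constructor extends
    field extended : ∀ u x → lookupL ρ u ≡ just x → lookupL ρf u ≡ just x
  open Extends

  extends-∷ : ∀ {ρ ρf} c k → lookupL ρ c ≡ nothing → Extends ((c , k) ∷ ρ) ρf → Extends ρ ρf
  extends-∷ {ρ} {ρf} c k c∉ ext = extends ext′
    where
    ext′ : ∀ u x → lookupL ρ u ≡ just x → lookupL ρf u ≡ just x
    ext′ u x ρu with ≡ᵇ-view c u
    ... | distinct c≢u _ = extended ext u x (trans (lookup-miss k ρ c≢u) ρu)
    ... | equal refl _ with trans (sym c∉) ρu
    ...   | ()

  extends-hit : ∀ {ρ ρf} c k → Extends ((c , k) ∷ ρ) ρf → lookupL ρf c ≡ just k
  extends-hit {ρ} c k ext = extended ext c k (lookup-hit c k ρ)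

  record RelabellingOf (ρ : List (ℕ × ℕ)) (es : RawTAG) (r : RawTAG) : Set where
    constructor relabelling
    field
      final           : List (ℕ × ℕ)
      final-extends   : Extends ρ final
      final-injective : ∀ u v x → lookupL final u ≡ just x → lookupL final v ≡ just x → u ≡ v
      final-defined   : ∀ v → Vertex v es → ∃ λ x → lookupL final v ≡ just x
      final-relabels  : relabel (lookup₀ final) es ≈ₑ* r
  open RelabellingOf

  relabellingOf-∷ : ∀ {ρ ρ₁ a b es r x y} e → (R : RelabellingOf ρ₁ es r) → Extends ρ (final R) →
                    lookupL (final R) a ≡ just x → lookupL (final R) b ≡ just y → (x , y) ≈ₑ e →
                    RelabellingOf ρ ((a , b) ∷ es) (e ∷ r)
  relabellingOf-∷ {a = a} {b} e R ext ρa ρb xy≈e =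
    relabelling (final R) ext (final-injective R) defined
      (subst₂ (λ x y → (x , y) ≈ₑ e) (sym (lookup₀-just (final R) a ρa)) (sym (lookup₀-just (final R) b ρb)) xy≈e
        ∷ final-relabels R)
    where
    defined : ∀ v → Vertex v ((a , b) ∷ _) → ∃ λ x → lookupL (final R) v ≡ just x
    defined v (here (inj₁ refl)) = _ , ρa
    defined v (here (inj₂ refl)) = _ , ρb
    defined v (there v∈) = final-defined R v v∈

  relabels-are-relabellings : ∀ ρ n es r → InjectiveBelow ρ n → r ∈ relabels ρ n es → RelabellingOf ρ es r
  relabels-are-relabellings ρ n [] r ib (here refl) = relabelling ρ (extends λ _ _ p → p) (injective ib) (λ _ ()) []
  relabels-are-relabellings ρ n ((a , b) ∷ es) r ib r∈ with lookupL ρ a in ρa | lookupL ρ b in ρb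
  ... | just x | just y with ∈-map⁻ _ r∈
  ...   | r' , r'∈ , refl =
    let R = relabels-are-relabellings ρ n es r' ib r'∈
    in relabellingOf-∷ (mkEdge x y) R (final-extends R) (extended (final-extends R) a x ρa)
         (extended (final-extends R) b y ρb) (≈ₑ-mkEdge x y)
  relabels-are-relabellings ρ n ((a , b) ∷ es) r ib r∈ | just x | nothing with ∈-map⁻ _ r∈
  ...   | r' , r'∈ , refl =
    let R = relabels-are-relabellings ((b , n) ∷ ρ) (suc n) es r' (injectiveBelow-∷ b ib ρb) r'∈
        ext = extends-∷ b n ρb (final-extends R)
    in relabellingOf-∷ (mkEdge x n) R ext (extended ext a x ρa) (extends-hit b n (final-extends R)) (≈ₑ-mkEdge x n)
  relabels-are-relabellings ρ n ((a , b) ∷ es) r ib r∈ | nothing | just y with ∈-map⁻ _ r∈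
  ...   | r' , r'∈ , refl =
    let R = relabels-are-relabellings ((a , n) ∷ ρ) (suc n) es r' (injectiveBelow-∷ a ib ρa) r'∈
        ext = extends-∷ a n ρa (final-extends R)
    in relabellingOf-∷ (mkEdge n y) R ext (extends-hit a n (final-extends R)) (extended ext b y ρb) (≈ₑ-mkEdge n y)
  relabels-are-relabellings ρ n ((a , b) ∷ es) r ib r∈ | nothing | nothing with ≡ᵇ-view a b
  ... | equal refl a≡ᵇa rewrite a≡ᵇa with ∈-map⁻ _ r∈
  ...   | r' , r'∈ , refl =
    let R = relabels-are-relabellings ((a , n) ∷ ρ) (suc n) es r' (injectiveBelow-∷ a ib ρa) r'∈
        ext = extends-∷ a n ρa (final-extends R)
    in relabellingOf-∷ (n , n) R ext (extends-hit a n (final-extends R)) (extends-hit a n (final-extends R)) same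
  relabels-are-relabellings ρ n ((a , b) ∷ es) r ib r∈ | nothing | nothing | distinct a≢b a≢ᵇb rewrite a≢ᵇb
    with ∈-++⁻ (map ((n , suc n) ∷_) (relabels ((b , suc n) ∷ (a , n) ∷ ρ) (suc (suc n)) es)) r∈
  ... | inj₁ r∈₁ with ∈-map⁻ ((n , suc n) ∷_) r∈₁
  ...   | r' , r'∈ , refl =
    let b∉ = trans (lookup-miss n ρ a≢b) ρb
        R = relabels-are-relabellings _ _ es r' (injectiveBelow-∷ b (injectiveBelow-∷ a ib ρa) b∉) r'∈
        ext = extends-∷ b (suc n) b∉ (final-extends R)
    in relabellingOf-∷ (n , suc n) R (extends-∷ a n ρa ext) (extends-hit a n ext) (extends-hit b (suc n) (final-extends R)) same
  relabels-are-relabellings ρ n ((a , b) ∷ es) r ib r∈ | nothing | nothing | distinct a≢b a≢ᵇb | inj₂ r∈₂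
    with ∈-map⁻ ((n , suc n) ∷_) r∈₂
  ...   | r' , r'∈ , refl =
    let a∉ = trans (lookup-miss n ρ (λ b≡a → a≢b (sym b≡a))) ρa
        R = relabels-are-relabellings _ _ es r' (injectiveBelow-∷ a (injectiveBelow-∷ b ib ρb) a∉) r'∈
        ext = extends-∷ a (suc n) a∉ (final-extends R)
    in relabellingOf-∷ (n , suc n) R (extends-∷ b n ρb ext) (extends-hit a (suc n) (final-extends R)) (extends-hit b n ext) swapped

  canon-∈-relabels : ∀ g → canon g ∈ relabels [] 0 g
  canon-∈-relabels g rewrite canon-unfold g with minRaw-∈ (normE g) (relabels [] 0 g)
  ... | there p = p
  ... | here min≡normE with relabels-below-normE [] 0 g (first-appearance (λ v _ → inj₂ (refl , z≤n)))
  ...   | r₀ , r₀∈ , r₀≤normE = subst (_∈ relabels [] 0 g) (sym min≡r₀) r₀∈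
    where
    min≡r₀ : minRaw (normE g) (relabels [] 0 g) ≡ r₀
    min≡r₀ = leqRaw-antisym _ _ (minRaw-least (normE g) (relabels [] 0 g) r₀ (there r₀∈))
                              (subst (λ z → leqRaw r₀ z ≡ true) (sym min≡normE) r₀≤normE)

  canon-least : ∀ g r → r ∈ relabels [] 0 g → leqRaw (canon g) r ≡ true
  canon-least g r r∈ rewrite canon-unfold g = minRaw-least (normE g) (relabels [] 0 g) r (there r∈)

  canon-≈ₑ* : ∀ {A : Set} (f f' : A → ℕ) (es : List (A × A)) h → SameKernel f f' es → relabel f' es ≈ₑ* h →
              canon (relabel f es) ≡ canon h
  canon-≈ₑ* f f' es h ker pw = leqRaw-antisym _ _
    (canon-least (relabel f es) (canon h) (∈-resp-↭ (↭-sym perm) (canon-∈-relabels h)))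
    (canon-least h (canon (relabel f es)) (∈-resp-↭ perm (canon-∈-relabels (relabel f es))))
    where
    perm : relabels [] 0 (relabel f es) ↭ relabels [] 0 h
    perm = relabels-perm f f' es h [] [] 0 ker (agree (λ _ _ → refl)) pw

  canon-kernel : ∀ {A : Set} (f f' : A → ℕ) (es : List (A × A)) → SameKernel f f' es →
                 canon (relabel f es) ≡ canon (relabel f' es)
  canon-kernel f f' es ker = canon-≈ₑ* f f' es (relabel f' es) ker ≈ₑ*-refl

  canon-relabelling : ∀ g → Σ (ℕ → ℕ) λ π → SameKernel (λ v → v) π g × relabel π g ≈ₑ* canon g
  canon-relabelling g = lookup₀ (final R) , ker , final-relabels R
    where
    R = relabels-are-relabellings [] 0 g (canon g) injectiveBelow-[] (canon-∈-relabels g)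
    ker : SameKernel (λ v → v) (lookup₀ (final R)) g
    ker u v u∈ v∈ with final-defined R u u∈ | final-defined R v v∈
    ... | x , ρu | y , ρv = mk⇔ (cong (lookup₀ (final R)))
      (λ πu≡πv → final-injective R u v y
        (subst (λ z → lookupL (final R) u ≡ just z)
               (trans (sym (lookup₀-just (final R) u ρu)) (trans πu≡πv (lookup₀-just (final R) v ρv))) ρu) ρv)
module Contraction where

  open LexOrder
  open CanonicalForm
  open import Data.Nat using (ℕ; _≡ᵇ_)
  open import Data.Bool using (if_then_else_)
  open import Data.Product using (_×_; _,_)
  open import Data.Product.Function.NonDependent.Propositional using (_×-⇔_)
  open import Data.Sum using (_⊎_; inj₁; inj₂)
  open import Data.Sum.Algebra using (⊎-comm)
  open import Data.Sum.Function.Propositional using (_⊎-⇔_)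
  open import Data.List using ([]; _∷_; _++_)
  open import Data.List.Relation.Unary.Any using (here; there)
  open import Data.List.Membership.Propositional using (_∈_)
  open import Data.List.Membership.Propositional.Properties using (∈-++⁺ˡ; ∈-++⁺ʳ; ∈-++⁻)
  open import Data.List.Relation.Binary.Pointwise using ([]; _∷_)
  open import Data.Empty using (⊥-elim)
  open import Function.Bundles using (_⇔_; mk⇔; Equivalence)
  open import Function.Properties.Equivalence using (⇔-setoid)
  open import Function.Properties.Inverse using (↔⇒⇔)
  open import Level using (0ℓ)
  open import Relation.Binary.Bundles using (Setoid)
  import Relation.Binary.Reasoning.Setoid
  open import Relation.Binary.PropositionalEquality
  open Equivalence using (to; from)

  open Setoid (⇔-setoid 0ℓ) public using () renaming (refl to ⇔-refl; sym to ⇔-sym; trans to ⇔-trans)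
  module ⇔-Reasoning = Relation.Binary.Reasoning.Setoid (⇔-setoid 0ℓ)

  contractOn : RawTAG → (ℕ → ℕ) → ℕ → ℕ
  contractOn [] ρ v = ρ v
  contractOn ((a , b) ∷ es) ρ v = if contractOn es ρ v ≡ᵇ contractOn es ρ b then contractOn es ρ a else contractOn es ρ v

  contractMap-contractOn : ∀ es v → contractMap es v ≡ contractOn es (λ x → x) v
  contractMap-contractOn [] v = refl
  contractMap-contractOn ((a , b) ∷ es) v
    rewrite contractMap-contractOn es v | contractMap-contractOn es b | contractMap-contractOn es a = refl

  contractOn-cong : ∀ es {ρ ρ'} → (∀ x → ρ x ≡ ρ' x) → ∀ v → contractOn es ρ v ≡ contractOn es ρ' v
  contractOn-cong [] ρ≗ρ' v = ρ≗ρ' v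
  contractOn-cong ((a , b) ∷ es) ρ≗ρ' v
    rewrite contractOn-cong es ρ≗ρ' v | contractOn-cong es ρ≗ρ' b | contractOn-cong es ρ≗ρ' a = refl

  contractOn-++ : ∀ xs ys ρ v → contractOn (xs ++ ys) ρ v ≡ contractOn xs (contractOn ys ρ) v
  contractOn-++ [] ys ρ v = refl
  contractOn-++ ((a , b) ∷ xs) ys ρ v
    rewrite contractOn-++ xs ys ρ v | contractOn-++ xs ys ρ b | contractOn-++ xs ys ρ a = refl

  contractMap-++ : ∀ xs ys v → contractMap (xs ++ ys) v ≡ contractOn xs (contractMap ys) v
  contractMap-++ xs ys v =
    trans (contractMap-contractOn (xs ++ ys) v)
          (trans (contractOn-++ xs ys _ v) (contractOn-cong xs (λ x → sym (contractMap-contractOn ys x)) v))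

  Kernel : (ℕ → ℕ) → ℕ → ℕ → Set
  Kernel ρ u v = ρ u ≡ ρ v

  -- For an equivalence R, the equivalence generated by R and the pair (a , b).
  Merge : (ℕ → ℕ → Set) → ℕ → ℕ → ℕ → ℕ → Set
  Merge R a b u v = R u v ⊎ ((R u a ⊎ R u b) × (R v a ⊎ R v b))

  Merge-swap : ∀ R a b u v → Merge R a b u v ⇔ Merge R b a u v
  Merge-swap R a b u v = ⇔-refl ⊎-⇔ (swap ×-⇔ swap)
    where swap : ∀ {A B : Set} → (A ⊎ B) ⇔ (B ⊎ A)
          swap = ↔⇒⇔ (⊎-comm _ _)

  kernel-contractOn-∷ : ∀ a b es ρ u v →
    Kernel (contractOn ((a , b) ∷ es) ρ) u v ⇔ Merge (Kernel (contractOn es ρ)) a b u v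
  kernel-contractOn-∷ a b es ρ u v
    with ≡ᵇ-view (contractOn es ρ u) (contractOn es ρ b) | ≡ᵇ-view (contractOn es ρ v) (contractOn es ρ b)
  ... | equal pu eu | equal pv ev rewrite eu | ev = mk⇔ (λ _ → inj₁ (trans pu (sym pv))) (λ _ → refl)
  ... | equal pu eu | distinct pv ev rewrite eu | ev =
    mk⇔ (λ e → inj₂ (inj₂ pu , inj₁ (sym e)))
        (λ { (inj₁ q) → ⊥-elim (pv (trans (sym q) pu)) ; (inj₂ (_ , inj₁ q)) → sym q ; (inj₂ (_ , inj₂ q)) → ⊥-elim (pv q) })
  ... | distinct pu eu | equal pv ev rewrite eu | ev =
    mk⇔ (λ e → inj₂ (inj₁ e , inj₂ pv))
        (λ { (inj₁ q) → ⊥-elim (pu (trans q pv)) ; (inj₂ (inj₁ q , _)) → q ; (inj₂ (inj₂ q , _)) → ⊥-elim (pu q) })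
  ... | distinct pu eu | distinct pv ev rewrite eu | ev =
    mk⇔ inj₁
        (λ { (inj₁ q) → q ; (inj₂ (inj₁ q , inj₁ r)) → trans q (sym r) ; (inj₂ (inj₂ q , _)) → ⊥-elim (pu q)
           ; (inj₂ (_ , inj₂ r)) → ⊥-elim (pv r) })

  kernel-transport : (P : ℕ → Set) (φ : ℕ → ℕ) (ρ₀ ρ₀' : ℕ → ℕ) (es es' : RawTAG) →
    (∀ v → Vertex v es → P v) → relabel φ es ≈ₑ* es' →
    (∀ u v → P u → P v → (ρ₀ u ≡ ρ₀ v) ⇔ (ρ₀' (φ u) ≡ ρ₀' (φ v))) →
    ∀ u v → P u → P v → (contractOn es ρ₀ u ≡ contractOn es ρ₀ v) ⇔ (contractOn es' ρ₀' (φ u) ≡ contractOn es' ρ₀' (φ v))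
  kernel-transport P φ ρ₀ ρ₀' [] [] _ [] base u v pu pv = base u v pu pv
  kernel-transport P φ ρ₀ ρ₀' ((a , b) ∷ es) (_ ∷ es') inP (ab≈ ∷ pw) base u v pu pv =
    ⇔-trans (kernel-contractOn-∷ a b es ρ₀ u v) (⇔-trans merged (last ab≈))
    where
    pa = inP a vertexˡ
    pb = inP b vertexʳ
    IH : ∀ x y → P x → P y →
      (contractOn es ρ₀ x ≡ contractOn es ρ₀ y) ⇔ (contractOn es' ρ₀' (φ x) ≡ contractOn es' ρ₀' (φ y))
    IH = kernel-transport P φ ρ₀ ρ₀' es es' (λ v v∈ → inP v (there v∈)) pw base
    merged : Merge (Kernel (contractOn es ρ₀)) a b u v ⇔ Merge (Kernel (contractOn es' ρ₀')) (φ a) (φ b) (φ u) (φ v)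
    merged = IH u v pu pv ⊎-⇔ ((IH u a pu pa ⊎-⇔ IH u b pu pb) ×-⇔ (IH v a pv pa ⊎-⇔ IH v b pv pb))
    last : ∀ {e} → (φ a , φ b) ≈ₑ e →
           Merge (Kernel (contractOn es' ρ₀')) (φ a) (φ b) (φ u) (φ v) ⇔ Kernel (contractOn (e ∷ es') ρ₀') (φ u) (φ v)
    last same = ⇔-sym (kernel-contractOn-∷ (φ a) (φ b) es' ρ₀' (φ u) (φ v))
    last swapped = ⇔-trans (Merge-swap (Kernel (contractOn es' ρ₀')) (φ a) (φ b) (φ u) (φ v))
                           (⇔-sym (kernel-contractOn-∷ (φ b) (φ a) es' ρ₀' (φ u) (φ v)))

  data Connected (es : RawTAG) (R : ℕ → ℕ → Set) : ℕ → ℕ → Set where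
    cbase  : ∀ {u v} → R u v → Connected es R u v
    cedge  : ∀ {a b} → (a , b) ∈ es → Connected es R a b
    csym   : ∀ {u v} → Connected es R u v → Connected es R v u
    ctrans : ∀ {u v w} → Connected es R u v → Connected es R v w → Connected es R u w

  Connected-map : ∀ {es es' R R'} → (∀ {a b} → (a , b) ∈ es → Connected es' R' a b) →
                  (∀ {u v} → R u v → Connected es' R' u v) → ∀ {u v} → Connected es R u v → Connected es' R' u v
  Connected-map edges base (cbase r) = base r
  Connected-map edges base (cedge p) = edges p
  Connected-map edges base (csym c) = csym (Connected-map edges base c)
  Connected-map edges base (ctrans c d) = ctrans (Connected-map edges base c) (Connected-map edges base d)

  kernel-contractOn : ∀ es ρ u v → (contractOn es ρ u ≡ contractOn es ρ v) ⇔ Connected es (Kernel ρ) u v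
  kernel-contractOn [] ρ u v = mk⇔ cbase back
    where
    back : ∀ {u v} → Connected [] (Kernel ρ) u v → ρ u ≡ ρ v
    back (cbase r) = r
    back (cedge ())
    back (csym c) = sym (back c)
    back (ctrans c d) = trans (back c) (back d)
  kernel-contractOn ((a , b) ∷ es) ρ u v = ⇔-trans (kernel-contractOn-∷ a b es ρ u v) (mk⇔ fwd back)
    where
    IH = kernel-contractOn es ρ
    step = kernel-contractOn-∷ a b es ρ
    up : ∀ {x y} → Connected es (Kernel ρ) x y → Connected ((a , b) ∷ es) (Kernel ρ) x y
    up = Connected-map (λ p → cedge (there p)) cbase
    toA : ∀ {x} → (contractOn es ρ x ≡ contractOn es ρ a ⊎ contractOn es ρ x ≡ contractOn es ρ b) →
          Connected ((a , b) ∷ es) (Kernel ρ) x a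
    toA {x} (inj₁ q) = up (to (IH x a) q)
    toA {x} (inj₂ q) = ctrans (up (to (IH x b) q)) (csym (cedge (here refl)))
    fwd : Merge (Kernel (contractOn es ρ)) a b u v → Connected ((a , b) ∷ es) (Kernel ρ) u v
    fwd (inj₁ q) = up (to (IH u v) q)
    fwd (inj₂ (hu , hv)) = ctrans (toA hu) (csym (toA hv))
    contracted : ∀ {x y} → Connected ((a , b) ∷ es) (Kernel ρ) x y → Kernel (contractOn ((a , b) ∷ es) ρ) x y
    contracted {x} {y} (cbase r) = from (step x y) (inj₁ (from (IH x y) (cbase r)))
    contracted (cedge (here refl)) = from (step a b) (inj₂ (inj₁ refl , inj₂ refl))
    contracted {x} {y} (cedge (there p)) = from (step x y) (inj₁ (from (IH x y) (cedge p)))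
    contracted (csym c) = sym (contracted c)
    contracted (ctrans c d) = trans (contracted c) (contracted d)
    back : Connected ((a , b) ∷ es) (Kernel ρ) u v → Merge (Kernel (contractOn es ρ)) a b u v
    back c = to (step u v) (contracted c)

  Connected-++ : ∀ xs ys R u v → Connected xs (Connected ys R) u v ⇔ Connected (xs ++ ys) R u v
  Connected-++ xs ys R u v =
    mk⇔ (Connected-map (λ p → cedge (∈-++⁺ˡ p)) (Connected-map (λ p → cedge (∈-++⁺ʳ xs p)) cbase))
        (Connected-map (λ p → split (∈-++⁻ xs p)) (λ r → cbase (cbase r)))
    where
    split : ∀ {a b} → ((a , b) ∈ xs ⊎ (a , b) ∈ ys) → Connected xs (Connected ys R) a b
    split (inj₁ q) = cedge q
    split (inj₂ q) = cbase (cedge q)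

  Connected-⊆ : ∀ {xs ys R u v} → (∀ {e} → e ∈ xs → e ∈ ys) → Connected xs R u v → Connected ys R u v
  Connected-⊆ xs⊆ys = Connected-map (λ p → cedge (xs⊆ys p)) cbase

  ∈⇒Vertex : ∀ {a b x} {es : RawTAG} → (a , b) ∈ es → (x ≡ a ⊎ x ≡ b) → Vertex x es
  ∈⇒Vertex (here refl) x∈ab = here x∈ab
  ∈⇒Vertex (there p) x∈ab = there (∈⇒Vertex p x∈ab)

  Connected-Vertex : ∀ {es u v} → Connected es _≡_ u v → u ≡ v ⊎ (Vertex u es × Vertex v es)
  Connected-Vertex (cbase u≡v) = inj₁ u≡v
  Connected-Vertex (cedge p) = inj₂ (∈⇒Vertex p (inj₁ refl) , ∈⇒Vertex p (inj₂ refl))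
  Connected-Vertex (csym c) with Connected-Vertex c
  ... | inj₁ r = inj₁ (sym r)
  ... | inj₂ (p , q) = inj₂ (q , p)
  Connected-Vertex (ctrans c d) with Connected-Vertex c | Connected-Vertex d
  ... | inj₁ refl | r = r
  ... | inj₂ (p , q) | inj₁ refl = inj₂ (p , q)
  ... | inj₂ (p , _) | inj₂ (_ , q) = inj₂ (p , q)

  Connected-invariant : ∀ {es} (Q : ℕ → Set) → (∀ {a b} → (a , b) ∈ es → Q a ⇔ Q b) →
                        ∀ {u v} → Connected es _≡_ u v → Q u ⇔ Q v
  Connected-invariant Q edge-inv (cbase refl) = ⇔-refl
  Connected-invariant Q edge-inv (cedge p) = edge-inv p
  Connected-invariant Q edge-inv (csym c) = ⇔-sym (Connected-invariant Q edge-inv c)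
  Connected-invariant Q edge-inv (ctrans c d) = ⇔-trans (Connected-invariant Q edge-inv c) (Connected-invariant Q edge-inv d)

module FormalSums {c ℓ : Level} (K : CommutativeRing c ℓ) where

  open Hopf K
  open CommutativeRing K
  open import Algebra.Properties.Ring ring using (-‿distribˡ-*; -‿+-comm; -0#≈0#)
  open import Algebra.Properties.CommutativeSemigroup +-commutativeSemigroup
    using (interchange) renaming (x∙yz≈y∙xz to x+[y+z]≈y+[x+z])
  open import Algebra.Properties.CommutativeSemigroup *-commutativeSemigroup
    using () renaming (x∙yz≈y∙xz to x*[y*z]≈y*[x*z])
  open import Relation.Binary.Reasoning.Setoid setoid
  open import Data.Nat using (ℕ; zero; suc; z≤n; s≤s) renaming (_+_ to _+ℕ_; _≤_ to _≤ℕ_)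
  open import Data.Nat.Properties as ℕ using (≤-trans; ≤-refl; +-mono-≤; n≤1+n)
  open import Data.Bool using (Bool; true; false; if_then_else_)
  open import Data.Product using (_,_)
  open import Data.List using (List; []; _∷_; _++_; map; length)
  open import Data.List.Membership.Propositional using (_∈_)
  open import Data.List.Relation.Unary.Any using (here; there)
  open import Relation.Binary.PropositionalEquality as ≡ using (_≡_)

  sumL : {a : Level} {A : Set a} → List A → (A → Carrier) → Carrier
  sumL [] f = 0#
  sumL (x ∷ xs) f = f x + sumL xs f

  sumL-cong : ∀ {a} {A : Set a} (xs : List A) {f g : A → Carrier} → (∀ x → f x ≈ g x) → sumL xs f ≈ sumL xs g
  sumL-cong [] f≈g = refl
  sumL-cong (x ∷ xs) f≈g = +-cong (f≈g x) (sumL-cong xs f≈g)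

  sumL-cong∈ : ∀ {a} {A : Set a} (xs : List A) {f g : A → Carrier} → (∀ x → x ∈ xs → f x ≈ g x) → sumL xs f ≈ sumL xs g
  sumL-cong∈ [] f≈g = refl
  sumL-cong∈ (x ∷ xs) f≈g = +-cong (f≈g x (here ≡.refl)) (sumL-cong∈ xs (λ y y∈ → f≈g y (there y∈)))

  sumL-++ : ∀ {a} {A : Set a} (xs ys : List A) f → sumL (xs ++ ys) f ≈ sumL xs f + sumL ys f
  sumL-++ [] ys f = sym (+-identityˡ _)
  sumL-++ (x ∷ xs) ys f = trans (+-congˡ (sumL-++ xs ys f)) (sym (+-assoc _ _ _))

  sumL-map : ∀ {a b} {A : Set a} {B : Set b} (g : A → B) (xs : List A) f → sumL (map g xs) f ≡ sumL xs (λ x → f (g x))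
  sumL-map g [] f = ≡.refl
  sumL-map g (x ∷ xs) f = ≡.cong (f (g x) +_) (sumL-map g xs f)

  sumL-+ : ∀ {a} {A : Set a} (xs : List A) f g → sumL xs (λ x → f x + g x) ≈ sumL xs f + sumL xs g
  sumL-+ [] f g = sym (+-identityˡ 0#)
  sumL-+ (x ∷ xs) f g = trans (+-congˡ (sumL-+ xs f g)) (interchange _ _ _ _)

  sumL-*ˡ : ∀ {a} {A : Set a} (xs : List A) k f → sumL xs (λ x → k * f x) ≈ k * sumL xs f
  sumL-*ˡ [] k f = sym (zeroʳ k)
  sumL-*ˡ (x ∷ xs) k f = trans (+-congˡ (sumL-*ˡ xs k f)) (sym (distribˡ k _ _))

  sumL-0 : ∀ {a} {A : Set a} (xs : List A) → sumL xs (λ _ → 0#) ≈ 0#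
  sumL-0 [] = refl
  sumL-0 (x ∷ xs) = trans (+-identityˡ _) (sumL-0 xs)

  pair : {B : Set} → FV B → (B → Carrier) → Carrier
  pair [] f = 0#
  pair ((x , b) ∷ r) f = x * f b + pair r f

  pair-cong : ∀ {B : Set} (u : FV B) {f g : B → Carrier} → (∀ b → f b ≈ g b) → pair u f ≈ pair u g
  pair-cong [] f≈g = refl
  pair-cong ((x , b) ∷ u) f≈g = +-cong (*-congˡ (f≈g b)) (pair-cong u f≈g)

  pair-++ : ∀ {B : Set} (u v : FV B) f → pair (u ++ v) f ≈ pair u f + pair v f
  pair-++ [] v f = sym (+-identityˡ _)
  pair-++ ((x , b) ∷ u) v f = trans (+-congˡ (pair-++ u v f)) (sym (+-assoc _ _ _))

  pair-scale : ∀ {B : Set} k (u : FV B) f → pair (scaleV k u) f ≈ k * pair u f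
  pair-scale k [] f = sym (zeroʳ k)
  pair-scale k ((x , b) ∷ u) f = trans (+-cong (*-assoc k x (f b)) (pair-scale k u f)) (sym (distribˡ k _ _))

  pair-neg : ∀ {B : Set} (u : FV B) f → pair (-V u) f ≈ - pair u f
  pair-neg [] f = sym -0#≈0#
  pair-neg ((x , b) ∷ u) f = trans (+-cong (sym (-‿distribˡ-* x (f b))) (pair-neg u f)) (-‿+-comm _ _)

  pair-vec : ∀ {B : Set} (b : B) f → pair (vec b) f ≈ f b
  pair-vec b f = trans (+-identityʳ _) (*-identityˡ (f b))

  pair-extend : ∀ {A B : Set} (F : A → FV B) (u : FV A) f → pair (extend F u) f ≈ pair u (λ a → pair (F a) f)
  pair-extend F [] f = refl
  pair-extend F ((x , a) ∷ u) f = trans (pair-++ (scaleV x (F a)) _ f) (+-cong (pair-scale x (F a) f) (pair-extend F u f))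

  pair-extend-vec : ∀ {A B : Set} (φ : A → B) (w : FV A) (Φ : B → Carrier) →
                    pair (extend (λ p → vec (φ p)) w) Φ ≈ pair w (λ p → Φ (φ p))
  pair-extend-vec φ w Φ = trans (pair-extend (λ p → vec (φ p)) w Φ) (pair-cong w (λ p → pair-vec (φ p) Φ))

  pair-sumV : ∀ {B : Set} (us : List (FV B)) f → pair (sumV us) f ≈ sumL us (λ u → pair u f)
  pair-sumV [] f = refl
  pair-sumV (u ∷ us) f = trans (pair-++ u (sumV us) f) (+-congˡ (pair-sumV us f))

  pair-units : ∀ {A B : Set} (g : A → B) (xs : List A) f → pair (map (λ a → (1# , g a)) xs) f ≈ sumL xs (λ a → f (g a))
  pair-units g [] f = refl
  pair-units g (x ∷ xs) f = +-cong (*-identityˡ _) (pair-units g xs f)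

  pair-*ˡ : ∀ {B : Set} (u : FV B) k f → pair u (λ x → k * f x) ≈ k * pair u f
  pair-*ˡ [] k f = sym (zeroʳ k)
  pair-*ˡ ((x , b) ∷ u) k f = trans (+-cong (x*[y*z]≈y*[x*z] x k (f b)) (pair-*ˡ u k f)) (sym (distribˡ k _ _))

  pair-sumL : ∀ {a} {A : Set a} {B : Set} (u : FV B) (L : List A) (F : A → B → Carrier) →
              pair u (λ x → sumL L (λ l → F l x)) ≈ sumL L (λ l → pair u (F l))
  pair-sumL [] L F = sym (sumL-0 L)
  pair-sumL ((x , b) ∷ u) L F = begin
    x * sumL L (λ l → F l b) + pair u (λ y → sumL L (λ l → F l y)) ≈⟨ +-cong (sym (sumL-*ˡ L x (λ l → F l b))) (pair-sumL u L F) ⟩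
    sumL L (λ l → x * F l b) + sumL L (λ l → pair u (F l))         ≈⟨ sym (sumL-+ L _ _) ⟩
    sumL L (λ l → pair ((x , b) ∷ u) (F l))                         ∎

  indicator : Bool → Carrier
  indicator true = 1#
  indicator false = 0#

  coeff-pair : ∀ {B : Set} (eq : B → B → Bool) t (u : FV B) → coeff eq t u ≈ pair u (λ b → indicator (eq b t))
  coeff-pair eq t [] = refl
  coeff-pair eq t ((x , b) ∷ u) = +-cong (if≈* (eq b t)) (coeff-pair eq t u)
    where
    if≈* : ∀ β → (if β then x else 0#) ≈ x * indicator β
    if≈* true = sym (*-identityʳ x)
    if≈* false = sym (zeroʳ x)

  -- Indicators of classes give pair≈⇒EqV; removing one class at a time from both
  -- sides gives EqV⇒pair≈.
  module ClassPairing {B : Set} (eq : B → B → Bool) (eq-refl : ∀ b → eq b b ≡ true)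
                      (eq-sym : ∀ a b → eq a b ≡ eq b a)
                      (eq-trans : ∀ a b d → eq a b ≡ true → eq b d ≡ true → eq a d ≡ true) where

    ClassFunction : (B → Carrier) → Set ℓ
    ClassFunction f = ∀ a b → eq a b ≡ true → f a ≈ f b

    eq-classˡ : ∀ a b t → eq a b ≡ true → eq a t ≡ eq b t
    eq-classˡ a b t a~b with eq a t in a~t | eq b t in b~t
    ... | true | true = ≡.refl
    ... | false | false = ≡.refl
    ... | true | false = ≡.trans (≡.sym (eq-trans b a t (≡.trans (eq-sym b a) a~b) a~t)) b~t
    ... | false | true = ≡.trans (≡.sym a~t) (eq-trans a b t a~b b~t)

    indicator-class : ∀ t → ClassFunction (λ b → indicator (eq b t))
    indicator-class t a b a~b rewrite eq-classˡ a b t a~b = refl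

    dropClass : B → FV B → FV B
    dropClass a [] = []
    dropClass a ((x , b) ∷ r) = if eq b a then dropClass a r else (x , b) ∷ dropClass a r

    pair-dropClass : ∀ {f} → ClassFunction f → ∀ a w → pair w f ≈ f a * coeff eq a w + pair (dropClass a w) f
    pair-dropClass f-cl a [] = sym (trans (+-identityʳ _) (zeroʳ _))
    pair-dropClass {f} f-cl a ((x , b) ∷ r) with eq b a in b~a
    ... | true = begin
        x * f b + pair r f                                    ≈⟨ +-cong (*-congˡ (f-cl b a b~a)) (pair-dropClass f-cl a r) ⟩
        x * f a + (f a * coeff eq a r + pair (dropClass a r) f) ≈⟨ sym (+-assoc _ _ _) ⟩
        (x * f a + f a * coeff eq a r) + pair (dropClass a r) f ≈⟨ +-congʳ (trans (+-congʳ (*-comm x (f a))) (sym (distribˡ (f a) x _))) ⟩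
        f a * (x + coeff eq a r) + pair (dropClass a r) f       ∎
    ... | false = begin
        x * f b + pair r f                                      ≈⟨ +-congˡ (pair-dropClass f-cl a r) ⟩
        x * f b + (f a * coeff eq a r + pair (dropClass a r) f) ≈⟨ x+[y+z]≈y+[x+z] _ _ _ ⟩
        f a * coeff eq a r + (x * f b + pair (dropClass a r) f) ≈⟨ +-congʳ (*-congˡ (sym (+-identityˡ _))) ⟩
        f a * (0# + coeff eq a r) + (x * f b + pair (dropClass a r) f) ∎

    coeff-dropClass : ∀ a t w → coeff eq t (dropClass a w) ≈ (if eq t a then 0# else coeff eq t w)
    coeff-dropClass a t [] with eq t a
    ... | true = refl
    ... | false = refl
    coeff-dropClass a t ((x , b) ∷ r) with eq b a in b~a | eq b t in b~t | eq t a in t~a | coeff-dropClass a t r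
    ... | true  | _     | true  | ih = ih
    ... | true  | true  | false | ih with () ← ≡.trans (≡.sym (eq-trans t b a (≡.trans (eq-sym t b) b~t) b~a)) t~a
    ... | true  | false | false | ih = trans ih (sym (+-identityˡ _))
    ... | false | true  | true  | ih with () ← ≡.trans (≡.sym (eq-trans b t a b~t t~a)) b~a
    ... | false | false | true  | ih rewrite b~t = trans (+-identityˡ _) ih
    ... | false | true  | false | ih rewrite b~t = +-congˡ ih
    ... | false | false | false | ih rewrite b~t = +-congˡ ih

    length-dropClass : ∀ a w → length (dropClass a w) ≤ℕ length w
    length-dropClass a [] = z≤n
    length-dropClass a ((x , b) ∷ r) with eq b a
    ... | true = ≤-trans (length-dropClass a r) (n≤1+n _)
    ... | false = s≤s (length-dropClass a r)

    private
      EqV-dropClass : ∀ a u v → EqV eq u v → EqV eq (dropClass a u) (dropClass a v)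
      EqV-dropClass a u v u~v t with eq t a | coeff-dropClass a t u | coeff-dropClass a t v
      ... | true | p | q = trans p (sym q)
      ... | false | p | q = trans p (trans (u~v t) (sym q))

      mutual
        pair-cong-EqV : ∀ n (u v : FV B) {f} → ClassFunction f → length u +ℕ length v ≤ℕ n → EqV eq u v →
                        pair u f ≈ pair v f
        pair-cong-EqV zero [] [] f-cl _ _ = refl
        pair-cong-EqV (suc n) [] [] f-cl _ _ = refl
        pair-cong-EqV (suc n) ((x , a) ∷ r) v f-cl (s≤s len≤n) u~v = pair-cong-EqV-∷ n x a r v f-cl len≤n u~v
        pair-cong-EqV (suc n) [] ((y , a) ∷ v) f-cl (s≤s len≤n) u~v =
          sym (pair-cong-EqV-∷ n y a v [] f-cl (≡.subst (_≤ℕ n) (≡.sym (ℕ.+-identityʳ _)) len≤n) (λ t → sym (u~v t)))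

        pair-cong-EqV-∷ : ∀ n x a r (v : FV B) {f} → ClassFunction f → length r +ℕ length v ≤ℕ n →
                          EqV eq ((x , a) ∷ r) v → pair ((x , a) ∷ r) f ≈ pair v f
        pair-cong-EqV-∷ n x a r v {f} f-cl len≤n u~v = begin
          pair ((x , a) ∷ r) f ≈⟨ pair-dropClass f-cl a ((x , a) ∷ r) ⟩
          f a * coeff eq a ((x , a) ∷ r) + pair (dropClass a ((x , a) ∷ r)) f ≈⟨ +-cong (*-congˡ (u~v a)) rest ⟩
          f a * coeff eq a v + pair (dropClass a v) f ≈⟨ sym (pair-dropClass f-cl a v) ⟩
          pair v f ∎
          where
          shorter : length (dropClass a ((x , a) ∷ r)) +ℕ length (dropClass a v) ≤ℕ n
          shorter rewrite eq-refl a = ≤-trans (+-mono-≤ (length-dropClass a r) (length-dropClass a v)) len≤n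
          rest : pair (dropClass a ((x , a) ∷ r)) f ≈ pair (dropClass a v) f
          rest = pair-cong-EqV n (dropClass a ((x , a) ∷ r)) (dropClass a v) f-cl shorter
                   (EqV-dropClass a ((x , a) ∷ r) v u~v)

    EqV⇒pair≈ : ∀ (u v : FV B) {f} → ClassFunction f → EqV eq u v → pair u f ≈ pair v f
    EqV⇒pair≈ u v f-cl u~v = pair-cong-EqV (length u +ℕ length v) u v f-cl ≤-refl u~v

    pair≈⇒EqV : ∀ (u v : FV B) → (∀ f → ClassFunction f → pair u f ≈ pair v f) → EqV eq u v
    pair≈⇒EqV u v pair≈ t = trans (coeff-pair eq t u) (trans (pair≈ _ (indicator-class t)) (sym (coeff-pair eq t v)))

module Relabelling where

  open CanonicalForm
  open Contraction
  open import Data.Nat using (ℕ; suc; _≤_; _+_; _⊔_)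
  open import Data.Nat.Properties using (≤-trans; m≤m⊔n; m≤n⊔m; m≤n⇒m≤n⊔o; m≤n⇒m≤o⊔n; +-cancelˡ-≡; m≤m+n; 1+n≰n)
  open import Data.Bool using (true; false)
  open import Data.Product using (_×_; _,_; proj₁; proj₂; ∃)
  open import Data.Sum using (_⊎_; inj₁; inj₂; [_,_]′)
  open import Data.List using (List; []; _∷_; _++_; map; length)
  open import Data.List.Properties using (length-map)
  open import Data.List.Relation.Unary.Any using (here; there)
  open import Data.List.Relation.Unary.Any.Properties using (++⁻)
  open import Data.List.Relation.Binary.Pointwise as Pointwise using ([]; _∷_)
  open import Data.Empty using (⊥-elim)
  open import Function.Bundles using (mk⇔; Equivalence)
  open import Relation.Binary.PropositionalEquality
  open Equivalence using (to; from)

  Vertex⇒≤maxV : ∀ {v g} → Vertex v g → v ≤ maxV g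
  Vertex⇒≤maxV {g = (a , b) ∷ es} (here (inj₁ refl)) = m≤n⇒m≤n⊔o (maxV es) (m≤m⊔n a b)
  Vertex⇒≤maxV {g = (a , b) ∷ es} (here (inj₂ refl)) = m≤n⇒m≤n⊔o (maxV es) (m≤n⊔m a b)
  Vertex⇒≤maxV {g = (a , b) ∷ es} (there p) = m≤n⇒m≤o⊔n (a ⊔ b) (Vertex⇒≤maxV p)

  Vertex-mapVertices⁺ : ∀ {A B : Set} {t : A → B} {v} {es : List (A × A)} → Vertex v es →
    Vertex (t v) (mapVertices t es)
  Vertex-mapVertices⁺ (here (inj₁ refl)) = here (inj₁ refl)
  Vertex-mapVertices⁺ (here (inj₂ refl)) = here (inj₂ refl)
  Vertex-mapVertices⁺ (there p) = there (Vertex-mapVertices⁺ p)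

  Vertex-mapVertices⁻ : ∀ {A B : Set} {t : A → B} {x} (es : List (A × A)) → Vertex x (mapVertices t es) →
                        ∃ λ v → Vertex v es × x ≡ t v
  Vertex-mapVertices⁻ (e ∷ es) (here (inj₁ refl)) = _ , here (inj₁ refl) , refl
  Vertex-mapVertices⁻ (e ∷ es) (here (inj₂ refl)) = _ , here (inj₂ refl) , refl
  Vertex-mapVertices⁻ (e ∷ es) (there p) with Vertex-mapVertices⁻ es p
  ... | v , v∈ , x≡tv = v , there v∈ , x≡tv

  mapVertices-∘ : ∀ {A B C : Set} (s : B → C) (t : A → B) es →
    mapVertices s (mapVertices t es) ≡ mapVertices (λ v → s (t v)) es
  mapVertices-∘ s t [] = refl
  mapVertices-∘ s t (e ∷ es) = cong (_ ∷_) (mapVertices-∘ s t es)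

  length-relabel : ∀ {A : Set} (f : A → ℕ) es → length (relabel f es) ≡ length es
  length-relabel f es = length-map _ es

  ≈ₑ-relabel : ∀ (φ : ℕ → ℕ) {e e'} → e ≈ₑ e' → (φ (proj₁ e) , φ (proj₂ e)) ≈ₑ (φ (proj₁ e') , φ (proj₂ e'))
  ≈ₑ-relabel φ same = same
  ≈ₑ-relabel φ swapped = swapped

  ≈ₑ*-relabel : ∀ (φ : ℕ → ℕ) {x y} → x ≈ₑ* y → relabel φ x ≈ₑ* relabel φ y
  ≈ₑ*-relabel φ x≈y = Pointwise.map⁺ _ _ (Pointwise.map (≈ₑ-relabel φ) x≈y)

  Vertex-≈ₑ* : ∀ {v x y} → x ≈ₑ* y → Vertex v x → Vertex v y
  Vertex-≈ₑ* (same ∷ p) (here v∈e) = here v∈e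
  Vertex-≈ₑ* (swapped ∷ p) (here (inj₁ v≡a)) = here (inj₂ v≡a)
  Vertex-≈ₑ* (swapped ∷ p) (here (inj₂ v≡b)) = here (inj₁ v≡b)
  Vertex-≈ₑ* (_ ∷ p) (there v∈) = there (Vertex-≈ₑ* p v∈)

  select-relabel : ∀ (φ : ℕ → ℕ) β m (es : RawTAG) → select β m (relabel φ es) ≡ relabel φ (select β m es)
  select-relabel φ β [] es = refl
  select-relabel φ β (_ ∷ _) [] = refl
  select-relabel φ true (true ∷ m) (e ∷ es) = cong (_ ∷_) (select-relabel φ true m es)
  select-relabel φ true (false ∷ m) (e ∷ es) = select-relabel φ true m es
  select-relabel φ false (true ∷ m) (e ∷ es) = select-relabel φ false m es
  select-relabel φ false (false ∷ m) (e ∷ es) = cong (_ ∷_) (select-relabel φ false m es)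

  select-≈ₑ* : ∀ β m {x y} → x ≈ₑ* y → select β m x ≈ₑ* select β m y
  select-≈ₑ* β [] p = []
  select-≈ₑ* β (_ ∷ _) [] = []
  select-≈ₑ* true (true ∷ m) (e≈ ∷ p) = e≈ ∷ select-≈ₑ* true m p
  select-≈ₑ* true (false ∷ m) (e≈ ∷ p) = select-≈ₑ* true m p
  select-≈ₑ* false (true ∷ m) (e≈ ∷ p) = select-≈ₑ* false m p
  select-≈ₑ* false (false ∷ m) (e≈ ∷ p) = e≈ ∷ select-≈ₑ* false m p

  Vertex-select : ∀ {v} β m g → Vertex v (select β m g) → Vertex v g
  Vertex-select β [] g ()
  Vertex-select β (_ ∷ _) [] ()
  Vertex-select true (true ∷ m) (e ∷ g) (here q) = here q
  Vertex-select true (true ∷ m) (e ∷ g) (there p) = there (Vertex-select true m g p)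
  Vertex-select true (false ∷ m) (e ∷ g) p = there (Vertex-select true m g p)
  Vertex-select false (true ∷ m) (e ∷ g) p = there (Vertex-select false m g p)
  Vertex-select false (false ∷ m) (e ∷ g) (here q) = here q
  Vertex-select false (false ∷ m) (e ∷ g) (there p) = there (Vertex-select false m g p)

  shifted-apart : ∀ {x M} y → x ≤ M → x ≢ suc M + y
  shifted-apart {x} {M} y x≤M refl = 1+n≰n (≤-trans (m≤m+n (suc M) y) x≤M)

  SameKernel-refl : ∀ {A : Set} (f : A → ℕ) es → SameKernel f f es
  SameKernel-refl f es u v _ _ = ⇔-refl

  SameKernel-shift : ∀ {A : Set} k k' (f f' : A → ℕ) es → SameKernel f f' es →
                     SameKernel (λ v → k + f v) (λ v → k' + f' v) es
  SameKernel-shift k k' f f' es ker u v u∈ v∈ =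
    mk⇔ (λ e → cong (k' +_) (to (ker u v u∈ v∈) (+-cancelˡ-≡ k _ _ e)))
        (λ e → cong (k +_) (from (ker u v u∈ v∈) (+-cancelˡ-≡ k' _ _ e)))

  SameKernel-shifts : ∀ {A : Set} k k' (es : List (A × A)) (f : A → ℕ) → SameKernel (λ v → k + f v) (λ v → k' + f v) es
  SameKernel-shifts k k' es f = SameKernel-shift k k' f f es (SameKernel-refl f es)

  SameKernel-⊆ : ∀ {A : Set} (f f' : A → ℕ) {es es'} → (∀ {v} → Vertex v es' → Vertex v es) →
                 SameKernel f f' es → SameKernel f f' es'
  SameKernel-⊆ f f' sub ker u v u∈ v∈ = ker u v (sub u∈) (sub v∈)

  infixr 5 _⊎ᵍ_

  _⊎ᵍ_ : {A₁ A₂ : Set} → List (A₁ × A₁) → List (A₂ × A₂) → List ((A₁ ⊎ A₂) × (A₁ ⊎ A₂))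
  X ⊎ᵍ Y = mapVertices inj₁ X ++ mapVertices inj₂ Y

  relabel-⊎ᵍ : ∀ {A₁ A₂ : Set} (F₁ : A₁ → ℕ) (F₂ : A₂ → ℕ) X Y →
    relabel [ F₁ , F₂ ]′ (X ⊎ᵍ Y) ≡ relabel F₁ X ++ relabel F₂ Y
  relabel-⊎ᵍ F₁ F₂ [] Y = mapVertices-∘ [ F₁ , F₂ ]′ inj₂ Y
  relabel-⊎ᵍ F₁ F₂ (e ∷ X) Y = cong (_ ∷_) (relabel-⊎ᵍ F₁ F₂ X Y)

  data Origin {A₁ A₂ : Set} (X : List (A₁ × A₁)) (Y : List (A₂ × A₂)) : A₁ ⊎ A₂ → Set where
    left  : ∀ {a} → Vertex a X → Origin X Y (inj₁ a)
    right : ∀ {b} → Vertex b Y → Origin X Y (inj₂ b)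

  origin : ∀ {A₁ A₂ : Set} (X : List (A₁ × A₁)) (Y : List (A₂ × A₂)) {x} → Vertex x (X ⊎ᵍ Y) → Origin X Y x
  origin X Y x∈ with ++⁻ (mapVertices inj₁ X) x∈
  ... | inj₁ x∈X with Vertex-mapVertices⁻ X x∈X
  ...   | _ , a∈ , refl = left a∈
  origin X Y x∈ | inj₂ x∈Y with Vertex-mapVertices⁻ Y x∈Y
  ...   | _ , b∈ , refl = right b∈

  SameKernel-⊎ᵍ : ∀ {A₁ A₂ : Set} (F₁ F₁' : A₁ → ℕ) (F₂ F₂' : A₂ → ℕ) X Y →
                  SameKernel F₁ F₁' X → SameKernel F₂ F₂' Y →
                  (∀ a b → Vertex a X → Vertex b Y → F₁ a ≢ F₂ b) →
                  (∀ a b → Vertex a X → Vertex b Y → F₁' a ≢ F₂' b) →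
                  SameKernel [ F₁ , F₂ ]′ [ F₁' , F₂' ]′ (X ⊎ᵍ Y)
  SameKernel-⊎ᵍ F₁ F₁' F₂ F₂' X Y ker₁ ker₂ apart apart' u v u∈ v∈ with origin X Y u∈ | origin X Y v∈
  ... | left a∈ | left a'∈ = ker₁ _ _ a∈ a'∈
  ... | right b∈ | right b'∈ = ker₂ _ _ b∈ b'∈
  ... | left a∈ | right b∈ = mk⇔ (λ e → ⊥-elim (apart _ _ a∈ b∈ e)) (λ e → ⊥-elim (apart' _ _ a∈ b∈ e))
  ... | right b∈ | left a∈ = mk⇔ (λ e → ⊥-elim (apart _ _ a∈ b∈ (sym e))) (λ e → ⊥-elim (apart' _ _ a∈ b∈ (sym e)))

module IsoInvariance where

  open CanonicalForm
  open Contraction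
  open Relabelling
  open import Data.Nat using (ℕ; suc; _≤_; _+_)
  open import Data.Nat.Properties using (+-cancelˡ-≡; suc-injective)
  open import Data.Bool using (Bool; true; false)
  open import Data.Product using (_×_; _,_; proj₁; proj₂)
  open import Data.Sum using (inj₁; inj₂; [_,_]′)
  open import Data.List using (List; []; _∷_; _++_; length)
  open import Data.List.Properties using (map-++; ++-assoc; ++-identityʳ)
  open import Data.List.Membership.Propositional using (_∈_)
  open import Data.List.Membership.Propositional.Properties using (∈-++⁺ˡ; ∈-++⁺ʳ; ∈-++⁻)
  open import Data.List.Relation.Binary.Pointwise as Pointwise using (Pointwise-length)
  open import Data.List.Relation.Unary.Any.Properties using (++⁺ˡ; ++⁺ʳ)
  open import Data.Empty using (⊥-elim)
  open import Data.Unit using (⊤; tt)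
  open import Function.Bundles using (_⇔_; mk⇔; Equivalence)
  open import Relation.Nullary using (¬_)
  open import Relation.Binary.PropositionalEquality
  open Equivalence using (to; from)

  canon-length : ∀ g g' → canon g ≡ canon g' → length g ≡ length g'
  canon-length g g' eq with canon-relabelling g | canon-relabelling g'
  ... | π , _ , r | π' , _ , r' = begin
    length g               ≡⟨ sym (length-relabel π g) ⟩
    length (relabel π g)   ≡⟨ Pointwise-length r ⟩
    length (canon g)       ≡⟨ cong length eq ⟩
    length (canon g')      ≡⟨ sym (Pointwise-length r') ⟩
    length (relabel π' g') ≡⟨ length-relabel π' g' ⟩
    length g'              ∎
    where open ≡-Reasoning

  canon-⊔ᵍ-canon : ∀ g h → canon (g ⊔ᵍ h) ≡ canon (canon g ⊔ᵍ canon h)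
  canon-⊔ᵍ-canon g h with canon-relabelling g | canon-relabelling h
  ... | π₁ , ker₁ , r₁ | π₂ , ker₂ , r₂ = trans (cong canon (sym lhs)) (canon-≈ₑ* F F' (g ⊎ᵍ h) _ ker rhs)
    where
    K = suc (maxV g)
    K' = suc (maxV (canon g))
    F = [ (λ v → v) , (λ v → K + v) ]′
    F' = [ π₁ , (λ v → K' + π₂ v) ]′
    lhs : relabel F (g ⊎ᵍ h) ≡ g ⊔ᵍ h
    lhs = trans (relabel-⊎ᵍ (λ v → v) (λ v → K + v) g h) (cong (_++ shiftV K h) (relabel-id g))
    rhs : relabel F' (g ⊎ᵍ h) ≈ₑ* canon g ⊔ᵍ canon h
    rhs rewrite relabel-⊎ᵍ π₁ (λ v → K' + π₂ v) g h =
      Pointwise.++⁺ r₁ (subst (_≈ₑ* shiftV K' (canon h)) (mapVertices-∘ (K' +_) π₂ h) (≈ₑ*-relabel (K' +_) r₂))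
    ker : SameKernel F F' (g ⊎ᵍ h)
    ker = SameKernel-⊎ᵍ (λ v → v) π₁ (λ v → K + v) (λ v → K' + π₂ v) g h ker₁
            (SameKernel-shift K K' (λ v → v) π₂ h ker₂)
            (λ a b a∈ _ → shifted-apart b (Vertex⇒≤maxV a∈))
            (λ a b a∈ _ → shifted-apart (π₂ b) (Vertex⇒≤maxV (Vertex-≈ₑ* r₁ (Vertex-mapVertices⁺ a∈))))

  canon-⊔ᵍ-cong : ∀ g g' h h' → canon g ≡ canon g' → canon h ≡ canon h' → canon (g ⊔ᵍ h) ≡ canon (g' ⊔ᵍ h')
  canon-⊔ᵍ-cong g g' h h' g≅g' h≅h' =
    trans (canon-⊔ᵍ-canon g h) (trans (cong₂ (λ x y → canon (x ⊔ᵍ y)) g≅g' h≅h') (sym (canon-⊔ᵍ-canon g' h')))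

  canon-⊔ᵍ-identityˡ : ∀ g → canon ([] ⊔ᵍ g) ≡ canon g
  canon-⊔ᵍ-identityˡ g =
    trans (canon-kernel (λ v → 1 + v) (λ v → v) g (SameKernel-shifts 1 0 g (λ v → v))) (cong canon (relabel-id g))

  ⊔ᵍ-identityʳ : ∀ g → g ⊔ᵍ [] ≡ g
  ⊔ᵍ-identityʳ = ++-identityʳ

  canon-⊔ᵍ-assoc : ∀ g h k → canon ((g ⊔ᵍ h) ⊔ᵍ k) ≡ canon (g ⊔ᵍ (h ⊔ᵍ k))
  canon-⊔ᵍ-assoc g h k = trans (cong canon (sym lhs)) (trans (canon-kernel F F' (g ⊎ᵍ h ⊎ᵍ k) ker) (cong canon rhs))
    where
    K₁ = suc (maxV g)
    K₂ = suc (maxV (g ⊔ᵍ h))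
    K₃ = suc (maxV h)
    G = [ (λ v → K₁ + v) , (λ v → K₂ + v) ]′
    G' = [ (λ v → K₁ + v) , (λ v → K₁ + (K₃ + v)) ]′
    F = [ (λ v → v) , G ]′
    F' = [ (λ v → v) , G' ]′
    lhs : relabel F (g ⊎ᵍ h ⊎ᵍ k) ≡ (g ⊔ᵍ h) ⊔ᵍ k
    lhs = trans (relabel-⊎ᵍ (λ v → v) G g (h ⊎ᵍ k))
            (trans (cong₂ _++_ (relabel-id g) (relabel-⊎ᵍ (λ v → K₁ + v) (λ v → K₂ + v) h k))
                   (sym (++-assoc g (shiftV K₁ h) (shiftV K₂ k))))
    rhs : relabel F' (g ⊎ᵍ h ⊎ᵍ k) ≡ g ⊔ᵍ (h ⊔ᵍ k)
    rhs = trans (relabel-⊎ᵍ (λ v → v) G' g (h ⊎ᵍ k))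
            (cong₂ _++_ (relabel-id g)
              (trans (relabel-⊎ᵍ (λ v → K₁ + v) (λ v → K₁ + (K₃ + v)) h k)
                (trans (cong (shiftV K₁ h ++_) (sym (mapVertices-∘ (K₁ +_) (K₃ +_) k)))
                       (sym (map-++ _ h (shiftV K₃ k))))))
    inner : SameKernel G G' (h ⊎ᵍ k)
    inner = SameKernel-⊎ᵍ (λ v → K₁ + v) (λ v → K₁ + v) (λ v → K₂ + v) (λ v → K₁ + (K₃ + v)) h k
              (SameKernel-refl _ h)
              (SameKernel-shift K₂ K₁ (λ v → v) (λ v → K₃ + v) k (SameKernel-shifts 0 K₃ k (λ v → v)))
              (λ a b a∈ _ → shifted-apart b (Vertex⇒≤maxV (++⁺ʳ g (Vertex-mapVertices⁺ {t = K₁ +_} a∈))))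
              (λ a b a∈ _ e → shifted-apart b (Vertex⇒≤maxV a∈) (+-cancelˡ-≡ K₁ _ _ e))
    apart : ∀ a x → Vertex a g → Origin h k x → a ≢ G x
    apart a (inj₁ b) a∈ (left _) = shifted-apart b (Vertex⇒≤maxV a∈)
    apart a (inj₂ c) a∈ (right _) = shifted-apart c (Vertex⇒≤maxV (++⁺ˡ {ys = shiftV K₁ h} a∈))
    apart' : ∀ a x → Vertex a g → Origin h k x → a ≢ G' x
    apart' a (inj₁ b) a∈ (left _) = shifted-apart b (Vertex⇒≤maxV a∈)
    apart' a (inj₂ c) a∈ (right _) = shifted-apart (K₃ + c) (Vertex⇒≤maxV a∈)
    ker : SameKernel F F' (g ⊎ᵍ h ⊎ᵍ k)
    ker = SameKernel-⊎ᵍ (λ v → v) (λ v → v) G G' g (h ⊎ᵍ k) (SameKernel-refl _ g) inner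
            (λ a x a∈ x∈ → apart a x a∈ (origin h k x∈))
            (λ a x a∈ x∈ → apart' a x a∈ (origin h k x∈))

  kernel-contractMap : ∀ es u v →
    (contractMap es u ≡ contractMap es v) ⇔ (contractOn es (λ x → x) u ≡ contractOn es (λ x → x) v)
  kernel-contractMap es u v rewrite contractMap-contractOn es u | contractMap-contractOn es v = ⇔-refl

  canon-subG-quotG-canon : ∀ g m →
    canon (subG m g) ≡ canon (subG m (canon g)) × canon (quotG m g) ≡ canon (quotG m (canon g))
  canon-subG-quotG-canon g m with canon-relabelling g
  ... | π , ker , r = canon-subG , canon-quotG
    where
    A = subG m g
    A' = subG m (canon g)
    D = select false m g
    D' = select false m (canon g)
    rA : relabel π A ≈ₑ* A'
    rA = subst (_≈ₑ* A') (select-relabel π true m g) (select-≈ₑ* true m r)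
    rD : relabel π D ≈ₑ* D'
    rD = subst (_≈ₑ* D') (select-relabel π false m g) (select-≈ₑ* false m r)
    canon-subG : canon A ≡ canon A'
    canon-subG = trans (cong canon (sym (relabel-id A)))
                       (canon-≈ₑ* (λ v → v) π A A' (SameKernel-⊆ (λ v → v) π (Vertex-select true m g) ker) rA)
    ρ = contractMap A
    ρ' = contractMap A'
    kerQ : SameKernel ρ (λ v → ρ' (π v)) D
    kerQ u v u∈ v∈ = ⇔-trans (kernel-contractMap A u v) (⇔-trans
      (kernel-transport (λ x → Vertex x g) π (λ x → x) (λ x → x) A A' (λ x → Vertex-select true m g) rA ker
         u v (Vertex-select false m g u∈) (Vertex-select false m g v∈))
      (⇔-sym (kernel-contractMap A' (π u) (π v))))
    rQ : relabel (λ v → ρ' (π v)) D ≈ₑ* relabel ρ' D'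
    rQ = subst (_≈ₑ* relabel ρ' D') (mapVertices-∘ ρ' π D) (≈ₑ*-relabel ρ' rD)
    canon-quotG : canon (quotG m g) ≡ canon (quotG m (canon g))
    canon-quotG = canon-≈ₑ* ρ (λ v → ρ' (π v)) D (relabel ρ' D') kerQ rQ

  canon-subG-quotG-cong : ∀ g g' → canon g ≡ canon g' → ∀ m →
                          canon (subG m g) ≡ canon (subG m g') × canon (quotG m g) ≡ canon (quotG m g')
  canon-subG-quotG-cong g g' g≅g' m =
    trans (proj₁ (canon-subG-quotG-canon g m)) (trans (cong (λ z → canon (subG m z)) g≅g') (sym (proj₁ (canon-subG-quotG-canon g' m)))) ,
    trans (proj₂ (canon-subG-quotG-canon g m)) (trans (cong (λ z → canon (quotG m z)) g≅g') (sym (proj₂ (canon-subG-quotG-canon g' m))))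

  select-++ : ∀ β m₁ m₂ x y → length m₁ ≡ length x → select β (m₁ ++ m₂) (x ++ y) ≡ select β m₁ x ++ select β m₂ y
  select-++ β [] m₂ [] y _ = refl
  select-++ true (true ∷ m₁) m₂ (e ∷ x) y l = cong (e ∷_) (select-++ true m₁ m₂ x y (suc-injective l))
  select-++ true (false ∷ m₁) m₂ (e ∷ x) y l = select-++ true m₁ m₂ x y (suc-injective l)
  select-++ false (true ∷ m₁) m₂ (e ∷ x) y l = select-++ false m₁ m₂ x y (suc-injective l)
  select-++ false (false ∷ m₁) m₂ (e ∷ x) y l = cong (e ∷_) (select-++ false m₁ m₂ x y (suc-injective l))

  contractMap⇔Connected : ∀ es u v → (contractMap es u ≡ contractMap es v) ⇔ Connected es _≡_ u v
  contractMap⇔Connected es u v = ⇔-trans (kernel-contractMap es u v) (kernel-contractOn es (λ x → x) u v)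

  contractMap-outside : ∀ B u v → ¬ Vertex u B → contractMap B u ≡ contractMap B v → u ≡ v
  contractMap-outside B u v u∉ eq with Connected-Vertex (to (contractMap⇔Connected B u v) eq)
  ... | inj₁ u≡v = u≡v
  ... | inj₂ (u∈ , _) = ⊥-elim (u∉ u∈)

  kernel-contractMap-⊆⊇ : ∀ xs ys → (∀ {e} → e ∈ xs → e ∈ ys) → (∀ {e} → e ∈ ys → e ∈ xs) → ∀ u v →
                          (contractMap xs u ≡ contractMap xs v) ⇔ (contractMap ys u ≡ contractMap ys v)
  kernel-contractMap-⊆⊇ xs ys xs⊆ys ys⊆xs u v =
    ⇔-trans (contractMap⇔Connected xs u v)
      (⇔-trans (mk⇔ (Connected-⊆ xs⊆ys) (Connected-⊆ ys⊆xs)) (⇔-sym (contractMap⇔Connected ys u v)))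

  canon-subG-⊔ᵍ : ∀ g h m₁ m₂ → length m₁ ≡ length g → canon (subG (m₁ ++ m₂) (g ⊔ᵍ h)) ≡ canon (subG m₁ g ⊔ᵍ subG m₂ h)
  canon-subG-⊔ᵍ g h m₁ m₂ len = trans (cong canon (sym lhs)) (trans (canon-kernel F F' (Ag ⊎ᵍ Ah) ker) (cong canon rhs))
    where
    K = suc (maxV g)
    Ag = subG m₁ g
    Ah = subG m₂ h
    K' = suc (maxV Ag)
    F = [ (λ v → v) , (λ v → K + v) ]′
    F' = [ (λ v → v) , (λ v → K' + v) ]′
    lhs : relabel F (Ag ⊎ᵍ Ah) ≡ subG (m₁ ++ m₂) (g ⊔ᵍ h)
    lhs = trans (relabel-⊎ᵍ (λ v → v) (λ v → K + v) Ag Ah)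
            (trans (cong₂ _++_ (relabel-id Ag) (sym (select-relabel (K +_) true m₂ h)))
                   (sym (select-++ true m₁ m₂ g (shiftV K h) len)))
    rhs : relabel F' (Ag ⊎ᵍ Ah) ≡ subG m₁ g ⊔ᵍ subG m₂ h
    rhs = trans (relabel-⊎ᵍ (λ v → v) (λ v → K' + v) Ag Ah) (cong (_++ shiftV K' Ah) (relabel-id Ag))
    ker : SameKernel F F' (Ag ⊎ᵍ Ah)
    ker = SameKernel-⊎ᵍ (λ v → v) (λ v → v) (λ v → K + v) (λ v → K' + v) Ag Ah (SameKernel-refl _ Ag)
            (SameKernel-shifts K K' Ah (λ v → v))
            (λ a b a∈ _ → shifted-apart b (Vertex⇒≤maxV (Vertex-select true m₁ g a∈)))
            (λ a b a∈ _ → shifted-apart b (Vertex⇒≤maxV a∈))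

  -- Contracting extra edges B away from the image of φ identifies no further vertices of A.
  kernel-contractMap-++-apart : ∀ (P : ℕ → Set) (φ : ℕ → ℕ) A A' B → relabel φ A ≈ₑ* A' →
    (∀ v → Vertex v A → P v) → (∀ u v → P u → P v → φ u ≡ φ v → u ≡ v) → (∀ v → P v → ¬ Vertex (φ v) B) →
    ∀ u v → P u → P v → (contractMap A u ≡ contractMap A v) ⇔ (contractMap (A' ++ B) (φ u) ≡ contractMap (A' ++ B) (φ v))
  kernel-contractMap-++-apart P φ A A' B rA inP φ-inj apart u v pu pv
    rewrite contractMap-++ A' B (φ u) | contractMap-++ A' B (φ v) =
    ⇔-trans (kernel-contractMap A u v) (kernel-transport P φ (λ x → x) (contractMap B) A A' inP rA base u v pu pv)
    where
    base : ∀ x y → P x → P y → (x ≡ y) ⇔ (contractMap B (φ x) ≡ contractMap B (φ y))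
    base x y px py = mk⇔ (cong (λ z → contractMap B (φ z)))
                         (λ eq → φ-inj x y px py (contractMap-outside B (φ x) (φ y) (apart x px) eq))

  module QuotientOfProduct (g h : RawTAG) (m₁ m₂ : List Bool) (len : length m₁ ≡ length g) where

    K = suc (maxV g)
    Ag = subG m₁ g
    Ah = subG m₂ h
    Dg = select false m₁ g
    Dh = select false m₂ h
    B = relabel (K +_) Ah
    ρ = contractMap (Ag ++ B)
    ρg = contractMap Ag
    ρh = contractMap Ah
    K' = suc (maxV (quotG m₁ g))
    F = [ ρ , (λ v → ρ (K + v)) ]′
    F' = [ ρg , (λ v → K' + ρh v) ]′

    quotG-⊔ᵍ : relabel F (Dg ⊎ᵍ Dh) ≡ quotG (m₁ ++ m₂) (g ⊔ᵍ h)
    quotG-⊔ᵍ =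
      trans (relabel-⊎ᵍ ρ (λ v → ρ (K + v)) Dg Dh)
        (trans (cong (relabel ρ Dg ++_) (sym (mapVertices-∘ ρ (K +_) Dh)))
          (trans (sym (map-++ _ Dg (relabel (K +_) Dh)))
                 (sym (cong₂ (λ a d → relabel (contractMap a) d) selected unselected))))
      where
      selected : select true (m₁ ++ m₂) (g ⊔ᵍ h) ≡ Ag ++ B
      selected = trans (select-++ true m₁ m₂ g (shiftV K h) len) (cong (Ag ++_) (select-relabel (K +_) true m₂ h))
      unselected : select false (m₁ ++ m₂) (g ⊔ᵍ h) ≡ Dg ++ relabel (K +_) Dh
      unselected = trans (select-++ false m₁ m₂ g (shiftV K h) len) (cong (Dg ++_) (select-relabel (K +_) false m₂ h))

    quotG-⊔ᵍ-quotG : relabel F' (Dg ⊎ᵍ Dh) ≡ quotG m₁ g ⊔ᵍ quotG m₂ h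
    quotG-⊔ᵍ-quotG = trans (relabel-⊎ᵍ ρg (λ v → K' + ρh v) Dg Dh) (cong (relabel ρg Dg ++_) (sym (mapVertices-∘ (K' +_) ρh Dh)))

    inAg : ∀ {x} → Vertex x Ag → x ≤ maxV g
    inAg x∈ = Vertex⇒≤maxV (Vertex-select true m₁ g x∈)

    below-∉B : ∀ x → x ≤ maxV g → ¬ Vertex x B
    below-∉B x x≤ x∈ with Vertex-mapVertices⁻ Ah x∈
    ... | b , _ , refl = shifted-apart b x≤ refl

    kernel-Dg : SameKernel ρ ρg Dg
    kernel-Dg u v u∈ v∈ = ⇔-sym
      (kernel-contractMap-++-apart (_≤ maxV g) (λ x → x) Ag Ag B (subst (_≈ₑ* Ag) (sym (relabel-id Ag)) ≈ₑ*-refl)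
        (λ _ → inAg) (λ _ _ _ _ eq → eq) below-∉B
        u v (Vertex⇒≤maxV (Vertex-select false m₁ g u∈)) (Vertex⇒≤maxV (Vertex-select false m₁ g v∈)))

    kernel-Dh : SameKernel (λ v → ρ (K + v)) (λ v → K' + ρh v) Dh
    kernel-Dh u v _ _ = begin
      (ρ (K + u) ≡ ρ (K + v))
        ≈⟨ kernel-contractMap-⊆⊇ (Ag ++ B) (B ++ Ag) (swap Ag B) (swap B Ag) (K + u) (K + v) ⟩
      (contractMap (B ++ Ag) (K + u) ≡ contractMap (B ++ Ag) (K + v))
        ≈⟨ ⇔-sym (kernel-contractMap-++-apart (λ _ → ⊤) (K +_) Ah B Ag ≈ₑ*-refl (λ _ _ → tt)
                    (λ _ _ _ _ → +-cancelˡ-≡ K _ _) (λ x _ x∈ → shifted-apart x (inAg x∈) refl) u v tt tt) ⟩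
      (ρh u ≡ ρh v)
        ≈⟨ mk⇔ (cong (K' +_)) (+-cancelˡ-≡ K' _ _) ⟩
      (K' + ρh u ≡ K' + ρh v) ∎
      where
      open ⇔-Reasoning
      swap : ∀ X Y {e} → e ∈ X ++ Y → e ∈ Y ++ X
      swap X Y e∈ with ∈-++⁻ X e∈
      ... | inj₁ e∈X = ∈-++⁺ʳ Y e∈X
      ... | inj₂ e∈Y = ∈-++⁺ˡ e∈Y

    -- No edge of Ag ++ B joins a vertex of g to a shifted vertex of h.
    contracted-apart : ∀ a b → Vertex a Dg → ρ a ≢ ρ (K + b)
    contracted-apart a b a∈ eq = shifted-apart b (to (Connected-invariant (_≤ maxV g) edge-inv connected) a≤) refl
      where
      a≤ = Vertex⇒≤maxV (Vertex-select false m₁ g a∈)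
      connected = to (contractMap⇔Connected (Ag ++ B) a (K + b)) eq
      edge-inv : ∀ {x y} → (x , y) ∈ Ag ++ B → (x ≤ maxV g) ⇔ (y ≤ maxV g)
      edge-inv xy∈ with ∈-++⁻ Ag xy∈
      ... | inj₁ xy∈Ag = mk⇔ (λ _ → inAg (∈⇒Vertex xy∈Ag (inj₂ refl))) (λ _ → inAg (∈⇒Vertex xy∈Ag (inj₁ refl)))
      ... | inj₂ xy∈B = mk⇔ (λ x≤ → ⊥-elim (below-∉B _ x≤ (∈⇒Vertex xy∈B (inj₁ refl))))
                            (λ y≤ → ⊥-elim (below-∉B _ y≤ (∈⇒Vertex xy∈B (inj₂ refl))))

    canon-quotG-⊔ᵍ : canon (quotG (m₁ ++ m₂) (g ⊔ᵍ h)) ≡ canon (quotG m₁ g ⊔ᵍ quotG m₂ h)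
    canon-quotG-⊔ᵍ = trans (cong canon (sym quotG-⊔ᵍ)) (trans (canon-kernel F F' (Dg ⊎ᵍ Dh) ker) (cong canon quotG-⊔ᵍ-quotG))
      where
      ker : SameKernel F F' (Dg ⊎ᵍ Dh)
      ker = SameKernel-⊎ᵍ ρ ρg (λ v → ρ (K + v)) (λ v → K' + ρh v) Dg Dh kernel-Dg kernel-Dh
              (λ a b a∈ _ → contracted-apart a b a∈)
              (λ a b a∈ _ → shifted-apart (ρh b) (Vertex⇒≤maxV (Vertex-mapVertices⁺ {t = ρg} a∈)))

  open QuotientOfProduct public using (canon-quotG-⊔ᵍ)

module NestedMasks where

  open CanonicalForm
  open Contraction
  open Relabelling
  open IsoInvariance
  open import Data.Nat.Properties using (suc-injective)
  open import Data.Bool using (Bool; true; false)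
  open import Data.Product using (_,_)
  open import Data.Sum using (inj₁; inj₂)
  open import Data.List using (List; []; _∷_; _++_; length)
  open import Data.List.Relation.Unary.Any using (here; there)
  open import Data.List.Membership.Propositional using (_∈_)
  open import Data.List.Membership.Propositional.Properties using (∈-++⁺ˡ; ∈-++⁺ʳ; ∈-++⁻)
  open import Data.Unit using (⊤; tt)
  open import Function.Bundles using (mk⇔; Equivalence)
  open import Relation.Binary.PropositionalEquality

  -- A ternary mask puts each edge of Γ into γ' (t0), γ ∖ γ' (t1) or Γ ∖ γ (t2), for
  -- nested subgraphs γ' ⊆ γ ⊆ Γ.  outerL and innerL select γ ⊆ Γ and then γ' ⊆ γ, as in
  -- (Δ ⊗ id) ∘ Δ; outerR and innerR select γ' ⊆ Γ and then γ/γ' ⊆ Γ/γ', as in (id ⊗ Δ) ∘ Δ.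
  data Tri : Set where
    t0 t1 t2 : Tri

  outerL innerL outerR innerR : List Tri → List Bool
  outerL [] = []
  outerL (t0 ∷ t) = true ∷ outerL t
  outerL (t1 ∷ t) = true ∷ outerL t
  outerL (t2 ∷ t) = false ∷ outerL t
  innerL [] = []
  innerL (t0 ∷ t) = true ∷ innerL t
  innerL (t1 ∷ t) = false ∷ innerL t
  innerL (t2 ∷ t) = innerL t
  outerR [] = []
  outerR (t0 ∷ t) = true ∷ outerR t
  outerR (t1 ∷ t) = false ∷ outerR t
  outerR (t2 ∷ t) = false ∷ outerR t
  innerR [] = []
  innerR (t0 ∷ t) = innerR t
  innerR (t1 ∷ t) = true ∷ innerR t
  innerR (t2 ∷ t) = false ∷ innerR t

  subG-subG : ∀ t g → length t ≡ length g → subG (innerL t) (subG (outerL t) g) ≡ subG (outerR t) g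
  subG-subG [] [] l = refl
  subG-subG (t0 ∷ t) (e ∷ g) l = cong (e ∷_) (subG-subG t g (suc-injective l))
  subG-subG (t1 ∷ t) (e ∷ g) l = subG-subG t g (suc-injective l)
  subG-subG (t2 ∷ t) (e ∷ g) l = subG-subG t g (suc-injective l)

  rest-subG : ∀ t g → length t ≡ length g →
              select false (innerL t) (subG (outerL t) g) ≡ subG (innerR t) (select false (outerR t) g)
  rest-subG [] [] l = refl
  rest-subG (t0 ∷ t) (e ∷ g) l = rest-subG t g (suc-injective l)
  rest-subG (t1 ∷ t) (e ∷ g) l = cong (e ∷_) (rest-subG t g (suc-injective l))
  rest-subG (t2 ∷ t) (e ∷ g) l = rest-subG t g (suc-injective l)

  rest-rest : ∀ t g → length t ≡ length g →
              select false (outerL t) g ≡ select false (innerR t) (select false (outerR t) g)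
  rest-rest [] [] l = refl
  rest-rest (t0 ∷ t) (e ∷ g) l = rest-rest t g (suc-injective l)
  rest-rest (t1 ∷ t) (e ∷ g) l = rest-rest t g (suc-injective l)
  rest-rest (t2 ∷ t) (e ∷ g) l = cong (e ∷_) (rest-rest t g (suc-injective l))

  γ γ' γ∖γ' : List Tri → RawTAG → RawTAG
  γ t g = subG (outerL t) g
  γ' t g = subG (outerR t) g
  γ∖γ' t g = subG (innerR t) (select false (outerR t) g)

  γ-⊆ : ∀ t g {e} → length t ≡ length g → e ∈ γ t g → e ∈ γ∖γ' t g ++ γ' t g
  γ-⊆ (t0 ∷ t) (x ∷ g) l (here refl) = ∈-++⁺ʳ (γ∖γ' t g) (here refl)
  γ-⊆ (t0 ∷ t) (x ∷ g) l (there e∈) with ∈-++⁻ (γ∖γ' t g) (γ-⊆ t g (suc-injective l) e∈)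
  ... | inj₁ e∈₁ = ∈-++⁺ˡ e∈₁
  ... | inj₂ e∈₂ = ∈-++⁺ʳ (γ∖γ' t g) (there e∈₂)
  γ-⊆ (t1 ∷ t) (x ∷ g) l (here refl) = here refl
  γ-⊆ (t1 ∷ t) (x ∷ g) l (there e∈) = there (γ-⊆ t g (suc-injective l) e∈)
  γ-⊆ (t2 ∷ t) (x ∷ g) l e∈ = γ-⊆ t g (suc-injective l) e∈

  γ-⊇ : ∀ t g {e} → length t ≡ length g → e ∈ γ∖γ' t g ++ γ' t g → e ∈ γ t g
  γ-⊇ [] [] l ()
  γ-⊇ (t0 ∷ t) (x ∷ g) l e∈ with ∈-++⁻ (γ∖γ' t g) e∈
  ... | inj₁ e∈₁ = there (γ-⊇ t g (suc-injective l) (∈-++⁺ˡ e∈₁))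
  ... | inj₂ (here refl) = here refl
  ... | inj₂ (there e∈₂) = there (γ-⊇ t g (suc-injective l) (∈-++⁺ʳ (γ∖γ' t g) e∈₂))
  γ-⊇ (t1 ∷ t) (x ∷ g) l (here refl) = here refl
  γ-⊇ (t1 ∷ t) (x ∷ g) l (there e∈) = there (γ-⊇ t g (suc-injective l) e∈)
  γ-⊇ (t2 ∷ t) (x ∷ g) l e∈ = γ-⊇ t g (suc-injective l) e∈

  quotG-subG : ∀ t g → length t ≡ length g → quotG (innerL t) (subG (outerL t) g) ≡ subG (innerR t) (quotG (outerR t) g)
  quotG-subG t g l = trans (cong₂ (λ a d → relabel (contractMap a) d) (subG-subG t g l) (rest-subG t g l))
                           (sym (select-relabel (contractMap (γ' t g)) true (innerR t) (select false (outerR t) g)))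

  -- Contracting γ is contracting γ' and then the image of γ ∖ γ'.
  canon-quotG-quotG : ∀ t g → length t ≡ length g →
    canon (quotG (outerL t) g) ≡ canon (quotG (innerR t) (quotG (outerR t) g))
  canon-quotG-quotG t g l = trans (canon-kernel ρ (λ v → ρ₂ (ρ₁ v)) (select false (outerL t) g) ker) (cong canon iterated)
    where
    rest = select false (outerR t) g
    ρ = contractMap (γ t g)
    ρ₁ = contractMap (γ' t g)
    ρ₂ = contractMap (relabel ρ₁ (γ∖γ' t g))
    iterated : relabel (λ v → ρ₂ (ρ₁ v)) (select false (outerL t) g) ≡ quotG (innerR t) (quotG (outerR t) g)
    iterated = trans (sym (mapVertices-∘ ρ₂ ρ₁ _))
                 (cong₂ (λ a d → relabel (contractMap a) d)
                   (sym (select-relabel ρ₁ true (innerR t) rest))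
                   (trans (cong (relabel ρ₁) (rest-rest t g l)) (sym (select-relabel ρ₁ false (innerR t) rest))))
    ker : SameKernel ρ (λ v → ρ₂ (ρ₁ v)) (select false (outerL t) g)
    ker u v _ _ = begin
      (ρ u ≡ ρ v)                                     ≈⟨ contractMap⇔Connected (γ t g) u v ⟩
      Connected (γ t g) _≡_ u v                       ≈⟨ mk⇔ (Connected-⊆ (γ-⊆ t g l)) (Connected-⊆ (γ-⊇ t g l)) ⟩
      Connected (γ∖γ' t g ++ γ' t g) _≡_ u v          ≈⟨ ⇔-sym (Connected-++ (γ∖γ' t g) (γ' t g) _≡_ u v) ⟩
      Connected (γ∖γ' t g) (Connected (γ' t g) _≡_) u v
        ≈⟨ mk⇔ (Connected-map cedge (λ c → cbase (from (contractMap⇔Connected (γ' t g) _ _) c)))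
               (Connected-map cedge (λ e → cbase (to (contractMap⇔Connected (γ' t g) _ _) e))) ⟩
      Connected (γ∖γ' t g) (Kernel ρ₁) u v            ≈⟨ ⇔-sym (kernel-contractOn (γ∖γ' t g) ρ₁ u v) ⟩
      (contractOn (γ∖γ' t g) ρ₁ u ≡ contractOn (γ∖γ' t g) ρ₁ v)
        ≈⟨ kernel-transport (λ _ → ⊤) ρ₁ ρ₁ (λ x → x) (γ∖γ' t g) _ (λ _ _ → tt) ≈ₑ*-refl (λ _ _ _ _ → ⇔-refl) u v tt tt ⟩
      (contractOn (relabel ρ₁ (γ∖γ' t g)) (λ x → x) (ρ₁ u) ≡ contractOn (relabel ρ₁ (γ∖γ' t g)) (λ x → x) (ρ₁ v))
        ≈⟨ ⇔-sym (kernel-contractMap (relabel ρ₁ (γ∖γ' t g)) (ρ₁ u) (ρ₁ v)) ⟩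
      (ρ₂ (ρ₁ u) ≡ ρ₂ (ρ₁ v))                         ∎
      where
      open ⇔-Reasoning
      open Equivalence using (to; from)

module ClassFunctions {c ℓ : Level} (K : CommutativeRing c ℓ) where

  open Hopf K
  open CommutativeRing K
  open LexOrder
  open IsoInvariance
  open FormalSums K
  open import Relation.Binary.Reasoning.Setoid setoid
  open import Data.Bool using (true; false; if_then_else_; _∧_)
  open import Data.Product using (_×_; _,_; proj₁; proj₂)
  open import Data.List using ([]; _∷_)
  open import Data.Empty using (⊥-elim)
  open import Relation.Binary.PropositionalEquality as ≡ using (_≡_)

  eqEdge-true⇒≡ : ∀ e f → eqEdge e f ≡ true → e ≡ f
  eqEdge-true⇒≡ (a , b) (c , d) eq with ≡ᵇ-view a c | ≡ᵇ-view b d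
  ... | equal ≡.refl _ | equal ≡.refl _ = ≡.refl
  ... | equal _ a≡ᵇc | distinct _ b≢ᵇd rewrite a≡ᵇc | b≢ᵇd = ⊥-elim (true≢false (≡.sym eq))
  ... | distinct _ a≢ᵇc | _ rewrite a≢ᵇc = ⊥-elim (true≢false (≡.sym eq))

  eqRaw-true⇒≡ : ∀ x y → eqRaw x y ≡ true → x ≡ y
  eqRaw-true⇒≡ [] [] _ = ≡.refl
  eqRaw-true⇒≡ [] (_ ∷ _) ()
  eqRaw-true⇒≡ (_ ∷ _) [] ()
  eqRaw-true⇒≡ (e ∷ x) (f ∷ y) eq with eqEdge e f in e≡ᵇf
  ... | true = ≡.cong₂ _∷_ (eqEdge-true⇒≡ e f e≡ᵇf) (eqRaw-true⇒≡ x y eq)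
  ... | false = ⊥-elim (true≢false (≡.sym eq))

  eqRaw-refl : ∀ x → eqRaw x x ≡ true
  eqRaw-refl [] = ≡.refl
  eqRaw-refl (e ∷ x) rewrite eqEdge-refl e = eqRaw-refl x

  iso⇒canon≡ : ∀ g h → isoᵇ g h ≡ true → canon g ≡ canon h
  iso⇒canon≡ g h = eqRaw-true⇒≡ (canon g) (canon h)

  canon≡⇒iso : ∀ g h → canon g ≡ canon h → isoᵇ g h ≡ true
  canon≡⇒iso g h g≅h = ≡.trans (≡.cong (eqRaw (canon g)) (≡.sym g≅h)) (eqRaw-refl (canon g))

  iso-refl : ∀ g → isoᵇ g g ≡ true
  iso-refl g = eqRaw-refl (canon g)

  iso-sym : ∀ a b → isoᵇ a b ≡ isoᵇ b a
  iso-sym a b with isoᵇ a b in a~b | isoᵇ b a in b~a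
  ... | true | true = ≡.refl
  ... | false | false = ≡.refl
  ... | true | false = ≡.trans (≡.sym (canon≡⇒iso b a (≡.sym (iso⇒canon≡ a b a~b)))) b~a
  ... | false | true = ≡.trans (≡.sym a~b) (canon≡⇒iso a b (≡.sym (iso⇒canon≡ b a b~a)))

  iso-trans : ∀ a b d → isoᵇ a b ≡ true → isoᵇ b d ≡ true → isoᵇ a d ≡ true
  iso-trans a b d a~b b~d = canon≡⇒iso a d (≡.trans (iso⇒canon≡ a b a~b) (iso⇒canon≡ b d b~d))

  eq2-refl : ∀ b → eq2 b b ≡ true
  eq2-refl (a , b) rewrite iso-refl a | iso-refl b = ≡.refl

  eq3-refl : ∀ b → eq3 b b ≡ true
  eq3-refl (a , b , d) rewrite iso-refl a | iso-refl b | iso-refl d = ≡.refl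

  eq2-sym : ∀ x y → eq2 x y ≡ eq2 y x
  eq2-sym (a , b) (a' , b') rewrite iso-sym a a' | iso-sym b b' = ≡.refl

  eq3-sym : ∀ x y → eq3 x y ≡ eq3 y x
  eq3-sym (a , b , d) (a' , b' , d') rewrite iso-sym a a' | iso-sym b b' | iso-sym d d' = ≡.refl

  eq2-trans : ∀ x y z → eq2 x y ≡ true → eq2 y z ≡ true → eq2 x z ≡ true
  eq2-trans (a , b) (a' , b') (a'' , b'') x~y y~z with ∧-true {isoᵇ a a'} x~y | ∧-true {isoᵇ a' a''} y~z
  ... | p₁ , p₂ | q₁ , q₂ rewrite iso-trans a a' a'' p₁ q₁ | iso-trans b b' b'' p₂ q₂ = ≡.refl

  eq3-trans : ∀ x y z → eq3 x y ≡ true → eq3 y z ≡ true → eq3 x z ≡ true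
  eq3-trans (a , b , d) (a' , b' , d') (a'' , b'' , d'') x~y y~z with ∧-true {isoᵇ a a'} x~y | ∧-true {isoᵇ a' a''} y~z
  ... | p₁ , p₂₃ | q₁ , q₂₃ with ∧-true {isoᵇ b b'} p₂₃ | ∧-true {isoᵇ b' b''} q₂₃
  ...   | p₂ , p₃ | q₂ , q₃
    rewrite iso-trans a a' a'' p₁ q₁ | iso-trans b b' b'' p₂ q₂ | iso-trans d d' d'' p₃ q₃ = ≡.refl

  private
    module Classes₁ = ClassPairing eq1 iso-refl iso-sym iso-trans
    module Classes₂ = ClassPairing eq2 eq2-refl eq2-sym eq2-trans
    module Classes₃ = ClassPairing eq3 eq3-refl eq3-sym eq3-trans

  Invariant : (RawTAG → Carrier) → Set ℓ
  Invariant f = ∀ a b → canon a ≡ canon b → f a ≈ f b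

  Invariant₂ : (RawTAG × RawTAG → Carrier) → Set ℓ
  Invariant₂ f = ∀ a b a' b' → canon a ≡ canon a' → canon b ≡ canon b' → f (a , b) ≈ f (a' , b')

  Invariant₃ : (RawTAG → RawTAG → RawTAG → Carrier) → Set ℓ
  Invariant₃ Ψ = ∀ a b d a' b' d' → canon a ≡ canon a' → canon b ≡ canon b' → canon d ≡ canon d' → Ψ a b d ≈ Ψ a' b' d'

  ≈H-intro : ∀ (u v : H) → (∀ f → Invariant f → pair u f ≈ pair v f) → u ≈H v
  ≈H-intro u v pair≈ = Classes₁.pair≈⇒EqV u v (λ f f-cl → pair≈ f (λ a b a≅b → f-cl a b (canon≡⇒iso a b a≅b)))

  ≈H-elim : ∀ (u v : H) → u ≈H v → ∀ {f} → Invariant f → pair u f ≈ pair v f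
  ≈H-elim u v u≈v f-inv = Classes₁.EqV⇒pair≈ u v (λ a b a~b → f-inv a b (iso⇒canon≡ a b a~b)) u≈v

  ≈H⊗H-intro : ∀ u v → (∀ f → Invariant₂ f → pair u f ≈ pair v f) → u ≈H⊗H v
  ≈H⊗H-intro u v pair≈ = Classes₂.pair≈⇒EqV u v λ f f-cl → pair≈ f λ a b a' b' a≅a' b≅b' →
    f-cl (a , b) (a' , b') (≡.cong₂ _∧_ (canon≡⇒iso a a' a≅a') (canon≡⇒iso b b' b≅b'))

  ≈H⊗H⊗H-intro : ∀ u v → (∀ f → Invariant₃ (λ a b d → f (a , b , d)) → pair u f ≈ pair v f) → u ≈H⊗H⊗H v
  ≈H⊗H⊗H-intro u v pair≈ = Classes₃.pair≈⇒EqV u v λ f f-cl → pair≈ f λ a b d a' b' d' a≅a' b≅b' d≅d' →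
    f-cl (a , b , d) (a' , b' , d')
      (≡.cong₂ _∧_ (canon≡⇒iso a a' a≅a') (≡.cong₂ _∧_ (canon≡⇒iso b b' b≅b') (canon≡⇒iso d d' d≅d')))

  vec-canon : ∀ x y → canon x ≡ canon y → vec x ≈H vec y
  vec-canon x y x≅y t = reflexive (≡.cong (λ b → (if b then 1# else 0#) + 0#) (≡.cong (λ z → eqRaw z (canon t)) x≅y))

  Invariant-⊔ˡ : ∀ {f} → Invariant f → ∀ h → Invariant (λ g → f (g ⊔ᵍ h))
  Invariant-⊔ˡ f-inv h a b a≅b = f-inv _ _ (canon-⊔ᵍ-cong a b h h a≅b ≡.refl)

  Invariant-⊔ʳ : ∀ {f} → Invariant f → ∀ g → Invariant (λ h → f (g ⊔ᵍ h))
  Invariant-⊔ʳ f-inv g a b a≅b = f-inv _ _ (canon-⊔ᵍ-cong g g a b ≡.refl a≅b)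

  sumΔ : RawTAG → (RawTAG → RawTAG → Carrier) → Carrier
  sumΔ g F = sumL (allMasks g) (λ m → F (subG m g) (quotG m g))

  pair-Δ : ∀ g f → pair (Δ g) f ≈ sumΔ g (λ a b → f (a , b))
  pair-Δ g f = ≡.subst (λ z → pair (Δ g) f ≈ z) (sumL-map (λ m → (subG m g , quotG m g)) (allMasks g) f)
                 (pair-units (λ p → p) (subPairs g) f)

  pair-· : ∀ (u v : H) f → pair (u · v) f ≈ pair u (λ g → pair v (λ h → f (g ⊔ᵍ h)))
  pair-· u v f = trans (pair-extend (λ g → extend (λ h → vec (g ⊔ᵍ h)) v) u f)
                       (pair-cong u (λ g → pair-extend-vec (g ⊔ᵍ_) v f))

  pair-⊗ : ∀ {A B C D : Set} (F : A → FV C) (G : B → FV D) (w : FV (A × B)) (Φ : C × D → Carrier) →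
    pair ((F ⊗map G) w) Φ ≈ pair w (λ p → pair (F (proj₁ p)) (λ x → pair (G (proj₂ p)) (λ y → Φ (x , y))))
  pair-⊗ F G w Φ = trans (pair-extend (λ p → extend (λ x → extend (λ y → vec (x , y)) (G (proj₂ p))) (F (proj₁ p))) w Φ)
    (pair-cong w (λ p → trans (pair-extend (λ x → extend (λ y → vec (x , y)) (G (proj₂ p))) (F (proj₁ p)) Φ)
       (pair-cong (F (proj₁ p)) (λ x → pair-extend-vec (x ,_) (G (proj₂ p)) Φ))))

  pair-conv : ∀ (F G : RawTAG → H) t f →
    pair (conv F G t) f ≈ sumΔ t (λ a b → pair (F a) (λ x → pair (G b) (λ y → f (x ⊔ᵍ y))))
  pair-conv F G t f = begin
    pair (conv F G t) f                                    ≈⟨ pair-extend-vec (λ p → proj₁ p ⊔ᵍ proj₂ p) ((F ⊗map G) (Δ t)) f ⟩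
    pair ((F ⊗map G) (Δ t)) (λ p → f (proj₁ p ⊔ᵍ proj₂ p)) ≈⟨ pair-⊗ F G (Δ t) (λ p → f (proj₁ p ⊔ᵍ proj₂ p)) ⟩
    pair (Δ t) (λ p → pair (F (proj₁ p)) (λ x → pair (G (proj₂ p)) (λ y → f (x ⊔ᵍ y)))) ≈⟨ pair-Δ t _ ⟩
    sumΔ t (λ a b → pair (F a) (λ x → pair (G b) (λ y → f (x ⊔ᵍ y)))) ∎

module MaskSums {c ℓ : Level} (K : CommutativeRing c ℓ) where

  open Hopf K
  open CommutativeRing K
  open LexOrder
  open CanonicalForm
  open Relabelling
  open NestedMasks
  open FormalSums K
  open import Relation.Binary.Reasoning.Setoid setoid
  open import Data.Nat using (ℕ; zero; suc; s≤s; z≤n) renaming (_+_ to _+ℕ_; _<_ to _<ℕ_; _≤_ to _≤ℕ_)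
  open import Data.Nat.Properties using (suc-injective; ≤-trans; n≤1+n)
  open import Data.Bool using (Bool; true; false; if_then_else_; _∧_; not)
  open import Data.Bool.Properties using (∧-identityʳ)
  open import Data.Product using (_×_; _,_; proj₁; proj₂)
  open import Data.List using (List; []; _∷_; _++_; map; length; replicate)
  open import Data.List.Membership.Propositional using (_∈_)
  open import Data.List.Membership.Propositional.Properties using (∈-map⁻; ∈-++⁻)
  open import Data.List.Relation.Unary.Any using (here; there)
  open import Data.Sum using (inj₁; inj₂)
  open import Relation.Binary.PropositionalEquality as ≡ using (_≡_)

  length-masks : ∀ n {m} → m ∈ masks n → length m ≡ n
  length-masks zero (here ≡.refl) = ≡.refl
  length-masks (suc n) {m} p with ∈-++⁻ (map (true ∷_) (masks n)) p
  ... | inj₁ q with ∈-map⁻ (true ∷_) q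
  ...   | m' , r , ≡.refl = ≡.cong suc (length-masks n r)
  length-masks (suc n) {m} p | inj₂ q with ∈-map⁻ (false ∷_) q
  ...   | m' , r , ≡.refl = ≡.cong suc (length-masks n r)

  sumL-masks-suc : ∀ n (G : List Bool → Carrier) →
    sumL (masks (suc n)) G ≈ sumL (masks n) (λ m → G (true ∷ m)) + sumL (masks n) (λ m → G (false ∷ m))
  sumL-masks-suc n G = trans (sumL-++ (map (true ∷_) (masks n)) _ G)
    (+-cong (reflexive (sumL-map (true ∷_) (masks n) G))
            (reflexive (sumL-map (false ∷_) (masks n) G)))

  ones zeros : ℕ → List Bool
  ones n = replicate n true
  zeros n = replicate n false

  subG-ones : ∀ g → subG (ones (length g)) g ≡ g
  subG-ones [] = ≡.refl
  subG-ones (e ∷ g) = ≡.cong (e ∷_) (subG-ones g)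

  rest-ones : ∀ g → select false (ones (length g)) g ≡ []
  rest-ones [] = ≡.refl
  rest-ones (e ∷ g) = rest-ones g

  subG-zeros : ∀ g → subG (zeros (length g)) g ≡ []
  subG-zeros [] = ≡.refl
  subG-zeros (e ∷ g) = subG-zeros g

  rest-zeros : ∀ g → select false (zeros (length g)) g ≡ g
  rest-zeros [] = ≡.refl
  rest-zeros (e ∷ g) = ≡.cong (e ∷_) (rest-zeros g)

  quotG-ones : ∀ g → quotG (ones (length g)) g ≡ []
  quotG-ones g = ≡.cong (relabel (contractMap (subG (ones (length g)) g))) (rest-ones g)

  quotG-zeros : ∀ g → quotG (zeros (length g)) g ≡ g
  quotG-zeros g = ≡.trans (≡.cong₂ (λ a d → relabel (contractMap a) d) (subG-zeros g) (rest-zeros g)) (relabel-id g)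

  ε-relabel : ∀ (f : ℕ → ℕ) es → ε (relabel f es) ≡ ε es
  ε-relabel f [] = ≡.refl
  ε-relabel f (e ∷ es) = ≡.refl

  sumL-ε-subG : ∀ g (F : List Bool → Carrier) → sumL (allMasks g) (λ m → ε (subG m g) * F m) ≈ F (zeros (length g))
  sumL-ε-subG [] F = trans (+-identityʳ _) (*-identityˡ _)
  sumL-ε-subG (e ∷ g) F = begin
    sumL (masks (suc (length g))) (λ m → ε (subG m (e ∷ g)) * F m) ≈⟨ sumL-masks-suc (length g) _ ⟩
    sumL (masks (length g)) (λ m → 0# * F (true ∷ m)) + sumL (masks (length g)) (λ m → ε (subG m g) * F (false ∷ m))
       ≈⟨ +-cong (trans (sumL-cong (masks (length g)) (λ m → zeroˡ _)) (sumL-0 (masks (length g)))) (sumL-ε-subG g (λ m → F (false ∷ m))) ⟩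
    0# + F (zeros (suc (length g))) ≈⟨ +-identityˡ _ ⟩
    F (zeros (suc (length g))) ∎

  sumL-ε-rest : ∀ g (F : List Bool → Carrier) →
    sumL (allMasks g) (λ m → ε (select false m g) * F m) ≈ F (ones (length g))
  sumL-ε-rest [] F = trans (+-identityʳ _) (*-identityˡ _)
  sumL-ε-rest (e ∷ g) F = begin
    sumL (masks (suc (length g))) (λ m → ε (select false m (e ∷ g)) * F m) ≈⟨ sumL-masks-suc (length g) _ ⟩
    sumL (masks (length g)) (λ m → ε (select false m g) * F (true ∷ m)) + sumL (masks (length g)) (λ m → 0# * F (false ∷ m))
       ≈⟨ +-cong (sumL-ε-rest g (λ m → F (true ∷ m))) (trans (sumL-cong (masks (length g)) (λ m → zeroˡ _)) (sumL-0 (masks (length g)))) ⟩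
    F (ones (suc (length g))) + 0# ≈⟨ +-identityʳ _ ⟩
    F (ones (suc (length g))) ∎

  sumL-ε-quotG : ∀ g (F : List Bool → Carrier) → sumL (allMasks g) (λ m → ε (quotG m g) * F m) ≈ F (ones (length g))
  sumL-ε-quotG g F = trans (sumL-cong (allMasks g) (λ m → *-congʳ (reflexive (ε-relabel (contractMap (subG m g)) (select false m g))))) (sumL-ε-rest g F)

  sumL-masks-+ : ∀ n k (F : List Bool → Carrier) →
    sumL (masks (n +ℕ k)) F ≈ sumL (masks n) (λ m₁ → sumL (masks k) (λ m₂ → F (m₁ ++ m₂)))
  sumL-masks-+ zero k F = sym (+-identityʳ _)
  sumL-masks-+ (suc n) k F = begin
    sumL (masks (suc (n +ℕ k))) F ≈⟨ sumL-masks-suc (n +ℕ k) F ⟩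
    sumL (masks (n +ℕ k)) (λ m → F (true ∷ m)) + sumL (masks (n +ℕ k)) (λ m → F (false ∷ m))
       ≈⟨ +-cong (sumL-masks-+ n k (λ m → F (true ∷ m))) (sumL-masks-+ n k (λ m → F (false ∷ m))) ⟩
    sumL (masks n) (λ m₁ → sumL (masks k) (λ m₂ → F (true ∷ m₁ ++ m₂))) + sumL (masks n) (λ m₁ → sumL (masks k) (λ m₂ → F (false ∷ m₁ ++ m₂)))
       ≈⟨ sym (sumL-masks-suc n _) ⟩
    sumL (masks (suc n)) (λ m₁ → sumL (masks k) (λ m₂ → F (m₁ ++ m₂))) ∎

  tmasks : ℕ → List (List Tri)
  tmasks zero = [] ∷ []
  tmasks (suc n) = map (t0 ∷_) (tmasks n) ++ (map (t1 ∷_) (tmasks n) ++ map (t2 ∷_) (tmasks n))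

  length-tmasks : ∀ n {t} → t ∈ tmasks n → length t ≡ n
  length-tmasks zero (here ≡.refl) = ≡.refl
  length-tmasks (suc n) p with ∈-++⁻ (map (t0 ∷_) (tmasks n)) p
  ... | inj₁ q with ∈-map⁻ (t0 ∷_) q
  ...   | t , r , ≡.refl = ≡.cong suc (length-tmasks n r)
  length-tmasks (suc n) p | inj₂ q with ∈-++⁻ (map (t1 ∷_) (tmasks n)) q
  ...   | inj₁ q' with ∈-map⁻ (t1 ∷_) q'
  ...     | t , r , ≡.refl = ≡.cong suc (length-tmasks n r)
  length-tmasks (suc n) p | inj₂ q | inj₂ q' with ∈-map⁻ (t2 ∷_) q'
  ...     | t , r , ≡.refl = ≡.cong suc (length-tmasks n r)

  sumL-tmasks-suc : ∀ n (G : List Tri → Carrier) → sumL (tmasks (suc n)) G ≈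
     sumL (tmasks n) (λ t → G (t0 ∷ t)) + (sumL (tmasks n) (λ t → G (t1 ∷ t)) + sumL (tmasks n) (λ t → G (t2 ∷ t)))
  sumL-tmasks-suc n G = trans (sumL-++ (map (t0 ∷_) (tmasks n)) _ G)
    (+-cong (reflexive (sumL-map (t0 ∷_) (tmasks n) G))
      (trans (sumL-++ (map (t1 ∷_) (tmasks n)) _ G)
        (+-cong (reflexive (sumL-map (t1 ∷_) (tmasks n) G))
                (reflexive (sumL-map (t2 ∷_) (tmasks n) G)))))

  sumL-nestedL : ∀ g (F : List Bool → List Bool → Carrier) →
    sumL (masks (length g)) (λ m → sumL (masks (length (subG m g))) (λ m' → F m m')) ≈ sumL (tmasks (length g)) (λ t → F (outerL t) (innerL t))
  sumL-nestedL [] F = +-cong (+-identityʳ _) refl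
  sumL-nestedL (e ∷ g) F = begin
    sumL (masks (suc (length g))) (λ m → sumL (masks (length (subG m (e ∷ g)))) (λ m' → F m m'))
      ≈⟨ sumL-masks-suc (length g) _ ⟩
    sumL (masks (length g)) (λ m → sumL (masks (suc (length (subG m g)))) (λ m' → F (true ∷ m) m'))
      + sumL (masks (length g)) (λ m → sumL (masks (length (subG m g))) (λ m' → F (false ∷ m) m'))
      ≈⟨ +-congʳ (sumL-cong (masks (length g)) (λ m → sumL-masks-suc (length (subG m g)) _)) ⟩
    sumL (masks (length g)) (λ m → sumL (masks (length (subG m g))) (λ m' → F (true ∷ m) (true ∷ m'))
                                   + sumL (masks (length (subG m g))) (λ m' → F (true ∷ m) (false ∷ m')))
      + sumL (masks (length g)) (λ m → sumL (masks (length (subG m g))) (λ m' → F (false ∷ m) m'))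
      ≈⟨ +-congʳ (sumL-+ (masks (length g)) _ _) ⟩
    (sumL (masks (length g)) (λ m → sumL (masks (length (subG m g))) (λ m' → F (true ∷ m) (true ∷ m')))
     + sumL (masks (length g)) (λ m → sumL (masks (length (subG m g))) (λ m' → F (true ∷ m) (false ∷ m'))))
      + sumL (masks (length g)) (λ m → sumL (masks (length (subG m g))) (λ m' → F (false ∷ m) m'))
      ≈⟨ +-assoc _ _ _ ⟩
    _ ≈⟨ +-cong (sumL-nestedL g (λ m m' → F (true ∷ m) (true ∷ m')))
         (+-cong (sumL-nestedL g (λ m m' → F (true ∷ m) (false ∷ m'))) (sumL-nestedL g (λ m m' → F (false ∷ m) m'))) ⟩
    _ ≈⟨ sym (sumL-tmasks-suc (length g) _) ⟩
    sumL (tmasks (suc (length g))) (λ t → F (outerL t) (innerL t)) ∎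

  sumL-nestedR : ∀ g (F : List Bool → List Bool → Carrier) →
    sumL (masks (length g)) (λ m → sumL (masks (length (select false m g))) (λ m' → F m m')) ≈ sumL (tmasks (length g)) (λ t → F (outerR t) (innerR t))
  sumL-nestedR [] F = +-cong (+-identityʳ _) refl
  sumL-nestedR (e ∷ g) F = begin
    sumL (masks (suc (length g))) (λ m → sumL (masks (length (select false m (e ∷ g)))) (λ m' → F m m'))
      ≈⟨ sumL-masks-suc (length g) _ ⟩
    sumL (masks (length g)) (λ m → sumL (masks (length (select false m g))) (λ m' → F (true ∷ m) m'))
      + sumL (masks (length g)) (λ m → sumL (masks (suc (length (select false m g)))) (λ m' → F (false ∷ m) m'))
      ≈⟨ +-congˡ (sumL-cong (masks (length g)) (λ m → sumL-masks-suc (length (select false m g)) _)) ⟩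
    sumL (masks (length g)) (λ m → sumL (masks (length (select false m g))) (λ m' → F (true ∷ m) m'))
      + sumL (masks (length g)) (λ m → sumL (masks (length (select false m g))) (λ m' → F (false ∷ m) (true ∷ m'))
                                     + sumL (masks (length (select false m g))) (λ m' → F (false ∷ m) (false ∷ m')))
      ≈⟨ +-congˡ (sumL-+ (masks (length g)) _ _) ⟩
    _ ≈⟨ +-cong (sumL-nestedR g (λ m m' → F (true ∷ m) m'))
         (+-cong (sumL-nestedR g (λ m m' → F (false ∷ m) (true ∷ m'))) (sumL-nestedR g (λ m m' → F (false ∷ m) (false ∷ m')))) ⟩
    _ ≈⟨ sym (sumL-tmasks-suc (length g) _) ⟩
    sumL (tmasks (suc (length g))) (λ t → F (outerR t) (innerR t)) ∎

  isStrict : List Bool → Bool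
  isStrict m = orB m ∧ orB (map not m)

  sumL-filterB : ∀ {A : Set} (p : A → Bool) (xs : List A) (F : A → Carrier) →
    sumL xs F ≈ sumL (filterB p xs) F + sumL xs (λ m → if p m then 0# else F m)
  sumL-filterB p [] F = sym (+-identityˡ 0#)
  sumL-filterB p (x ∷ xs) F with p x
  ... | true = trans (+-congˡ (sumL-filterB p xs F)) (trans (sym (+-assoc _ _ _)) (+-congˡ (sym (+-identityˡ _))))
  ... | false = trans (+-congˡ (sumL-filterB p xs F)) (trans (sym (+-assoc _ _ _)) (trans (+-congʳ (+-comm _ _)) (+-assoc _ _ _)))

  sumL-ones : ∀ n (G : List Bool → Carrier) → sumL (masks n) (λ m → if orB (map not m) then 0# else G m) ≈ G (ones n)
  sumL-ones zero G = +-identityʳ _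
  sumL-ones (suc n) G = trans (sumL-masks-suc n _)
    (trans (+-cong (sumL-ones n (λ m → G (true ∷ m))) (sumL-0 (masks n))) (+-identityʳ _))

  sumL-zeros : ∀ n (G : List Bool → Carrier) → sumL (masks n) (λ m → if orB m then 0# else G m) ≈ G (zeros n)
  sumL-zeros zero G = +-identityʳ _
  sumL-zeros (suc n) G = trans (sumL-masks-suc n _)
    (trans (+-cong (sumL-0 (masks n)) (sumL-zeros n (λ m → G (false ∷ m)))) (+-identityˡ _))

  sumL-nonstrict : ∀ n (G : List Bool → Carrier) →
    sumL (masks (suc n)) (λ m → if isStrict m then 0# else G m) ≈ G (ones (suc n)) + G (zeros (suc n))
  sumL-nonstrict n G = trans (sumL-masks-suc n _)
    (+-cong (sumL-ones n (λ m → G (true ∷ m)))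
            (trans (sumL-cong (masks n) (λ m → reflexive (≡.cong (λ b → if b then 0# else G (false ∷ m)) (∧-identityʳ (orB m)))))
                   (sumL-zeros n (λ m → G (false ∷ m)))))

  sumL-allMasks-split : ∀ e es (F : List Bool → Carrier) →
    sumL (allMasks (e ∷ es)) F ≈ (F (ones (suc (length es))) + F (zeros (suc (length es)))) + sumL (filterB isStrict (allMasks (e ∷ es))) F
  sumL-allMasks-split e es F = trans (sumL-filterB isStrict (allMasks (e ∷ es)) F) (trans (+-comm _ _) (+-congʳ (sumL-nonstrict (length es) F)))

  ∈-filterB⁻ : ∀ {A : Set} (p : A → Bool) xs {x} → x ∈ filterB p xs → x ∈ xs × p x ≡ true
  ∈-filterB⁻ p (y ∷ xs) q with p y in e
  ∈-filterB⁻ p (y ∷ xs) (here ≡.refl) | true = here ≡.refl , e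
  ∈-filterB⁻ p (y ∷ xs) (there q) | true = let (a , b) = ∈-filterB⁻ p xs q in there a , b
  ∈-filterB⁻ p (y ∷ xs) q | false = let (a , b) = ∈-filterB⁻ p xs q in there a , b

  length-select : ∀ β m g → length (select β m g) ≤ℕ length g
  length-select β [] g = z≤n
  length-select β (_ ∷ _) [] = z≤n
  length-select true (true ∷ m) (e ∷ g) = s≤s (length-select true m g)
  length-select true (false ∷ m) (e ∷ g) = ≤-trans (length-select true m g) (n≤1+n _)
  length-select false (true ∷ m) (e ∷ g) = ≤-trans (length-select false m g) (n≤1+n _)
  length-select false (false ∷ m) (e ∷ g) = s≤s (length-select false m g)

  length-subG-< : ∀ m g → length m ≡ length g → orB (map not m) ≡ true → length (subG m g) <ℕ length g
  length-subG-< (true ∷ m) (e ∷ g) l h = s≤s (length-subG-< m g (suc-injective l) h)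
  length-subG-< (false ∷ m) (e ∷ g) l h = s≤s (length-select true m g)

  length-rest-< : ∀ m g → length m ≡ length g → orB m ≡ true → length (select false m g) <ℕ length g
  length-rest-< (true ∷ m) (e ∷ g) l h = s≤s (length-select false m g)
  length-rest-< (false ∷ m) (e ∷ g) l h = s≤s (length-rest-< m g (suc-injective l) h)

  strict-smaller : ∀ g {m} → m ∈ filterB isStrict (allMasks g) →
    length (subG m g) <ℕ length g × length (quotG m g) <ℕ length g
  strict-smaller g {m} m∈ with ∈-filterB⁻ isStrict (allMasks g) m∈
  ... | m∈masks , strict with ∧-true {orB m} strict
  ...   | some-true , some-false =
    length-subG-< m g (length-masks (length g) m∈masks) some-false ,
    ≡.subst (_<ℕ length g) (≡.sym (length-relabel (contractMap (subG m g)) (select false m g)))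
            (length-rest-< m g (length-masks (length g) m∈masks) some-true)

  strictSubPairs-smaller : ∀ g {p} → p ∈ strictSubPairs g → length (proj₁ p) <ℕ length g × length (proj₂ p) <ℕ length g
  strictSubPairs-smaller g p∈ with ∈-map⁻ (λ m → (subG m g , quotG m g)) p∈
  ... | m , m∈ , ≡.refl = strict-smaller g m∈

module BialgebraAxioms {c ℓ : Level} (K : CommutativeRing c ℓ) where

  open Hopf K
  open CommutativeRing K
  open Relabelling
  open IsoInvariance
  open NestedMasks
  open FormalSums K
  open ClassFunctions K
  open MaskSums K
  open import Relation.Binary.Reasoning.Setoid setoid
  open import Data.Nat using () renaming (_+_ to _+ℕ_)
  open import Data.Bool using (Bool; true; false)
  open import Data.Product using (_×_; _,_; proj₁; proj₂)
  open import Data.List using (List; []; _∷_; _++_; length)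
  open import Data.List.Properties using (length-++; length-map)
  open import Relation.Binary.PropositionalEquality as ≡ using (_≡_)

  product-wd : ∀ g g' h h' → isoᵇ g g' ≡ true → isoᵇ h h' ≡ true → vec (g ⊔ᵍ h) ≈H vec (g' ⊔ᵍ h')
  product-wd g g' h h' g~g' h~h' =
    vec-canon (g ⊔ᵍ h) (g' ⊔ᵍ h') (canon-⊔ᵍ-cong g g' h h' (iso⇒canon≡ g g' g~g') (iso⇒canon≡ h h' h~h'))

  product-assoc : ∀ g h k → vec ((g ⊔ᵍ h) ⊔ᵍ k) ≈H vec (g ⊔ᵍ (h ⊔ᵍ k))
  product-assoc g h k = vec-canon ((g ⊔ᵍ h) ⊔ᵍ k) (g ⊔ᵍ (h ⊔ᵍ k)) (canon-⊔ᵍ-assoc g h k)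

  product-unitˡ : ∀ g → (oneH · vec g) ≈H vec g
  product-unitˡ g = ≈H-intro (oneH · vec g) (vec g) λ f f-inv → begin
    pair (oneH · vec g) f                             ≈⟨ pair-· oneH (vec g) f ⟩
    pair oneH (λ x → pair (vec g) (λ h → f (x ⊔ᵍ h))) ≈⟨ pair-vec [] (λ x → pair (vec g) (λ h → f (x ⊔ᵍ h))) ⟩
    pair (vec g) (λ h → f ([] ⊔ᵍ h))                  ≈⟨ pair-vec g (λ h → f ([] ⊔ᵍ h)) ⟩
    f ([] ⊔ᵍ g)                                       ≈⟨ f-inv _ _ (canon-⊔ᵍ-identityˡ g) ⟩
    f g                                               ≈⟨ sym (pair-vec g f) ⟩
    pair (vec g) f                                    ∎

  product-unitʳ : ∀ g → (vec g · oneH) ≈H vec g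
  product-unitʳ g = ≈H-intro (vec g · oneH) (vec g) λ f f-inv → begin
    pair (vec g · oneH) f                             ≈⟨ pair-· (vec g) oneH f ⟩
    pair (vec g) (λ x → pair oneH (λ h → f (x ⊔ᵍ h))) ≈⟨ pair-vec g (λ x → pair oneH (λ h → f (x ⊔ᵍ h))) ⟩
    pair oneH (λ h → f (g ⊔ᵍ h))                      ≈⟨ pair-vec [] (λ h → f (g ⊔ᵍ h)) ⟩
    f (g ⊔ᵍ [])                                       ≈⟨ reflexive (≡.cong f (⊔ᵍ-identityʳ g)) ⟩
    f g                                               ≈⟨ sym (pair-vec g f) ⟩
    pair (vec g) f                                    ∎

  Δ-wd : ∀ g g' → isoᵇ g g' ≡ true → Δ g ≈H⊗H Δ g'
  Δ-wd g g' g~g' = ≈H⊗H-intro (Δ g) (Δ g') λ f f-inv → begin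
    pair (Δ g) f                                          ≈⟨ pair-Δ g f ⟩
    sumL (masks (length g)) (λ m → f (subG m g , quotG m g))
      ≈⟨ sumL-cong (masks (length g)) (λ m → f-inv _ _ _ _ (proj₁ (same-parts m)) (proj₂ (same-parts m))) ⟩
    sumL (masks (length g)) (λ m → f (subG m g' , quotG m g'))
      ≈⟨ reflexive (≡.cong (λ n → sumL (masks n) _) (canon-length g g' g≅g')) ⟩
    sumL (masks (length g')) (λ m → f (subG m g' , quotG m g')) ≈⟨ sym (pair-Δ g' f) ⟩
    pair (Δ g') f                                         ∎
    where
    g≅g' = iso⇒canon≡ g g' g~g'
    same-parts = canon-subG-quotG-cong g g' g≅g'

  ε-wd : ∀ g g' → isoᵇ g g' ≡ true → ε g ≈ ε g'
  ε-wd g g' g~g' with canon-length g g' (iso⇒canon≡ g g' g~g')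
  ε-wd [] [] _ | _ = refl
  ε-wd (_ ∷ _) (_ ∷ _) _ | _ = refl

  sumΔ-coassoc : ∀ g Ψ → Invariant₃ Ψ →
    sumΔ g (λ a b → sumΔ a (λ a' b' → Ψ a' b' b)) ≈ sumΔ g (λ a b → sumΔ b (λ b' b'' → Ψ a b' b''))
  sumΔ-coassoc g Ψ Ψ-inv = begin
    sumL (masks (length g)) (λ m → sumL (masks (length (subG m g))) (λ m' → Ψ (subG m' (subG m g)) (quotG m' (subG m g)) (quotG m g)))
      ≈⟨ sumL-nestedL g (λ m m' → Ψ (subG m' (subG m g)) (quotG m' (subG m g)) (quotG m g)) ⟩
    sumL (tmasks (length g)) (λ t → Ψ (subG (innerL t) (subG (outerL t) g)) (quotG (innerL t) (subG (outerL t) g)) (quotG (outerL t) g))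
      ≈⟨ sumL-cong∈ (tmasks (length g)) (λ t t∈ → let l = length-tmasks (length g) t∈ in
           Ψ-inv _ _ _ _ _ _ (≡.cong canon (subG-subG t g l)) (≡.cong canon (quotG-subG t g l)) (canon-quotG-quotG t g l)) ⟩
    sumL (tmasks (length g)) (λ t → Ψ (subG (outerR t) g) (subG (innerR t) (quotG (outerR t) g)) (quotG (innerR t) (quotG (outerR t) g)))
      ≈⟨ sym (sumL-nestedR g (λ m m' → Ψ (subG m g) (subG m' (quotG m g)) (quotG m' (quotG m g)))) ⟩
    sumL (masks (length g)) (λ m → sumL (masks (length (select false m g))) (λ m' → Ψ (subG m g) (subG m' (quotG m g)) (quotG m' (quotG m g))))
      ≈⟨ sumL-cong (masks (length g)) (λ m →
           reflexive (≡.cong (λ n → sumL (masks n) (λ m' → Ψ (subG m g) (subG m' (quotG m g)) (quotG m' (quotG m g))))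
                             (≡.sym (length-relabel (contractMap (subG m g)) (select false m g))))) ⟩
    sumL (masks (length g)) (λ m → sumL (masks (length (quotG m g))) (λ m' → Ψ (subG m g) (subG m' (quotG m g)) (quotG m' (quotG m g)))) ∎

  pair-[Δ⊗id]∘Δ : ∀ g f → pair (extend (λ p → vec (proj₁ (proj₁ p) , proj₂ (proj₁ p) , proj₂ p)) ((Δ ⊗map idB) (Δ g))) f
                           ≈ sumΔ g (λ a b → sumΔ a (λ a' b' → f (a' , b' , b)))
  pair-[Δ⊗id]∘Δ g f = begin
    pair (extend (λ p → vec (Φ-arg p)) ((Δ ⊗map idB) (Δ g))) f ≈⟨ pair-extend-vec Φ-arg ((Δ ⊗map idB) (Δ g)) f ⟩
    pair ((Δ ⊗map idB) (Δ g)) (λ p → f (Φ-arg p))              ≈⟨ pair-⊗ Δ idB (Δ g) _ ⟩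
    pair (Δ g) (λ p → pair (Δ (proj₁ p)) (λ x → pair (vec (proj₂ p)) (λ y → f (Φ-arg (x , y)))))
      ≈⟨ pair-cong (Δ g) (λ p → trans (pair-cong (Δ (proj₁ p)) (λ x → pair-vec (proj₂ p) (λ y → f (Φ-arg (x , y)))))
                                     (pair-Δ (proj₁ p) (λ x → f (Φ-arg (x , proj₂ p))))) ⟩
    pair (Δ g) (λ p → sumΔ (proj₁ p) (λ a' b' → f (a' , b' , proj₂ p))) ≈⟨ pair-Δ g _ ⟩
    sumΔ g (λ a b → sumΔ a (λ a' b' → f (a' , b' , b)))                 ∎
    where
    Φ-arg : (RawTAG × RawTAG) × RawTAG → RawTAG × RawTAG × RawTAG
    Φ-arg p = proj₁ (proj₁ p) , proj₂ (proj₁ p) , proj₂ p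

  pair-[id⊗Δ]∘Δ : ∀ g f → pair (extend (λ p → vec (proj₁ p , proj₁ (proj₂ p) , proj₂ (proj₂ p))) ((idB ⊗map Δ) (Δ g))) f
                           ≈ sumΔ g (λ a b → sumΔ b (λ b' b'' → f (a , b' , b'')))
  pair-[id⊗Δ]∘Δ g f = begin
    pair (extend (λ p → vec (Φ-arg p)) ((idB ⊗map Δ) (Δ g))) f ≈⟨ pair-extend-vec Φ-arg ((idB ⊗map Δ) (Δ g)) f ⟩
    pair ((idB ⊗map Δ) (Δ g)) (λ p → f (Φ-arg p))              ≈⟨ pair-⊗ idB Δ (Δ g) _ ⟩
    pair (Δ g) (λ p → pair (vec (proj₁ p)) (λ x → pair (Δ (proj₂ p)) (λ y → f (Φ-arg (x , y)))))
      ≈⟨ pair-cong (Δ g) (λ p → trans (pair-vec (proj₁ p) (λ x → pair (Δ (proj₂ p)) (λ y → f (Φ-arg (x , y)))))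
                                     (pair-Δ (proj₂ p) (λ y → f (Φ-arg (proj₁ p , y))))) ⟩
    pair (Δ g) (λ p → sumΔ (proj₂ p) (λ b' b'' → f (proj₁ p , b' , b''))) ≈⟨ pair-Δ g _ ⟩
    sumΔ g (λ a b → sumΔ b (λ b' b'' → f (a , b' , b'')))                 ∎
    where
    Φ-arg : RawTAG × (RawTAG × RawTAG) → RawTAG × RawTAG × RawTAG
    Φ-arg p = proj₁ p , proj₁ (proj₂ p) , proj₂ (proj₂ p)

  Δ-coassoc : ∀ g → extend (λ { ((a , b) , d) → vec (a , b , d) }) ((Δ ⊗map idB) (Δ g))
                    ≈H⊗H⊗H extend (λ { (a , (b , d)) → vec (a , b , d) }) ((idB ⊗map Δ) (Δ g))
  Δ-coassoc g = ≈H⊗H⊗H-intro (extend (λ p → vec (proj₁ (proj₁ p) , proj₂ (proj₁ p) , proj₂ p)) ((Δ ⊗map idB) (Δ g)))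
                              (extend (λ p → vec (proj₁ p , proj₁ (proj₂ p) , proj₂ (proj₂ p))) ((idB ⊗map Δ) (Δ g))) λ f f-inv →
    trans (pair-[Δ⊗id]∘Δ g f) (trans (sumΔ-coassoc g (λ a b d → f (a , b , d)) f-inv) (sym (pair-[id⊗Δ]∘Δ g f)))

  Δ-counitˡ : ∀ g → extend (λ { (a , b) → scaleV (ε a) (vec b) }) (Δ g) ≈H vec g
  Δ-counitˡ g = ≈H-intro (extend (λ p → scaleV (ε (proj₁ p)) (vec (proj₂ p))) (Δ g)) (vec g) λ f _ → begin
    pair (extend (λ p → scaleV (ε (proj₁ p)) (vec (proj₂ p))) (Δ g)) f ≈⟨ pair-extend (λ p → scaleV (ε (proj₁ p)) (vec (proj₂ p))) (Δ g) f ⟩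
    pair (Δ g) (λ p → pair (scaleV (ε (proj₁ p)) (vec (proj₂ p))) f)
      ≈⟨ pair-cong (Δ g) (λ p → trans (pair-scale (ε (proj₁ p)) (vec (proj₂ p)) f) (*-congˡ (pair-vec (proj₂ p) f))) ⟩
    pair (Δ g) (λ p → ε (proj₁ p) * f (proj₂ p))           ≈⟨ pair-Δ g _ ⟩
    sumL (allMasks g) (λ m → ε (subG m g) * f (quotG m g)) ≈⟨ sumL-ε-subG g (λ m → f (quotG m g)) ⟩
    f (quotG (zeros (length g)) g)                         ≈⟨ reflexive (≡.cong f (quotG-zeros g)) ⟩
    f g                                                    ≈⟨ sym (pair-vec g f) ⟩
    pair (vec g) f                                         ∎

  Δ-counitʳ : ∀ g → extend (λ { (a , b) → scaleV (ε b) (vec a) }) (Δ g) ≈H vec g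
  Δ-counitʳ g = ≈H-intro (extend (λ p → scaleV (ε (proj₂ p)) (vec (proj₁ p))) (Δ g)) (vec g) λ f _ → begin
    pair (extend (λ p → scaleV (ε (proj₂ p)) (vec (proj₁ p))) (Δ g)) f ≈⟨ pair-extend (λ p → scaleV (ε (proj₂ p)) (vec (proj₁ p))) (Δ g) f ⟩
    pair (Δ g) (λ p → pair (scaleV (ε (proj₂ p)) (vec (proj₁ p))) f)
      ≈⟨ pair-cong (Δ g) (λ p → trans (pair-scale (ε (proj₂ p)) (vec (proj₁ p)) f) (*-congˡ (pair-vec (proj₁ p) f))) ⟩
    pair (Δ g) (λ p → ε (proj₂ p) * f (proj₁ p))           ≈⟨ pair-Δ g _ ⟩
    sumL (allMasks g) (λ m → ε (quotG m g) * f (subG m g)) ≈⟨ sumL-ε-quotG g (λ m → f (subG m g)) ⟩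
    f (subG (ones (length g)) g)                           ≈⟨ reflexive (≡.cong f (subG-ones g)) ⟩
    f g                                                    ≈⟨ sym (pair-vec g f) ⟩
    pair (vec g) f                                         ∎

  length-⊔ᵍ : ∀ g h → length (g ⊔ᵍ h) ≡ length g +ℕ length h
  length-⊔ᵍ g h = ≡.trans (length-++ g) (≡.cong (length g +ℕ_) (length-map _ h))

  pair-·₂ : ∀ u v (f : RawTAG × RawTAG → Carrier) →
    pair (u ·₂ v) f ≈ pair u (λ p → pair v (λ q → f (proj₁ p ⊔ᵍ proj₁ q , proj₂ p ⊔ᵍ proj₂ q)))
  pair-·₂ u v f = trans (pair-extend (λ p → extend (λ q → vec (proj₁ p ⊔ᵍ proj₁ q , proj₂ p ⊔ᵍ proj₂ q)) v) u f)
    (pair-cong u (λ p → pair-extend-vec (λ q → (proj₁ p ⊔ᵍ proj₁ q , proj₂ p ⊔ᵍ proj₂ q)) v f))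

  -- A mask of g ⊔ᵍ h is a mask of g followed by a mask of h.
  Δ-multiplicative : ∀ g h → Δ (g ⊔ᵍ h) ≈H⊗H (Δ g ·₂ Δ h)
  Δ-multiplicative g h = ≈H⊗H-intro (Δ (g ⊔ᵍ h)) (Δ g ·₂ Δ h) λ f f-inv → begin
    pair (Δ (g ⊔ᵍ h)) f                    ≈⟨ pair-Δ (g ⊔ᵍ h) f ⟩
    sumL (masks (length (g ⊔ᵍ h))) (F f)    ≈⟨ reflexive (≡.cong (λ n → sumL (masks n) (F f)) (length-⊔ᵍ g h)) ⟩
    sumL (masks (length g +ℕ length h)) (F f) ≈⟨ sumL-masks-+ (length g) (length h) (F f) ⟩
    sumL (masks (length g)) (λ m₁ → sumL (masks (length h)) (λ m₂ → F f (m₁ ++ m₂)))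
      ≈⟨ sumL-cong∈ (masks (length g)) (λ m₁ m₁∈ → sumL-cong (masks (length h)) (λ m₂ →
           f-inv _ _ _ _ (canon-subG-⊔ᵍ g h m₁ m₂ (length-masks (length g) m₁∈))
                         (canon-quotG-⊔ᵍ g h m₁ m₂ (length-masks (length g) m₁∈)))) ⟩
    sumL (masks (length g)) (λ m₁ → sumL (masks (length h)) (λ m₂ → f (subG m₁ g ⊔ᵍ subG m₂ h , quotG m₁ g ⊔ᵍ quotG m₂ h)))
      ≈⟨ sym (sumL-cong (masks (length g)) (λ m₁ → pair-Δ h _)) ⟩
    sumΔ g (λ a b → pair (Δ h) (λ q → f (a ⊔ᵍ proj₁ q , b ⊔ᵍ proj₂ q))) ≈⟨ sym (pair-Δ g _) ⟩
    pair (Δ g) (λ p → pair (Δ h) (λ q → f (proj₁ p ⊔ᵍ proj₁ q , proj₂ p ⊔ᵍ proj₂ q))) ≈⟨ sym (pair-·₂ (Δ g) (Δ h) f) ⟩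
    pair (Δ g ·₂ Δ h) f                    ∎
    where
    F : (RawTAG × RawTAG → Carrier) → List Bool → Carrier
    F f m = f (subG m (g ⊔ᵍ h) , quotG m (g ⊔ᵍ h))

  ε-multiplicative : ∀ g h → ε (g ⊔ᵍ h) ≈ (ε g * ε h)
  ε-multiplicative [] [] = sym (*-identityˡ 1#)
  ε-multiplicative [] (_ ∷ _) = sym (*-identityˡ 0#)
  ε-multiplicative (_ ∷ _) h = sym (zeroˡ _)

  isBialgebra : IsBialgebra
  isBialgebra = record
    { m-wd = product-wd
    ; m-assoc = product-assoc
    ; m-unitˡ = product-unitˡ
    ; m-unitʳ = product-unitʳ
    ; Δ-wd = Δ-wd
    ; ε-wd = ε-wd
    ; coassoc = Δ-coassoc
    ; counitˡ = Δ-counitˡ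
    ; counitʳ = Δ-counitʳ
    ; Δ-mult = Δ-multiplicative
    ; Δ-unit = λ _ → refl
    ; ε-mult = ε-multiplicative
    ; ε-unit = refl
    }

module AntipodeConstruction {c ℓ : Level} (K : CommutativeRing c ℓ) where

  open Hopf K
  open CommutativeRing K
  open IsoInvariance
  open FormalSums K
  open ClassFunctions K
  open MaskSums K
  open BialgebraAxioms K
  open import Algebra.Properties.Ring ring using (-‿+-comm)
  open import Relation.Binary.Reasoning.Setoid setoid
  open import Data.Nat using (ℕ; zero; suc; s≤s) renaming (_≤_ to _≤ℕ_)
  open import Data.Nat.Properties using (≤-trans; ≤-refl; ≤-pred)
  open import Data.Bool using (Bool)
  open import Data.Product using (_×_; _,_; proj₁; proj₂)
  open import Data.List using (List; []; _∷_; _++_; map; length)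
  open import Data.List.Properties using (map-cong-local)
  open import Data.List.Membership.Propositional using (_∈_)
  import Data.List.Relation.Unary.All as All
  open import Relation.Binary.PropositionalEquality as ≡ using (_≡_)

  sum≈0⇒≈-+- : ∀ x y z → (x + y) + z ≈ 0# → x ≈ - y + - z
  sum≈0⇒≈-+- x y z sum≈0 = begin
    x                         ≈⟨ sym (+-identityʳ x) ⟩
    x + 0#                    ≈⟨ +-congˡ (sym (-‿inverseʳ (y + z))) ⟩
    x + ((y + z) + - (y + z)) ≈⟨ sym (+-assoc _ _ _) ⟩
    (x + (y + z)) + - (y + z) ≈⟨ +-congʳ (trans (sym (+-assoc _ _ _)) sum≈0) ⟩
    0# + - (y + z)            ≈⟨ +-identityˡ _ ⟩
    - (y + z)                 ≈⟨ sym (-‿+-comm y z) ⟩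
    - y + - z                 ∎

  ≈-+-⇒sum≈0 : ∀ x y z → x ≈ - y + - z → (x + y) + z ≈ 0#
  ≈-+-⇒sum≈0 x y z x≈ = begin
    (x + y) + z         ≈⟨ +-assoc _ _ _ ⟩
    x + (y + z)         ≈⟨ +-congʳ (trans x≈ (-‿+-comm y z)) ⟩
    - (y + z) + (y + z) ≈⟨ -‿inverseˡ _ ⟩
    0#                  ∎

  pair-scale-oneH : ∀ k f → pair (scaleV k oneH) f ≈ k * f []
  pair-scale-oneH k f = trans (pair-scale k oneH f) (*-congˡ (pair-vec [] f))

  pair-·vec : ∀ (u : H) q f → pair (u · vec q) f ≈ pair u (λ x → f (x ⊔ᵍ q))
  pair-·vec u q f = trans (pair-· u (vec q) f) (pair-cong u (λ x → pair-vec q (λ y → f (x ⊔ᵍ y))))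

  pair-vec· : ∀ (u : H) q f → pair (vec q · u) f ≈ pair u (λ y → f (q ⊔ᵍ y))
  pair-vec· u q f = trans (pair-· (vec q) u f) (pair-vec q (λ x → pair u (λ y → f (x ⊔ᵍ y))))

  strictSumΔ : RawTAG → (RawTAG → RawTAG → Carrier) → Carrier
  strictSumΔ g T = sumL (filterB isStrict (allMasks g)) (λ m → T (subG m g) (quotG m g))

  strictSumΔ-length : ∀ {g g'} → length g ≡ length g' → (F : List Bool → Carrier) →
                      sumL (filterB isStrict (allMasks g)) F ≈ sumL (filterB isStrict (allMasks g')) F
  strictSumΔ-length len F = reflexive (≡.cong (λ n → sumL (filterB isStrict (masks n)) F) len)

  sumΔ-split : ∀ e es (T : RawTAG → RawTAG → Carrier) →
               sumΔ (e ∷ es) T ≈ (T (e ∷ es) [] + T [] (e ∷ es)) + strictSumΔ (e ∷ es) T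
  sumΔ-split e es T = trans (sumL-allMasks-split e es (λ m → T (subG m g) (quotG m g)))
    (+-congʳ (+-cong (reflexive (≡.cong₂ T (subG-ones g) (quotG-ones g))) (reflexive (≡.cong₂ T (subG-zeros g) (quotG-zeros g)))))
    where g = e ∷ es

  pair-recursion : ∀ g (F : RawTAG × RawTAG → H) f →
    pair ((-V vec g) +V (-V sumV (map F (strictSubPairs g)))) f ≈ - f g + - strictSumΔ g (λ a b → pair (F (a , b)) f)
  pair-recursion g F f = begin
    pair ((-V vec g) ++ (-V sumV (map F (strictSubPairs g)))) f   ≈⟨ pair-++ (-V vec g) (-V sumV (map F (strictSubPairs g))) f ⟩
    pair (-V vec g) f + pair (-V sumV (map F (strictSubPairs g))) f ≈⟨ +-cong (pair-neg (vec g) f) (pair-neg (sumV (map F (strictSubPairs g))) f) ⟩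
    - pair (vec g) f + - pair (sumV (map F (strictSubPairs g))) f ≈⟨ +-cong (-‿cong (pair-vec g f)) (-‿cong (pair-sumV (map F (strictSubPairs g)) f)) ⟩
    - f g + - sumL (map F (strictSubPairs g)) (λ u → pair u f)
      ≈⟨ +-congˡ (-‿cong (reflexive (≡.trans (sumL-map F (strictSubPairs g) (λ u → pair u f))
                                                (sumL-map (λ m → (subG m g , quotG m g)) (filterB isStrict (allMasks g)) (λ p → pair (F p) f))))) ⟩
    - f g + - strictSumΔ g (λ a b → pair (F (a , b)) f)             ∎

  pair-convˡ : ∀ (S : RawTAG → H) t f → pair (conv S idB t) f ≈ sumΔ t (λ a b → pair (S a) (λ x → f (x ⊔ᵍ b)))
  pair-convˡ S t f = trans (pair-conv S idB t f)
    (sumL-cong (allMasks t) (λ m → pair-cong (S (subG m t)) (λ x → pair-vec (quotG m t) (λ y → f (x ⊔ᵍ y)))))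

  pair-convʳ : ∀ (S : RawTAG → H) t f → pair (conv idB S t) f ≈ sumΔ t (λ a b → pair (S b) (λ y → f (a ⊔ᵍ y)))
  pair-convʳ S t f = trans (pair-conv idB S t f)
    (sumL-cong (allMasks t) (λ m → pair-vec (subG m t) (λ x → pair (S (quotG m t)) (λ y → f (x ⊔ᵍ y)))))

  -- The recursions are on the number of edges; the fuel k only has to bound it (Sˡ[]-fuel).
  Sˡ[_] Sʳ[_] : ℕ → RawTAG → H
  Sˡ[ zero ] g = oneH
  Sˡ[ suc k ] [] = oneH
  Sˡ[ suc k ] (e ∷ es) = (-V vec (e ∷ es)) +V (-V sumV (map (λ p → Sˡ[ k ] (proj₁ p) · vec (proj₂ p)) (strictSubPairs (e ∷ es))))
  Sʳ[ zero ] g = oneH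
  Sʳ[ suc k ] [] = oneH
  Sʳ[ suc k ] (e ∷ es) = (-V vec (e ∷ es)) +V (-V sumV (map (λ p → vec (proj₁ p) · Sʳ[ k ] (proj₂ p)) (strictSubPairs (e ∷ es))))

  Sˡ Sʳ : RawTAG → H
  Sˡ g = Sˡ[ length g ] g
  Sʳ g = Sʳ[ length g ] g

  Sˡ[]-fuel : ∀ k k' g → length g ≤ℕ k → length g ≤ℕ k' → Sˡ[ k ] g ≡ Sˡ[ k' ] g
  Sˡ[]-fuel zero zero g _ _ = ≡.refl
  Sˡ[]-fuel zero (suc k') [] _ _ = ≡.refl
  Sˡ[]-fuel (suc k) zero [] _ _ = ≡.refl
  Sˡ[]-fuel (suc k) (suc k') [] _ _ = ≡.refl
  Sˡ[]-fuel (suc k) (suc k') (e ∷ es) len≤k len≤k' = ≡.cong (λ z → (-V vec (e ∷ es)) +V (-V sumV z))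
    (map-cong-local (All.tabulate λ {p} p∈ → let smaller = proj₁ (strictSubPairs-smaller (e ∷ es) p∈) in
       ≡.cong (_· vec (proj₂ p)) (Sˡ[]-fuel k k' (proj₁ p) (≤-pred (≤-trans smaller len≤k)) (≤-pred (≤-trans smaller len≤k')))))

  Sʳ[]-fuel : ∀ k k' g → length g ≤ℕ k → length g ≤ℕ k' → Sʳ[ k ] g ≡ Sʳ[ k' ] g
  Sʳ[]-fuel zero zero g _ _ = ≡.refl
  Sʳ[]-fuel zero (suc k') [] _ _ = ≡.refl
  Sʳ[]-fuel (suc k) zero [] _ _ = ≡.refl
  Sʳ[]-fuel (suc k) (suc k') [] _ _ = ≡.refl
  Sʳ[]-fuel (suc k) (suc k') (e ∷ es) len≤k len≤k' = ≡.cong (λ z → (-V vec (e ∷ es)) +V (-V sumV z))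
    (map-cong-local (All.tabulate λ {p} p∈ → let smaller = proj₂ (strictSubPairs-smaller (e ∷ es) p∈) in
       ≡.cong (vec (proj₁ p) ·_) (Sʳ[]-fuel k k' (proj₂ p) (≤-pred (≤-trans smaller len≤k)) (≤-pred (≤-trans smaller len≤k')))))

  Sˡ-unfold : ∀ e es →
    Sˡ (e ∷ es) ≡ (-V vec (e ∷ es)) +V (-V sumV (map (λ p → Sˡ (proj₁ p) · vec (proj₂ p)) (strictSubPairs (e ∷ es))))
  Sˡ-unfold e es = ≡.cong (λ z → (-V vec (e ∷ es)) +V (-V sumV z))
    (map-cong-local (All.tabulate λ {p} p∈ →
       ≡.cong (_· vec (proj₂ p)) (Sˡ[]-fuel (length es) (length (proj₁ p)) (proj₁ p)
                                   (≤-pred (proj₁ (strictSubPairs-smaller (e ∷ es) p∈))) ≤-refl)))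

  Sʳ-unfold : ∀ e es →
    Sʳ (e ∷ es) ≡ (-V vec (e ∷ es)) +V (-V sumV (map (λ p → vec (proj₁ p) · Sʳ (proj₂ p)) (strictSubPairs (e ∷ es))))
  Sʳ-unfold e es = ≡.cong (λ z → (-V vec (e ∷ es)) +V (-V sumV z))
    (map-cong-local (All.tabulate λ {p} p∈ →
       ≡.cong (vec (proj₁ p) ·_) (Sʳ[]-fuel (length es) (length (proj₂ p)) (proj₂ p)
                                   (≤-pred (proj₂ (strictSubPairs-smaller (e ∷ es) p∈))) ≤-refl)))

  pair-Sˡ : ∀ e es f →
    pair (Sˡ (e ∷ es)) f ≈ - f (e ∷ es) + - strictSumΔ (e ∷ es) (λ a b → pair (Sˡ a) (λ x → f (x ⊔ᵍ b)))
  pair-Sˡ e es f = trans (reflexive (≡.cong (λ u → pair u f) (Sˡ-unfold e es)))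
    (trans (pair-recursion (e ∷ es) (λ p → Sˡ (proj₁ p) · vec (proj₂ p)) f)
      (+-congˡ (-‿cong (sumL-cong (filterB isStrict (allMasks (e ∷ es))) (λ m → pair-·vec (Sˡ (subG m (e ∷ es))) (quotG m (e ∷ es)) f)))))

  pair-Sʳ : ∀ e es f →
    pair (Sʳ (e ∷ es)) f ≈ - f (e ∷ es) + - strictSumΔ (e ∷ es) (λ a b → pair (Sʳ b) (λ y → f (a ⊔ᵍ y)))
  pair-Sʳ e es f = trans (reflexive (≡.cong (λ u → pair u f) (Sʳ-unfold e es)))
    (trans (pair-recursion (e ∷ es) (λ p → vec (proj₁ p) · Sʳ (proj₂ p)) f)
      (+-congˡ (-‿cong (sumL-cong (filterB isStrict (allMasks (e ∷ es))) (λ m → pair-vec· (Sʳ (quotG m (e ∷ es))) (subG m (e ∷ es)) f)))))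

  Sˡ-convˡ : ∀ g → conv Sˡ idB g ≈H scaleV (ε g) oneH
  Sˡ-convˡ [] = ≈H-intro (conv Sˡ idB []) (scaleV (ε []) oneH) λ f _ →
    trans (pair-convˡ Sˡ [] f) (trans (+-identityʳ _) (trans (pair-vec [] (λ x → f (x ⊔ᵍ []))) (sym (trans (pair-scale-oneH 1# f) (*-identityˡ _)))))
  Sˡ-convˡ (e ∷ es) = ≈H-intro (conv Sˡ idB g) (scaleV (ε g) oneH) λ f f-inv → begin
    pair (conv Sˡ idB g) f                      ≈⟨ pair-convˡ Sˡ g f ⟩
    sumΔ g (T f)                                ≈⟨ sumΔ-split e es (T f) ⟩
    (T f g [] + T f [] g) + strictSumΔ g (T f)
      ≈⟨ +-congʳ (+-cong (pair-cong (Sˡ g) (λ x → reflexive (≡.cong f (⊔ᵍ-identityʳ x))))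
                         (trans (pair-vec [] (λ x → f (x ⊔ᵍ g))) (f-inv ([] ⊔ᵍ g) g (canon-⊔ᵍ-identityˡ g)))) ⟩
    (pair (Sˡ g) f + f g) + strictSumΔ g (T f) ≈⟨ ≈-+-⇒sum≈0 _ _ _ (pair-Sˡ e es f) ⟩
    0#                                          ≈⟨ sym (trans (pair-scale-oneH 0# f) (zeroˡ _)) ⟩
    pair (scaleV (ε g) oneH) f                  ∎
    where
    g = e ∷ es
    T : (RawTAG → Carrier) → RawTAG → RawTAG → Carrier
    T f a b = pair (Sˡ a) (λ x → f (x ⊔ᵍ b))

  Sʳ-convʳ : ∀ g → conv idB Sʳ g ≈H scaleV (ε g) oneH
  Sʳ-convʳ [] = ≈H-intro (conv idB Sʳ []) (scaleV (ε []) oneH) λ f _ →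
    trans (pair-convʳ Sʳ [] f) (trans (+-identityʳ _) (trans (pair-vec [] (λ y → f ([] ⊔ᵍ y))) (sym (trans (pair-scale-oneH 1# f) (*-identityˡ _)))))
  Sʳ-convʳ (e ∷ es) = ≈H-intro (conv idB Sʳ g) (scaleV (ε g) oneH) λ f f-inv → begin
    pair (conv idB Sʳ g) f                      ≈⟨ pair-convʳ Sʳ g f ⟩
    sumΔ g (T f)                                ≈⟨ sumΔ-split e es (T f) ⟩
    (T f g [] + T f [] g) + strictSumΔ g (T f)
      ≈⟨ +-congʳ (trans (+-comm _ _) (+-cong (pair-cong (Sʳ g) (λ y → f-inv ([] ⊔ᵍ y) y (canon-⊔ᵍ-identityˡ y)))
                                              (trans (pair-vec [] (λ y → f (g ⊔ᵍ y))) (reflexive (≡.cong f (⊔ᵍ-identityʳ g)))))) ⟩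
    (pair (Sʳ g) f + f g) + strictSumΔ g (T f) ≈⟨ ≈-+-⇒sum≈0 _ _ _ (pair-Sʳ e es f) ⟩
    0#                                          ≈⟨ sym (trans (pair-scale-oneH 0# f) (zeroˡ _)) ⟩
    pair (scaleV (ε g) oneH) f                  ∎
    where
    g = e ∷ es
    T : (RawTAG → Carrier) → RawTAG → RawTAG → Carrier
    T f a b = pair (Sʳ b) (λ y → f (a ⊔ᵍ y))

  Sˡ-wd : ∀ n g g' → length g ≤ℕ n → canon g ≡ canon g' → Sˡ g ≈H Sˡ g'
  Sˡ-wd n g g' len≤n g≅g' with canon-length g g' g≅g'
  Sˡ-wd n [] [] _ _ | _ = λ _ → refl
  Sˡ-wd (suc n) (e ∷ es) (e' ∷ es') (s≤s len≤n) g≅g' | same-length = ≈H-intro (Sˡ g) (Sˡ g') λ f f-inv → begin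
    pair (Sˡ g) f                     ≈⟨ pair-Sˡ e es f ⟩
    - f g + - strictSumΔ g (T f)
      ≈⟨ +-cong (-‿cong (f-inv g g' g≅g'))
                (-‿cong (trans (sumL-cong∈ (filterB isStrict (allMasks g)) (λ m m∈ → parts≈ f f-inv m m∈))
                               (strictSumΔ-length {g} {g'} same-length (λ m → T f (subG m g') (quotG m g'))))) ⟩
    - f g' + - strictSumΔ g' (T f)    ≈⟨ sym (pair-Sˡ e' es' f) ⟩
    pair (Sˡ g') f                    ∎
    where
    g = e ∷ es
    g' = e' ∷ es'
    T : (RawTAG → Carrier) → RawTAG → RawTAG → Carrier
    T f a b = pair (Sˡ a) (λ x → f (x ⊔ᵍ b))
    parts≈ : ∀ f → Invariant f → ∀ m → m ∈ filterB isStrict (allMasks g) →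
      T f (subG m g) (quotG m g) ≈ T f (subG m g') (quotG m g')
    parts≈ f f-inv m m∈ =
      trans (≈H-elim (Sˡ (subG m g)) (Sˡ (subG m g'))
                     (Sˡ-wd n (subG m g) (subG m g') (≤-pred (≤-trans (proj₁ (strict-smaller g m∈)) (s≤s len≤n)))
                            (proj₁ (canon-subG-quotG-cong g g' g≅g' m)))
                     (Invariant-⊔ˡ f-inv (quotG m g)))
            (pair-cong (Sˡ (subG m g')) (λ x → f-inv _ _ (canon-⊔ᵍ-cong x x (quotG m g) (quotG m g') ≡.refl
                                                                        (proj₂ (canon-subG-quotG-cong g g' g≅g' m)))))

  Sʳ-wd : ∀ n g g' → length g ≤ℕ n → canon g ≡ canon g' → Sʳ g ≈H Sʳ g'
  Sʳ-wd n g g' len≤n g≅g' with canon-length g g' g≅g'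
  Sʳ-wd n [] [] _ _ | _ = λ _ → refl
  Sʳ-wd (suc n) (e ∷ es) (e' ∷ es') (s≤s len≤n) g≅g' | same-length = ≈H-intro (Sʳ g) (Sʳ g') λ f f-inv → begin
    pair (Sʳ g) f                     ≈⟨ pair-Sʳ e es f ⟩
    - f g + - strictSumΔ g (T f)
      ≈⟨ +-cong (-‿cong (f-inv g g' g≅g'))
                (-‿cong (trans (sumL-cong∈ (filterB isStrict (allMasks g)) (λ m m∈ → parts≈ f f-inv m m∈))
                               (strictSumΔ-length {g} {g'} same-length (λ m → T f (subG m g') (quotG m g'))))) ⟩
    - f g' + - strictSumΔ g' (T f)    ≈⟨ sym (pair-Sʳ e' es' f) ⟩
    pair (Sʳ g') f                    ∎
    where
    g = e ∷ es
    g' = e' ∷ es'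
    T : (RawTAG → Carrier) → RawTAG → RawTAG → Carrier
    T f a b = pair (Sʳ b) (λ y → f (a ⊔ᵍ y))
    parts≈ : ∀ f → Invariant f → ∀ m → m ∈ filterB isStrict (allMasks g) →
      T f (subG m g) (quotG m g) ≈ T f (subG m g') (quotG m g')
    parts≈ f f-inv m m∈ =
      trans (≈H-elim (Sʳ (quotG m g)) (Sʳ (quotG m g'))
                     (Sʳ-wd n (quotG m g) (quotG m g') (≤-pred (≤-trans (proj₂ (strict-smaller g m∈)) (s≤s len≤n)))
                            (proj₂ (canon-subG-quotG-cong g g' g≅g' m)))
                     (Invariant-⊔ʳ f-inv (subG m g)))
            (pair-cong (Sʳ (quotG m g')) (λ y → f-inv _ _ (canon-⊔ᵍ-cong (subG m g) (subG m g') y y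
                                                                        (proj₁ (canon-subG-quotG-cong g g' g≅g' m)) ≡.refl)))

  -- Sʳ = (Sˡ ⋆ id) ⋆ Sʳ = Sˡ ⋆ (id ⋆ Sʳ) = Sˡ, the middle step being sumΔ-coassoc.
  module _ (f : RawTAG → Carrier) (f-inv : Invariant f) where

    Ψ : RawTAG → RawTAG → RawTAG → Carrier
    Ψ a b d = pair (Sˡ a) (λ x → pair (Sʳ d) (λ z → f (x ⊔ᵍ (b ⊔ᵍ z))))

    Ψ-invariant : Invariant₃ Ψ
    Ψ-invariant a b d a' b' d' a≅a' b≅b' d≅d' = trans
      (≈H-elim (Sˡ a) (Sˡ a') (Sˡ-wd (length a) a a' ≤-refl a≅a') {λ x → pair (Sʳ d) (λ z → f (x ⊔ᵍ (b ⊔ᵍ z)))}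
         (λ x x' x≅x' → pair-cong (Sʳ d) (λ z → f-inv _ _ (canon-⊔ᵍ-cong x x' (b ⊔ᵍ z) (b ⊔ᵍ z) x≅x' ≡.refl))))
      (pair-cong (Sˡ a') (λ x → trans
         (≈H-elim (Sʳ d) (Sʳ d') (Sʳ-wd (length d) d d' ≤-refl d≅d') {λ z → f (x ⊔ᵍ (b ⊔ᵍ z))}
            (λ z z' z≅z' → f-inv _ _ (canon-⊔ᵍ-cong x x (b ⊔ᵍ z) (b ⊔ᵍ z') ≡.refl (canon-⊔ᵍ-cong b b z z' ≡.refl z≅z'))))
         (pair-cong (Sʳ d') (λ z → f-inv _ _ (canon-⊔ᵍ-cong x x (b ⊔ᵍ z) (b' ⊔ᵍ z) ≡.refl (canon-⊔ᵍ-cong b b' z z b≅b' ≡.refl))))))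

    Sʳ-after : RawTAG → RawTAG → Carrier
    Sʳ-after b w = pair (Sʳ b) (λ z → f (w ⊔ᵍ z))

    sumΔ-Sˡ⋆id : ∀ a b → sumΔ a (λ a' b' → Ψ a' b' b) ≈ ε a * Sʳ-after b []
    sumΔ-Sˡ⋆id a b = begin
      sumΔ a (λ a' b' → Ψ a' b' b)
        ≈⟨ sumL-cong (allMasks a) (λ m → pair-cong (Sˡ (subG m a)) (λ x → pair-cong (Sʳ b) (λ z →
             f-inv _ _ (≡.sym (canon-⊔ᵍ-assoc x (quotG m a) z))))) ⟩
      sumΔ a (λ a' b' → pair (Sˡ a') (λ x → Sʳ-after b (x ⊔ᵍ b'))) ≈⟨ sym (pair-convˡ Sˡ a (Sʳ-after b)) ⟩
      pair (conv Sˡ idB a) (Sʳ-after b)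
        ≈⟨ ≈H-elim (conv Sˡ idB a) (scaleV (ε a) oneH) (Sˡ-convˡ a)
                   (λ w w' w≅w' → pair-cong (Sʳ b) (λ z → f-inv _ _ (canon-⊔ᵍ-cong w w' z z w≅w' ≡.refl))) ⟩
      pair (scaleV (ε a) oneH) (Sʳ-after b) ≈⟨ pair-scale-oneH (ε a) (Sʳ-after b) ⟩
      ε a * Sʳ-after b []                   ∎

    [Sˡ⋆id]⋆Sʳ : ∀ g → sumΔ g (λ a b → sumΔ a (λ a' b' → Ψ a' b' b)) ≈ pair (Sʳ g) f
    [Sˡ⋆id]⋆Sʳ g = begin
      sumΔ g (λ a b → sumΔ a (λ a' b' → Ψ a' b' b)) ≈⟨ sumL-cong (allMasks g) (λ m → sumΔ-Sˡ⋆id (subG m g) (quotG m g)) ⟩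
      sumL (allMasks g) (λ m → ε (subG m g) * Sʳ-after (quotG m g) []) ≈⟨ sumL-ε-subG g (λ m → Sʳ-after (quotG m g) []) ⟩
      Sʳ-after (quotG (zeros (length g)) g) []      ≈⟨ reflexive (≡.cong (λ z → Sʳ-after z []) (quotG-zeros g)) ⟩
      Sʳ-after g []                                 ≈⟨ pair-cong (Sʳ g) (λ z → f-inv _ _ (canon-⊔ᵍ-identityˡ z)) ⟩
      pair (Sʳ g) f                                 ∎

    sumΔ-id⋆Sʳ : ∀ a b → sumΔ b (λ b' b'' → Ψ a b' b'') ≈ ε b * pair (Sˡ a) f
    sumΔ-id⋆Sʳ a b = begin
      sumL (allMasks b) (λ m → pair (Sˡ a) (λ x → pair (Sʳ (quotG m b)) (λ z → f (x ⊔ᵍ (subG m b ⊔ᵍ z)))))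
        ≈⟨ sym (pair-sumL (Sˡ a) (allMasks b) (λ m x → pair (Sʳ (quotG m b)) (λ z → f (x ⊔ᵍ (subG m b ⊔ᵍ z))))) ⟩
      pair (Sˡ a) (λ x → sumΔ b (λ b' b'' → pair (Sʳ b'') (λ z → f (x ⊔ᵍ (b' ⊔ᵍ z)))))
        ≈⟨ pair-cong (Sˡ a) id⋆Sʳ ⟩
      pair (Sˡ a) (λ x → ε b * f x) ≈⟨ pair-*ˡ (Sˡ a) (ε b) f ⟩
      ε b * pair (Sˡ a) f           ∎
      where
      id⋆Sʳ : ∀ x → sumΔ b (λ b' b'' → pair (Sʳ b'') (λ z → f (x ⊔ᵍ (b' ⊔ᵍ z)))) ≈ ε b * f x
      id⋆Sʳ x = begin
        sumΔ b (λ b' b'' → pair (Sʳ b'') (λ z → f (x ⊔ᵍ (b' ⊔ᵍ z)))) ≈⟨ sym (pair-convʳ Sʳ b (λ w → f (x ⊔ᵍ w))) ⟩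
        pair (conv idB Sʳ b) (λ w → f (x ⊔ᵍ w))
          ≈⟨ ≈H-elim (conv idB Sʳ b) (scaleV (ε b) oneH) (Sʳ-convʳ b) (Invariant-⊔ʳ f-inv x) ⟩
        pair (scaleV (ε b) oneH) (λ w → f (x ⊔ᵍ w)) ≈⟨ pair-scale-oneH (ε b) (λ w → f (x ⊔ᵍ w)) ⟩
        ε b * f (x ⊔ᵍ [])                            ≈⟨ *-congˡ (reflexive (≡.cong f (⊔ᵍ-identityʳ x))) ⟩
        ε b * f x                                    ∎

    Sˡ⋆[id⋆Sʳ] : ∀ g → sumΔ g (λ a b → sumΔ b (λ b' b'' → Ψ a b' b'')) ≈ pair (Sˡ g) f
    Sˡ⋆[id⋆Sʳ] g = begin
      sumΔ g (λ a b → sumΔ b (λ b' b'' → Ψ a b' b'')) ≈⟨ sumL-cong (allMasks g) (λ m → sumΔ-id⋆Sʳ (subG m g) (quotG m g)) ⟩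
      sumL (allMasks g) (λ m → ε (quotG m g) * pair (Sˡ (subG m g)) f) ≈⟨ sumL-ε-quotG g (λ m → pair (Sˡ (subG m g)) f) ⟩
      pair (Sˡ (subG (ones (length g)) g)) f          ≈⟨ reflexive (≡.cong (λ z → pair (Sˡ z) f) (subG-ones g)) ⟩
      pair (Sˡ g) f                                   ∎

    pair-Sˡ≈pair-Sʳ : ∀ g → pair (Sˡ g) f ≈ pair (Sʳ g) f
    pair-Sˡ≈pair-Sʳ g = trans (sym (Sˡ⋆[id⋆Sʳ] g)) (trans (sym (sumΔ-coassoc g Ψ Ψ-invariant)) ([Sˡ⋆id]⋆Sʳ g))

  Sˡ≈Sʳ : ∀ g → Sˡ g ≈H Sʳ g
  Sˡ≈Sʳ g = ≈H-intro (Sˡ g) (Sʳ g) (λ f f-inv → pair-Sˡ≈pair-Sʳ f f-inv g)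

  Sˡ-convʳ : ∀ g → conv idB Sˡ g ≈H scaleV (ε g) oneH
  Sˡ-convʳ g = ≈H-intro (conv idB Sˡ g) (scaleV (ε g) oneH) λ f f-inv → begin
    pair (conv idB Sˡ g) f                           ≈⟨ pair-convʳ Sˡ g f ⟩
    sumΔ g (λ a b → pair (Sˡ b) (λ y → f (a ⊔ᵍ y)))
      ≈⟨ sumL-cong (allMasks g) (λ m → ≈H-elim (Sˡ (quotG m g)) (Sʳ (quotG m g)) (Sˡ≈Sʳ (quotG m g)) (Invariant-⊔ʳ f-inv (subG m g))) ⟩
    sumΔ g (λ a b → pair (Sʳ b) (λ y → f (a ⊔ᵍ y))) ≈⟨ sym (pair-convʳ Sʳ g f) ⟩
    pair (conv idB Sʳ g) f                           ≈⟨ ≈H-elim (conv idB Sʳ g) (scaleV (ε g) oneH) (Sʳ-convʳ g) f-inv ⟩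
    pair (scaleV (ε g) oneH) f                       ∎

  Sˡ-isAntipode : IsAntipode Sˡ
  Sˡ-isAntipode = record
    { S-wd = λ g g' g~g' → Sˡ-wd (length g) g g' ≤-refl (iso⇒canon≡ g g' g~g')
    ; S-left = Sˡ-convˡ
    ; S-right = Sˡ-convʳ
    }

module AntipodeRecursion {c ℓ : Level} (K : CommutativeRing c ℓ) (S : RawTAG → Hopf.H K) (S-antipode : Hopf.IsAntipode K S) where

  open Hopf K
  open IsAntipode S-antipode
  open CommutativeRing K
  open IsoInvariance
  open FormalSums K
  open ClassFunctions K
  open MaskSums K using (isStrict)
  open AntipodeConstruction K
  open import Relation.Binary.Reasoning.Setoid setoid
  open import Data.Product using (_,_; proj₁; proj₂)
  open import Data.List using ([]; _∷_; map)
  open import Relation.Binary.PropositionalEquality as ≡ using (_≡_)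

  S-empty : S [] ≈H oneH
  S-empty = ≈H-intro (S []) oneH λ f f-inv → begin
    pair (S []) f                                   ≈⟨ sym (trans (+-identityʳ _) (pair-cong (S []) (λ x → reflexive (≡.cong f (⊔ᵍ-identityʳ x))))) ⟩
    sumΔ [] (λ a b → pair (S a) (λ x → f (x ⊔ᵍ b))) ≈⟨ sym (pair-convˡ S [] f) ⟩
    pair (conv S idB []) f                          ≈⟨ ≈H-elim (conv S idB []) (scaleV (ε []) oneH) (S-left []) f-inv ⟩
    pair (scaleV 1# oneH) f                         ≈⟨ trans (pair-scale-oneH 1# f) (*-identityˡ _) ⟩
    f []                                            ≈⟨ sym (pair-vec [] f) ⟩
    pair oneH f                                     ∎

  -- At a non-empty g the counit vanishes, so the convolution identity S ⋆ id = ε 1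
  -- isolates the term S g ⊔ᵍ [] among the terms of Δ g.
  recursionˡ : ∀ e es →
    S (e ∷ es) ≈H ((-V vec (e ∷ es)) +V (-V sumV (map (λ p → S (proj₁ p) · vec (proj₂ p)) (strictSubPairs (e ∷ es)))))
  recursionˡ e es = ≈H-intro (S g) ((-V vec g) +V (-V sumV (map (λ p → S (proj₁ p) · vec (proj₂ p)) (strictSubPairs g)))) λ f f-inv → begin
    pair (S g) f                 ≈⟨ sum≈0⇒≈-+- _ _ _ (S⋆id≈0 f f-inv) ⟩
    - f g + - strictSumΔ g (T f)
      ≈⟨ +-congˡ (-‿cong (sumL-cong (filterB isStrict (allMasks g)) (λ m → sym (pair-·vec (S (subG m g)) (quotG m g) f)))) ⟩
    - f g + - strictSumΔ g (λ a b → pair (S a · vec b) f) ≈⟨ sym (pair-recursion g (λ p → S (proj₁ p) · vec (proj₂ p)) f) ⟩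
    pair ((-V vec g) +V (-V sumV (map (λ p → S (proj₁ p) · vec (proj₂ p)) (strictSubPairs g)))) f ∎
    where
    g = e ∷ es
    T : (RawTAG → Carrier) → RawTAG → RawTAG → Carrier
    T f a b = pair (S a) (λ x → f (x ⊔ᵍ b))
    S⋆id≈0 : ∀ f → Invariant f → (pair (S g) f + f g) + strictSumΔ g (T f) ≈ 0#
    S⋆id≈0 f f-inv = begin
      (pair (S g) f + f g) + strictSumΔ g (T f)
        ≈⟨ +-congʳ (sym (+-cong (pair-cong (S g) (λ x → reflexive (≡.cong f (⊔ᵍ-identityʳ x))))
             (trans (≈H-elim (S []) oneH S-empty (Invariant-⊔ˡ f-inv g))
                    (trans (pair-vec [] (λ x → f (x ⊔ᵍ g))) (f-inv ([] ⊔ᵍ g) g (canon-⊔ᵍ-identityˡ g)))))) ⟩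
      (T f g [] + T f [] g) + strictSumΔ g (T f) ≈⟨ sym (sumΔ-split e es (T f)) ⟩
      sumΔ g (T f)                               ≈⟨ sym (pair-convˡ S g f) ⟩
      pair (conv S idB g) f                      ≈⟨ ≈H-elim (conv S idB g) (scaleV (ε g) oneH) (S-left g) f-inv ⟩
      pair (scaleV 0# oneH) f                    ≈⟨ trans (pair-scale-oneH 0# f) (zeroˡ _) ⟩
      0#                                         ∎

  recursionʳ : ∀ e es →
    S (e ∷ es) ≈H ((-V vec (e ∷ es)) +V (-V sumV (map (λ p → vec (proj₁ p) · S (proj₂ p)) (strictSubPairs (e ∷ es)))))
  recursionʳ e es = ≈H-intro (S g) ((-V vec g) +V (-V sumV (map (λ p → vec (proj₁ p) · S (proj₂ p)) (strictSubPairs g)))) λ f f-inv → begin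
    pair (S g) f                 ≈⟨ sum≈0⇒≈-+- _ _ _ (id⋆S≈0 f f-inv) ⟩
    - f g + - strictSumΔ g (T f)
      ≈⟨ +-congˡ (-‿cong (sumL-cong (filterB isStrict (allMasks g)) (λ m → sym (pair-vec· (S (quotG m g)) (subG m g) f)))) ⟩
    - f g + - strictSumΔ g (λ a b → pair (vec a · S b) f) ≈⟨ sym (pair-recursion g (λ p → vec (proj₁ p) · S (proj₂ p)) f) ⟩
    pair ((-V vec g) +V (-V sumV (map (λ p → vec (proj₁ p) · S (proj₂ p)) (strictSubPairs g)))) f ∎
    where
    g = e ∷ es
    T : (RawTAG → Carrier) → RawTAG → RawTAG → Carrier
    T f a b = pair (S b) (λ y → f (a ⊔ᵍ y))
    id⋆S≈0 : ∀ f → Invariant f → (pair (S g) f + f g) + strictSumΔ g (T f) ≈ 0#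
    id⋆S≈0 f f-inv = begin
      (pair (S g) f + f g) + strictSumΔ g (T f)
        ≈⟨ +-congʳ (trans (+-comm _ _) (sym (+-cong
             (trans (≈H-elim (S []) oneH S-empty (Invariant-⊔ʳ f-inv g))
                    (trans (pair-vec [] (λ y → f (g ⊔ᵍ y))) (reflexive (≡.cong f (⊔ᵍ-identityʳ g)))))
             (pair-cong (S g) (λ y → f-inv ([] ⊔ᵍ y) y (canon-⊔ᵍ-identityˡ y)))))) ⟩
      (T f g [] + T f [] g) + strictSumΔ g (T f) ≈⟨ sym (sumΔ-split e es (T f)) ⟩
      sumΔ g (T f)                               ≈⟨ sym (pair-convʳ S g f) ⟩
      pair (conv idB S g) f                      ≈⟨ ≈H-elim (conv idB S g) (scaleV (ε g) oneH) (S-right g) f-inv ⟩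
      pair (scaleV 0# oneH) f                    ≈⟨ trans (pair-scale-oneH 0# f) (zeroˡ _) ⟩
      0#                                         ∎

  antipodeFormulas : AntipodeFormulas S
  antipodeFormulas = record { S-one = S-empty ; S-rec-left = recursionˡ ; S-rec-right = recursionʳ }

mainTheorem8 : {c ℓ : Level} (K : CommutativeRing c ℓ) → IsField K → CharZero K →
    Hopf.IsBialgebra K
    × Σ (RawTAG → Hopf.H K) (λ S → Hopf.IsAntipode K S)
    × ((S : RawTAG → Hopf.H K) → Hopf.IsAntipode K S → Hopf.AntipodeFormulas K S)
mainTheorem8 K _ _ =
  BialgebraAxioms.isBialgebra K ,
  (AntipodeConstruction.Sˡ K , AntipodeConstruction.Sˡ-isAntipode K) ,
  (λ S S-antipode → AntipodeRecursion.antipodeFormulas K S S-antipode)
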